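{- Let $p$ be an odd prime, fix a generator $\gamma$ of $\mathbb{F}_{p^2}^{\times}$, let $E$ be an elliptic curve over an algebraically closed field of characteristic different from $p$, and let $\mathcal{G}=\mathrm{PGL}(E[p])$. The set of oriented $\gamma$-necklaces of $E$ is isomorphic as a $\mathcal{G}$-set to $\mathcal{G}/\mathcal{H}$, where $\mathcal{H}$ is any non-split Cartan subgroup of $\mathcal{G}$. Similarly, the set of $\gamma$-necklaces of $E$ is isomorphic as a $\mathcal{G}$-set to $\mathcal{G}/\mathcal{N}$, where $\mathcal{N}$ is the normaliser of a non-split Cartan subgroup of $\mathcal{G}$. In particular, there are exactly $p(p-1)$ oriented $\gamma$-necklaces and $p(p-1)/2$ $\gamma$-necklaces.
   Context: $\mathcal{C}_\gamma\subset\mathrm{PGL}(E[p])$ is the set of elements having a representative in $\mathrm{GL}(E[p])$ whose characteristic polynomial equals the minimal polynomial of $\gamma$ over $\mathbb{F}_p$. An oriented $\gamma$-necklace of $E$ is an equivalence class, under cyclic permutation, of lists $(C_0,\dots,C_p)$ enumerating all $p+1$ cyclic subgroups of order $p$ of $E[p]$, such that some $h\in\mathcal{C}_\gamma$ satisfies $h(C_i)=C_{i+1}$ for $i=0,\dots,p-1$. Let $w$ be the involution $w(C_0,C_1,\dots,C_p)=(C_p,C_{p-1},\dots,C_0)$ on oriented necklaces; a $\gamma$-necklace is a $w$-orbit $\{\mathfrak v,w(\mathfrak v)\}$. $\mathcal{G}$ acts by $g\cdot(C_0,\dots,C_p)=(g(C_0),\dots,g(C_p))$. A non-split Cartan subgroup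 of $\mathrm{GL}(E[p])$ is the image of $\mathbb{F}_{p^2}^{\times}$ acting by multiplication under some $\mathbb{F}_p$-linear isomorphism $E[p]\cong\mathbb{F}_{p^2}$; a non-split Cartan subgroup of $\mathrm{PGL}(E[p])$ is the image of such a subgroup. -}

module Defs where

open import Data.Nat using (ℕ; zero; suc; _∸_; NonZero)
import Data.Nat as N
open import Data.Nat.DivMod using (_mod_)
open import Data.Fin using (Fin; toℕ; inject₁; opposite)
import Data.Fin as F
open import Data.Product using (Σ; _×_; _,_; proj₁; ∃)
open import Data.Sum using (_⊎_)
open import Relation.Binary.PropositionalEquality using (_≡_; _≢_)
open import Relation.Nullary using (¬_)

-- Everything is relative to a modulus p (later assumed an odd prime).
-- E[p] is modelled by the 2-dimensional F_p-vector space F_p × F_p.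

module _ (p : ℕ) .{{nz : NonZero p}} where

  Fp : Set
  Fp = Fin p

  infixl 6 _+F_ _-F_ _+K_
  infixl 7 _*F_

  _+F_ : Fp → Fp → Fp
  a +F b = (toℕ a N.+ toℕ b) mod p

  _*F_ : Fp → Fp → Fp
  a *F b = (toℕ a N.* toℕ b) mod p

  -F_ : Fp → Fp
  -F a = (p ∸ toℕ a) mod p

  _-F_ : Fp → Fp → Fp
  a -F b = a +F (-F b)

  0F : Fp
  0F = 0 mod p

  1F : Fp
  1F = 1 mod p

  -- A model of F_{p^2}: F_p[α]/(α² - c α - d), the pair (x , y)
  -- standing for x + y α.  It is a field of p² elements exactly when
  -- X² - c X - d has no root in F_p.

  Irreducible : Fp → Fp → Set
  Irreducible c d = ∀ (t : Fp) → t *F t ≢ c *F t +F d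

  K : Set
  K = Fp × Fp

  embK : Fp → K
  embK a = a , 0F

  0K : K
  0K = 0F , 0F

  1K : K
  1K = 1F , 0F

  _+K_ : K → K → K
  (x₁ , y₁) +K (x₂ , y₂) = (x₁ +F x₂) , (y₁ +F y₂)

  mulK : (c d : Fp) → K → K → K
  mulK c d (x₁ , y₁) (x₂ , y₂) =
    (x₁ *F x₂ +F d *F (y₁ *F y₂)) , (x₁ *F y₂ +F x₂ *F y₁ +F c *F (y₁ *F y₂))

  powK : (c d : Fp) → K → ℕ → K
  powK c d z zero    = 1K
  powK c d z (suc n) = mulK c d z (powK c d z n)

  IsGenerator : (c d : Fp) → K → Set
  IsGenerator c d γ = (γ ≢ 0K) × (∀ (z : K) → z ≢ 0K → ∃ λ n → powK c d γ n ≡ z)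

  -- The monic quadratic X² + a₁ X + a₀ is the minimal polynomial of γ
  -- over F_p: it vanishes at γ, and no monic polynomial of smaller
  -- degree does (degree 0: the constant 1 never vanishes; degree 1:
  -- X + b vanishes at γ iff γ = -b ∈ F_p).
  IsMinPolyQuad : (c d : Fp) → K → Fp → Fp → Set
  IsMinPolyQuad c d γ a₁ a₀ =
    (mulK c d γ γ +K mulK c d (embK a₁) γ +K embK a₀ ≡ 0K)
    × (∀ (b : Fp) → γ +K embK b ≢ 0K)

  -- 2×2 matrices over F_p (endomorphisms of V = F_p × F_p, columns are
  -- images of the standard basis vectors).

  record Mat : Set where
    constructor mat
    field
      m₁₁ m₁₂ m₂₁ m₂₂ : Fp
  open Mat public

  V : Set
  V = Fp × Fp

  det : Mat → Fp
  det (mat a b c d) = a *F d -F b *F c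

  tr : Mat → Fp
  tr (mat a b c d) = a +F d

  infixl 7 _⊙_
  _⊙_ : Mat → Mat → Mat
  mat a b c d ⊙ mat a' b' c' d' =
    mat (a *F a' +F b *F c') (a *F b' +F b *F d')
        (c *F a' +F d *F c') (c *F b' +F d *F d')

  scale : Fp → Mat → Mat
  scale λ' (mat a b c d) = mat (λ' *F a) (λ' *F b) (λ' *F c) (λ' *F d)

  -- adjugate; in PGL the class of adj g is the inverse of the class of g
  adj : Mat → Mat
  adj (mat a b c d) = mat d (-F b) (-F c) a

  apply : Mat → V → V
  apply (mat a b c d) (x , y) = (a *F x +F b *F y) , (c *F x +F d *F y)

  scaleV : Fp → V → V
  scaleV λ' (x , y) = (λ' *F x) , (λ' *F y)

  Invertible : Mat → Set
  Invertible g = det g ≢ 0F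

  GL : Set
  GL = Σ Mat Invertible

  -- equality in PGL(V) = GL(V)/scalars
  _≈P_ : Mat → Mat → Set
  A ≈P B = Σ Fp λ λ' → (λ' ≢ 0F) × (A ≡ scale λ' B)

  CharpolyIsMinpoly : (c d : Fp) → K → Mat → Set
  CharpolyIsMinpoly c d γ M = IsMinPolyQuad c d γ (-F tr M) (det M)

  InCγ : (c d : Fp) → K → Mat → Set
  InCγ c d γ h = Σ Mat λ M → (M ≈P h) × CharpolyIsMinpoly c d γ M

  -- Cyclic subgroups of order p of V: ⟨v⟩ for v ≠ 0; ⟨v⟩ = ⟨w⟩ iff
  -- v is a nonzero multiple of w.

  0V : V
  0V = 0F , 0F

  _~L_ : V → V → Set
  v ~L w = Σ Fp λ λ' → (λ' ≢ 0F) × (v ≡ scaleV λ' w)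

  -- a list (C₀,…,C_p), each Cᵢ = ⟨vᵢ⟩ given by a generator vᵢ
  Lst : Set
  Lst = Fin (suc p) → V

  IsOrientedNecklace : (c d : Fp) → K → Lst → Set
  IsOrientedNecklace c d γ C =
    (∀ i → C i ≢ 0V)
    × (∀ i j → C i ~L C j → i ≡ j)
    × (∀ (v : V) → v ≢ 0V → ∃ λ i → v ~L C i)
    × (Σ Mat λ h → Invertible h × InCγ c d γ h
         × (∀ (i : Fin p) → apply h (C (inject₁ i)) ~L C (F.suc i)))

  ONecklace : (c d : Fp) → K → Set
  ONecklace c d γ = Σ Lst (IsOrientedNecklace c d γ)

  rot : Fin (suc p) → Lst → Lst
  rot k C i = C ((toℕ i N.+ toℕ k) mod suc p)

  _≈Lst_ : Lst → Lst → Set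
  C ≈Lst D = ∀ i → C i ~L D i

  _≈O_ : Lst → Lst → Set
  C ≈O D = Σ (Fin (suc p)) λ k → C ≈Lst rot k D

  wrev : Lst → Lst
  wrev C i = C (opposite i)

  _≈U_ : Lst → Lst → Set
  C ≈U D = (C ≈O D) ⊎ (C ≈O wrev D)

  actL : Mat → Lst → Lst
  actL g C i = apply g (C i)

  -- Non-split Cartan subgroup of PGL(V) attached to an F_p-linear
  -- isomorphism V ≅ K given by an invertible matrix P (K with basis 1, α).

  -- matrix of multiplication by z = x + y α on K in the basis (1, α)
  mulMat : (c d : Fp) → K → Mat
  mulMat c d (x , y) = mat x (d *F y) y (x +F c *F y)

  NonsplitCartan : (c d : Fp) → Mat → Mat → Set
  NonsplitCartan c d P h = Σ K λ z → (z ≢ 0K) × ((P ⊙ h) ≈P (mulMat c d z ⊙ P))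

  Normaliser : (Mat → Set) → Mat → Set
  Normaliser H g = Invertible g ×
    (∀ (h : Mat) → Invertible h → (H h → H (g ⊙ h ⊙ adj g)) × (H (g ⊙ h ⊙ adj g) → H h))

  _≈[_]_ : Mat → (Mat → Set) → Mat → Set
  A ≈[ H ] B = Σ Mat λ h → Invertible h × H h × (B ≈P (A ⊙ h))

  -- Isomorphism of 𝒢-sets  X ≅ 𝒢/H, where X is given by a carrier of
  -- valid lists with an equality relation, and 𝒢 acts by actL.
  record GSetIsoToCosets (X : Set) (ι : X → Lst) (_≈X_ : Lst → Lst → Set)
                         (H : Mat → Set) : Set where
    field
      f       : X → GL
      f-cong  : ∀ x y → ι x ≈X ι y → proj₁ (f x) ≈[ H ] proj₁ (f y)
      f-inj   : ∀ x y → proj₁ (f x) ≈[ H ] proj₁ (f y) → ι x ≈X ι y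
      f-surj  : ∀ (A : GL) → Σ X λ x → proj₁ (f x) ≈[ H ] proj₁ A
      f-equiv : ∀ (g : GL) (x y : X) → ι y ≈X actL (proj₁ g) (ι x)
                  → proj₁ (f y) ≈[ H ] (proj₁ g ⊙ proj₁ (f x))

  -- the quotient of X by ≈X has exactly n elements
  record HasExactly (n : ℕ) (X : Set) (ι : X → Lst) (_≈X_ : Lst → Lst → Set) : Set where
    field
      e      : Fin n → X
      e-inj  : ∀ i j → ι (e i) ≈X ι (e j) → i ≡ j
      e-surj : ∀ (x : X) → Σ (Fin n) λ i → ι (e i) ≈X ι x

-- An oriented γ-necklace is stepped by a matrix h ∈ 𝒞_γ, unique in PGL(V), and h determines the
-- necklace up to rotation.  No element of 𝒞_γ has an eigenvector, so each is conjugate to m_γ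
-- (multiplication by γ on K ≅ F_{p²}) via a companion matrix; if h = X m_γ X⁻¹ the necklace is the list
-- of lines X γ⁰, …, X γ^p, which are distinct because γ generates K^×.  Hence oriented necklaces
-- correspond to the conjugacy class of γ_P = P⁻¹ m_γ P, whose stabiliser under conjugation is the
-- centraliser of γ_P, the non-split Cartan subgroup H: this is the G-set G/H.  Reversing a necklace
-- inverts its stepper, and N ∖ H conjugates γ_P to its Galois conjugate, which is projectively its
-- inverse; this gives G/N.  For P = I the matrices [[a, b], [0, 1]] with a ≠ 0 form a transversal of
-- G/H, so there are p(p − 1) oriented necklaces, and reversal pairs a with −a, leaving p(p − 1)/2.

module Submission where

open import Data.Nat using (ℕ; NonZero)
open import Data.Nat.Primality using (Prime)
import Defs as D

module ZMod (p : ℕ) .{{nz : NonZero p}} where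

  open import Data.Nat as ℕ using (zero; suc; _%_; _∸_)
  import Data.Nat.Properties as ℕ
  open import Data.Nat.DivMod using (_mod_; m<n⇒m%n≡m; %-distribˡ-+; %-distribˡ-*; n%n≡0)
  open import Data.Integer as ℤ using (ℤ; -[1+_]; _⊖_; sign; ∣_∣; _◃_)
  import Data.Integer.Properties as ℤ
  open import Data.Sign as Sign using (Sign)
  open import Data.Fin using (Fin; toℕ)
  open import Data.Fin.Properties using (toℕ-fromℕ<; toℕ-injective; toℕ<n)
  open import Data.Product using (_,_)
  import Data.Maybe as Maybe
  open import Relation.Nullary.Decidable.Core using (dec⇒maybe)
  open import Relation.Nullary using (yes; no)
  open import Relation.Binary.PropositionalEquality
  open import Algebra.Structures {A = Fin p} _≡_ using (IsCommutativeRing)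
  open import Algebra.Bundles using (CommutativeRing)
  open import Algebra.Solver.Ring.AlmostCommutativeRing
    using (AlmostCommutativeRing; fromCommutativeRing; _-Raw-AlmostCommutative⟶_)
  import Algebra.Solver.Ring as Solver
  import Algebra.Properties.Ring as RingProperties
  open import Defs using (Fp; _+F_; _*F_; -F_; _-F_; 0F; 1F)
  open ≡-Reasoning

  F : Set
  F = Fp p

  infixl 6 _+_ _-_
  infixl 7 _*_

  _+_ _*_ _-_ : F → F → F
  _+_ = _+F_ p
  _*_ = _*F_ p
  _-_ = _-F_ p

  -_ : F → F
  -_ = -F_ p

  0# 1# : F
  0# = 0F p
  1# = 1F p

  ⟦_⟧ : ℕ → F
  ⟦ n ⟧ = n mod p

  toℕ-⟦⟧ : ∀ n → toℕ ⟦ n ⟧ ≡ n % p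
  toℕ-⟦⟧ n = toℕ-fromℕ< _

  ⟦⟧-cong : ∀ {m n} → m % p ≡ n % p → ⟦ m ⟧ ≡ ⟦ n ⟧
  ⟦⟧-cong {m} {n} eq = toℕ-injective (trans (toℕ-⟦⟧ m) (trans eq (sym (toℕ-⟦⟧ n))))

  ⟦toℕ⟧ : ∀ a → ⟦ toℕ a ⟧ ≡ a
  ⟦toℕ⟧ a = toℕ-injective (trans (toℕ-⟦⟧ (toℕ a)) (m<n⇒m%n≡m (toℕ<n a)))

  ⟦⟧-+ : ∀ m n → ⟦ m ℕ.+ n ⟧ ≡ ⟦ m ⟧ + ⟦ n ⟧
  ⟦⟧-+ m n = ⟦⟧-cong (trans (%-distribˡ-+ m n p)
    (cong₂ (λ x y → (x ℕ.+ y) % p) (sym (toℕ-⟦⟧ m)) (sym (toℕ-⟦⟧ n))))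

  ⟦⟧-* : ∀ m n → ⟦ m ℕ.* n ⟧ ≡ ⟦ m ⟧ * ⟦ n ⟧
  ⟦⟧-* m n = ⟦⟧-cong (trans (%-distribˡ-* m n p)
    (cong₂ (λ x y → (x ℕ.* y) % p) (sym (toℕ-⟦⟧ m)) (sym (toℕ-⟦⟧ n))))

  ⟦p⟧ : ⟦ p ⟧ ≡ 0#
  ⟦p⟧ = ⟦⟧-cong (trans (n%n≡0 p) (sym (m<n⇒m%n≡m (ℕ.>-nonZero⁻¹ p))))

  -- Each law is pulled back from ℕ along the surjective homomorphism ⟦_⟧.
  +-assoc : ∀ a b c → (a + b) + c ≡ a + (b + c)
  +-assoc a b c = begin
    ⟦ x ℕ.+ y ⟧ + c        ≡⟨ cong (⟦ x ℕ.+ y ⟧ +_) (⟦toℕ⟧ c) ⟨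
    ⟦ x ℕ.+ y ⟧ + ⟦ z ⟧    ≡⟨ ⟦⟧-+ (x ℕ.+ y) z ⟨
    ⟦ x ℕ.+ y ℕ.+ z ⟧      ≡⟨ cong ⟦_⟧ (ℕ.+-assoc x y z) ⟩
    ⟦ x ℕ.+ (y ℕ.+ z) ⟧    ≡⟨ ⟦⟧-+ x (y ℕ.+ z) ⟩
    ⟦ x ⟧ + (b + c)        ≡⟨ cong (_+ (b + c)) (⟦toℕ⟧ a) ⟩
    a + (b + c)            ∎
    where x = toℕ a; y = toℕ b; z = toℕ c

  *-assoc : ∀ a b c → (a * b) * c ≡ a * (b * c)
  *-assoc a b c = begin
    ⟦ x ℕ.* y ⟧ * c        ≡⟨ cong (⟦ x ℕ.* y ⟧ *_) (⟦toℕ⟧ c) ⟨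
    ⟦ x ℕ.* y ⟧ * ⟦ z ⟧    ≡⟨ ⟦⟧-* (x ℕ.* y) z ⟨
    ⟦ x ℕ.* y ℕ.* z ⟧      ≡⟨ cong ⟦_⟧ (ℕ.*-assoc x y z) ⟩
    ⟦ x ℕ.* (y ℕ.* z) ⟧    ≡⟨ ⟦⟧-* x (y ℕ.* z) ⟩
    ⟦ x ⟧ * (b * c)        ≡⟨ cong (_* (b * c)) (⟦toℕ⟧ a) ⟩
    a * (b * c)            ∎
    where x = toℕ a; y = toℕ b; z = toℕ c

  *-distribʳ-+ : ∀ a b c → (b + c) * a ≡ b * a + c * a
  *-distribʳ-+ a b c = begin
    ⟦ y ℕ.+ z ⟧ * a              ≡⟨ cong (⟦ y ℕ.+ z ⟧ *_) (⟦toℕ⟧ a) ⟨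
    ⟦ y ℕ.+ z ⟧ * ⟦ x ⟧          ≡⟨ ⟦⟧-* (y ℕ.+ z) x ⟨
    ⟦ (y ℕ.+ z) ℕ.* x ⟧          ≡⟨ cong ⟦_⟧ (ℕ.*-distribʳ-+ x y z) ⟩
    ⟦ y ℕ.* x ℕ.+ z ℕ.* x ⟧      ≡⟨ ⟦⟧-+ (y ℕ.* x) (z ℕ.* x) ⟩
    ⟦ y ℕ.* x ⟧ + ⟦ z ℕ.* x ⟧    ∎
    where x = toℕ a; y = toℕ b; z = toℕ c

  +-comm : ∀ a b → a + b ≡ b + a
  +-comm a b = cong ⟦_⟧ (ℕ.+-comm (toℕ a) (toℕ b))

  *-comm : ∀ a b → a * b ≡ b * a
  *-comm a b = cong ⟦_⟧ (ℕ.*-comm (toℕ a) (toℕ b))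

  +-identityˡ : ∀ a → 0# + a ≡ a
  +-identityˡ a = begin
    0# + a        ≡⟨ cong (0# +_) (⟦toℕ⟧ a) ⟨
    ⟦ 0 ⟧ + ⟦ x ⟧ ≡⟨ ⟦⟧-+ 0 x ⟨
    ⟦ x ⟧         ≡⟨ ⟦toℕ⟧ a ⟩
    a             ∎
    where x = toℕ a

  *-identityˡ : ∀ a → 1# * a ≡ a
  *-identityˡ a = begin
    1# * a        ≡⟨ cong (1# *_) (⟦toℕ⟧ a) ⟨
    ⟦ 1 ⟧ * ⟦ x ⟧ ≡⟨ ⟦⟧-* 1 x ⟨
    ⟦ 1 ℕ.* x ⟧   ≡⟨ cong ⟦_⟧ (ℕ.*-identityˡ x) ⟩
    ⟦ x ⟧         ≡⟨ ⟦toℕ⟧ a ⟩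
    a             ∎
    where x = toℕ a

  -‿inverseˡ : ∀ a → (- a) + a ≡ 0#
  -‿inverseˡ a = begin
    ⟦ p ∸ x ⟧ + a         ≡⟨ cong (⟦ p ∸ x ⟧ +_) (⟦toℕ⟧ a) ⟨
    ⟦ p ∸ x ⟧ + ⟦ x ⟧     ≡⟨ ⟦⟧-+ (p ∸ x) x ⟨
    ⟦ p ∸ x ℕ.+ x ⟧       ≡⟨ cong ⟦_⟧ (ℕ.m∸n+n≡m (ℕ.<⇒≤ (toℕ<n a))) ⟩
    ⟦ p ⟧                 ≡⟨ ⟦p⟧ ⟩
    0#                    ∎
    where x = toℕ a

  isCommutativeRing : IsCommutativeRing _+_ _*_ -_ 0# 1#
  isCommutativeRing = record
    { isRing = record
      { +-isAbelianGroup = record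
        { isGroup = record
          { isMonoid = record
            { isSemigroup = record
              { isMagma = record { isEquivalence = isEquivalence ; ∙-cong = cong₂ _+_ }
              ; assoc = +-assoc }
            ; identity = +-identityˡ , λ a → trans (+-comm a 0#) (+-identityˡ a) }
          ; inverse = -‿inverseˡ , λ a → trans (+-comm a (- a)) (-‿inverseˡ a)
          ; ⁻¹-cong = cong (-_) }
        ; comm = +-comm }
      ; *-cong = cong₂ _*_
      ; *-assoc = *-assoc
      ; *-identity = *-identityˡ , λ a → trans (*-comm a 1#) (*-identityˡ a)
      ; distrib = (λ a b c → trans (*-comm a (b + c)) (trans (*-distribʳ-+ a b c)
                                   (cong₂ _+_ (*-comm b a) (*-comm c a))))
                , *-distribʳ-+ }
    ; *-comm = *-comm }

  commutativeRing : CommutativeRing _ _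
  commutativeRing = record { isCommutativeRing = isCommutativeRing }

  open RingProperties (CommutativeRing.ring commutativeRing) public
    using (-0#≈0#; -‿involutive; -‿+-comm; -‿distribˡ-*; -‿distribʳ-*)

  -- Needed to run the ring solver with integer coefficients.
  fromℤ : ℤ → F
  fromℤ (ℤ.+ n)  = ⟦ n ⟧
  fromℤ -[1+ n ] = - ⟦ suc n ⟧

  fromℤ-neg : ∀ i → fromℤ (ℤ.- i) ≡ - fromℤ i
  fromℤ-neg (ℤ.+ zero)  = sym -0#≈0#
  fromℤ-neg (ℤ.+ suc n) = refl
  fromℤ-neg -[1+ n ]    = sym (-‿involutive _)

  x≡[y+x]-y : ∀ x y → x ≡ (y + x) - y
  x≡[y+x]-y x y = begin
    x                ≡⟨ +-identityˡ x ⟨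
    0# + x           ≡⟨ cong (_+ x) (-‿inverseˡ y) ⟨
    (- y + y) + x    ≡⟨ +-assoc (- y) y x ⟩
    - y + (y + x)    ≡⟨ +-comm (- y) (y + x) ⟩
    (y + x) - y      ∎

  fromℤ-⊖ : ∀ m n → fromℤ (m ⊖ n) ≡ ⟦ m ⟧ - ⟦ n ⟧
  fromℤ-⊖ m n with n ℕ.≤? m
  ... | yes n≤m = begin
    fromℤ (m ⊖ n)                     ≡⟨ cong fromℤ (ℤ.⊖-≥ n≤m) ⟩
    ⟦ m ∸ n ⟧                         ≡⟨ x≡[y+x]-y _ ⟦ n ⟧ ⟩
    (⟦ n ⟧ + ⟦ m ∸ n ⟧) - ⟦ n ⟧       ≡⟨ cong (_- ⟦ n ⟧) (⟦⟧-+ n (m ∸ n)) ⟨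
    ⟦ n ℕ.+ (m ∸ n) ⟧ - ⟦ n ⟧         ≡⟨ cong (λ k → ⟦ k ⟧ - ⟦ n ⟧) (ℕ.m+[n∸m]≡n n≤m) ⟩
    ⟦ m ⟧ - ⟦ n ⟧                     ∎
  ... | no n≰m = begin
    fromℤ (m ⊖ n)                     ≡⟨ cong fromℤ (ℤ.⊖-< (ℕ.≰⇒> n≰m)) ⟩
    fromℤ (ℤ.- ℤ.+ (n ∸ m))           ≡⟨ fromℤ-neg (ℤ.+ (n ∸ m)) ⟩
    - ⟦ n ∸ m ⟧                       ≡⟨ cong (-_) (x≡[y+x]-y _ ⟦ m ⟧) ⟩
    - ((⟦ m ⟧ + ⟦ n ∸ m ⟧) - ⟦ m ⟧)   ≡⟨ cong (λ k → - (k - ⟦ m ⟧)) (⟦⟧-+ m (n ∸ m)) ⟨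
    - (⟦ m ℕ.+ (n ∸ m) ⟧ - ⟦ m ⟧)     ≡⟨ cong (λ k → - (⟦ k ⟧ - ⟦ m ⟧))
                                           (ℕ.m+[n∸m]≡n (ℕ.<⇒≤ (ℕ.≰⇒> n≰m))) ⟩
    - (⟦ n ⟧ - ⟦ m ⟧)                 ≡⟨ -[x-y]≡y-x ⟦ n ⟧ ⟦ m ⟧ ⟩
    ⟦ m ⟧ - ⟦ n ⟧                     ∎
    where
    -[x-y]≡y-x : ∀ x y → - (x - y) ≡ y - x
    -[x-y]≡y-x x y = begin
      - (x - y)       ≡⟨ -‿+-comm x (- y) ⟨
      - x + - - y     ≡⟨ cong (- x +_) (-‿involutive y) ⟩
      - x + y         ≡⟨ +-comm (- x) y ⟩
      y - x           ∎

  fromℤ-+ : ∀ i j → fromℤ (i ℤ.+ j) ≡ fromℤ i + fromℤ j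
  fromℤ-+ (ℤ.+ m)  (ℤ.+ n)  = ⟦⟧-+ m n
  fromℤ-+ (ℤ.+ m)  -[1+ n ] = fromℤ-⊖ m (suc n)
  fromℤ-+ -[1+ m ] (ℤ.+ n)  = trans (fromℤ-⊖ n (suc m)) (+-comm ⟦ n ⟧ (- ⟦ suc m ⟧))
  fromℤ-+ -[1+ m ] -[1+ n ] = begin
    - ⟦ suc (suc (m ℕ.+ n)) ⟧        ≡⟨ cong (λ k → - ⟦ suc k ⟧) (ℕ.+-suc m n) ⟨
    - ⟦ suc m ℕ.+ suc n ⟧            ≡⟨ cong (-_) (⟦⟧-+ (suc m) (suc n)) ⟩
    - (⟦ suc m ⟧ + ⟦ suc n ⟧)        ≡⟨ -‿+-comm ⟦ suc m ⟧ ⟦ suc n ⟧ ⟨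
    - ⟦ suc m ⟧ + - ⟦ suc n ⟧        ∎

  signed : Sign → F → F
  signed Sign.+ a = a
  signed Sign.- a = - a

  fromℤ-◃ : ∀ s n → fromℤ (s ◃ n) ≡ signed s ⟦ n ⟧
  fromℤ-◃ Sign.+ zero    = refl
  fromℤ-◃ Sign.- zero    = sym -0#≈0#
  fromℤ-◃ Sign.+ (suc n) = refl
  fromℤ-◃ Sign.- (suc n) = refl

  fromℤ-signAbs : ∀ i → fromℤ i ≡ signed (sign i) ⟦ ∣ i ∣ ⟧
  fromℤ-signAbs (ℤ.+ n)  = refl
  fromℤ-signAbs -[1+ n ] = refl

  signed-* : ∀ s t a b → signed (s Sign.* t) (a * b) ≡ signed s a * signed t b
  signed-* Sign.+ Sign.+ a b = refl
  signed-* Sign.+ Sign.- a b = -‿distribʳ-* a b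
  signed-* Sign.- Sign.+ a b = -‿distribˡ-* a b
  signed-* Sign.- Sign.- a b = begin
    a * b           ≡⟨ -‿involutive (a * b) ⟨
    - - (a * b)     ≡⟨ cong (-_) (-‿distribʳ-* a b) ⟩
    - (a * - b)     ≡⟨ -‿distribˡ-* a (- b) ⟩
    - a * - b       ∎

  fromℤ-* : ∀ i j → fromℤ (i ℤ.* j) ≡ fromℤ i * fromℤ j
  fromℤ-* i j = begin
    fromℤ (i ℤ.* j)                                  ≡⟨ fromℤ-◃ (sign i Sign.* sign j) _ ⟩
    signed (sign i Sign.* sign j) ⟦ ∣ i ∣ ℕ.* ∣ j ∣ ⟧  ≡⟨ cong (signed (sign i Sign.* sign j)) (⟦⟧-* ∣ i ∣ ∣ j ∣) ⟩
    signed (sign i Sign.* sign j) (⟦ ∣ i ∣ ⟧ * ⟦ ∣ j ∣ ⟧) ≡⟨ signed-* (sign i) (sign j) _ _ ⟩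
    signed (sign i) ⟦ ∣ i ∣ ⟧ * signed (sign j) ⟦ ∣ j ∣ ⟧ ≡⟨ cong₂ _*_ (fromℤ-signAbs i) (fromℤ-signAbs j) ⟨
    fromℤ i * fromℤ j                                ∎

  almostCommutativeRing : AlmostCommutativeRing _ _
  almostCommutativeRing = fromCommutativeRing commutativeRing

  fromℤ-homomorphism : ℤ.+-*-rawRing -Raw-AlmostCommutative⟶ almostCommutativeRing
  fromℤ-homomorphism = record
    { ⟦_⟧ = fromℤ ; +-homo = fromℤ-+ ; *-homo = fromℤ-* ; -‿homo = fromℤ-neg
    ; 0-homo = refl ; 1-homo = refl }

  open Solver ℤ.+-*-rawRing almostCommutativeRing fromℤ-homomorphism
    (λ i j → Maybe.map (cong fromℤ) (dec⇒maybe (i ℤ.≟ j))) public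
    using (solve; _:+_; _:*_; :-_; _:-_; _:=_; con; Polynomial)

  𝟘 𝟙 : ∀ {n} → Polynomial n
  𝟘 = con (ℤ.+ 0)
  𝟙 = con (ℤ.+ 1)

  open CommutativeRing commutativeRing public
    using (zeroˡ; zeroʳ; +-identityʳ; *-identityʳ; -‿inverseʳ)

  +-cancelˡ : ∀ u v w → u + v ≡ u + w → v ≡ w
  +-cancelˡ u v w u+v≡u+w = begin
    v              ≡⟨ solve 2 (λ u v → v := u :+ v :- u) refl u v ⟩
    u + v - u      ≡⟨ cong (_- u) u+v≡u+w ⟩
    u + w - u      ≡⟨ solve 2 (λ u w → u :+ w :- u := w) refl u w ⟩
    w              ∎


module Field (p : ℕ) .{{nz : NonZero p}} (p-prime : Prime p) where

  open import Data.Nat as ℕ using (suc)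
  import Data.Nat.Properties as ℕ
  open import Data.Nat.DivMod using (m<n⇒m%n≡m)
  open import Data.Nat.Divisibility using (_∣_; m%n≡0⇒n∣m; n∣m⇒m%n≡0)
  open import Data.Nat.Primality using (euclidsLemma; prime⇒nonTrivial)
  open import Data.Fin using (Fin; toℕ; punchOut)
  open import Data.Fin.Properties using (toℕ-injective; toℕ<n; any?; punchOut-injective; injective⇒≤; _≟_)
  open import Data.Product using (∃; _,_; proj₁; proj₂)
  open import Data.Sum as Sum using (_⊎_; [_,_])
  open import Relation.Nullary using (yes; no; contradiction)
  open import Relation.Binary.PropositionalEquality hiding ([_])
  open ZMod p
  open ≡-Reasoning

  injective⇒surjective : ∀ {n} (f : Fin n → Fin n) → (∀ {i j} → f i ≡ f j → i ≡ j) →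
                         ∀ j → ∃ λ i → f i ≡ j
  injective⇒surjective {suc n} f f-inj j with any? (λ i → f i ≟ j)
  ... | yes hit = hit
  ... | no miss = contradiction (injective⇒≤ g-inj) ℕ.1+n≰n
    where
    j≢f : ∀ i → j ≢ f i
    j≢f i j≡fi = miss (i , sym j≡fi)
    g : Fin (suc n) → Fin n
    g i = punchOut (j≢f i)
    g-inj : ∀ {x y} → g x ≡ g y → x ≡ y
    g-inj {x} {y} eq = f-inj (punchOut-injective (j≢f x) (j≢f y) eq)

  surjective⇒≤ : ∀ {m n} (f : Fin m → Fin n) → (∀ j → ∃ λ i → f i ≡ j) → n ℕ.≤ m
  surjective⇒≤ f f-surj = injective⇒≤ {f = λ j → proj₁ (f-surj j)}
    λ {x} {y} eq → trans (sym (proj₂ (f-surj x))) (trans (cong f eq) (proj₂ (f-surj y)))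

  toℕ-0# : toℕ 0# ≡ 0
  toℕ-0# = trans (toℕ-⟦⟧ 0) (m<n⇒m%n≡m (ℕ.>-nonZero⁻¹ p))

  toℕ≡0⇒≡0# : ∀ a → toℕ a ≡ 0 → a ≡ 0#
  toℕ≡0⇒≡0# a eq = toℕ-injective (trans eq (sym toℕ-0#))

  1≢0 : 1# ≢ 0#
  1≢0 eq = ℕ.1+n≢0 (trans (sym toℕ-1#) (trans (cong toℕ eq) toℕ-0#))
    where
    toℕ-1# : toℕ 1# ≡ 1
    toℕ-1# = trans (toℕ-⟦⟧ 1) (m<n⇒m%n≡m (ℕ.nonTrivial⇒n>1 p {{prime⇒nonTrivial p-prime}}))

  p∣toℕ⇒≡0# : ∀ a → p ∣ toℕ a → a ≡ 0#
  p∣toℕ⇒≡0# a p∣a = toℕ≡0⇒≡0# a (trans (sym (m<n⇒m%n≡m (toℕ<n a))) (n∣m⇒m%n≡0 _ p p∣a))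

  x*y≡0⇒x≡0⊎y≡0 : ∀ a b → a * b ≡ 0# → a ≡ 0# ⊎ b ≡ 0#
  x*y≡0⇒x≡0⊎y≡0 a b ab≡0 =
    Sum.map (p∣toℕ⇒≡0# a) (p∣toℕ⇒≡0# b) (euclidsLemma (toℕ a) (toℕ b) p-prime p∣ab)
    where
    p∣ab : p ∣ toℕ a ℕ.* toℕ b
    p∣ab = m%n≡0⇒n∣m _ p (trans (sym (toℕ-⟦⟧ _)) (trans (cong toℕ ab≡0) toℕ-0#))

  x≢0∧y≢0⇒x*y≢0 : ∀ {a b} → a ≢ 0# → b ≢ 0# → a * b ≢ 0#
  x≢0∧y≢0⇒x*y≢0 {a} {b} a≢0 b≢0 ab≡0 = [ a≢0 , b≢0 ] (x*y≡0⇒x≡0⊎y≡0 a b ab≡0)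

  x-y≡0⇒x≡y : ∀ x y → x - y ≡ 0# → x ≡ y
  x-y≡0⇒x≡y x y x-y≡0 = begin
    x                ≡⟨ solve 2 (λ x y → x := (x :- y) :+ y) refl x y ⟩
    (x - y) + y      ≡⟨ cong (_+ y) x-y≡0 ⟩
    0# + y           ≡⟨ +-identityˡ y ⟩
    y                ∎

  *-cancelˡ : ∀ {a} x y → a ≢ 0# → a * x ≡ a * y → x ≡ y
  *-cancelˡ {a} x y a≢0 ax≡ay = [ (λ a≡0 → contradiction a≡0 a≢0) , x-y≡0⇒x≡y x y ]
    (x*y≡0⇒x≡0⊎y≡0 a (x - y) (begin
      a * (x - y)        ≡⟨ solve 3 (λ a x y → a :* (x :- y) := a :* x :- a :* y) refl a x y ⟩
      a * x - a * y      ≡⟨ cong (_- a * y) ax≡ay ⟩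
      a * y - a * y      ≡⟨ -‿inverseʳ (a * y) ⟩
      0#                 ∎))

  -- Opaque so that the pigeonhole witness is never unfolded during type checking.
  opaque
    _⁻¹[_] : ∀ a → a ≢ 0# → F
    a ⁻¹[ a≢0 ] = proj₁ (injective⇒surjective (a *_) (*-cancelˡ _ _ a≢0) 1#)

    *-inverseʳ : ∀ a (a≢0 : a ≢ 0#) → a * a ⁻¹[ a≢0 ] ≡ 1#
    *-inverseʳ a a≢0 = proj₂ (injective⇒surjective (a *_) (*-cancelˡ _ _ a≢0) 1#)

  ⁻¹-≢0 : ∀ a (a≢0 : a ≢ 0#) → a ⁻¹[ a≢0 ] ≢ 0#
  ⁻¹-≢0 a a≢0 a⁻¹≡0 = 1≢0 (begin
    1#                 ≡⟨ *-inverseʳ a a≢0 ⟨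
    a * a ⁻¹[ a≢0 ]    ≡⟨ cong (a *_) a⁻¹≡0 ⟩
    a * 0#             ≡⟨ zeroʳ a ⟩
    0#                 ∎)

  *-⁻¹-cancel : ∀ a b (b≢0 : b ≢ 0#) → b * (a * b ⁻¹[ b≢0 ]) ≡ a
  *-⁻¹-cancel a b b≢0 = begin
    b * (a * b⁻¹)   ≡⟨ solve 3 (λ a b c → b :* (a :* c) := a :* (b :* c)) refl a b b⁻¹ ⟩
    a * (b * b⁻¹)   ≡⟨ cong (a *_) (*-inverseʳ b b≢0) ⟩
    a * 1#          ≡⟨ *-identityʳ a ⟩
    a               ∎
    where b⁻¹ = b ⁻¹[ b≢0 ]


module Matrices (p : ℕ) .{{nz : NonZero p}} where

  open import Data.Product using (_,_; proj₁; proj₂)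
  open import Relation.Binary.PropositionalEquality
  import Defs as D
  open D public using (mat)
  open ZMod p
  open ≡-Reasoning

  Mat V : Set
  Mat = D.Mat p
  V = D.V p

  infixl 7 _⊙_
  _⊙_ : Mat → Mat → Mat
  _⊙_ = D._⊙_ p

  scale : F → Mat → Mat
  scale = D.scale p

  adj : Mat → Mat
  adj = D.adj p

  det tr : Mat → F
  det = D.det p
  tr = D.tr p

  apply : Mat → V → V
  apply = D.apply p

  scaleV : F → V → V
  scaleV = D.scaleV p

  0V : V
  0V = D.0V p

  I : Mat
  I = mat 1# 0# 0# 1#

  -- Conjugation by X in PGL(V): adj X represents X⁻¹ up to the scalar det X.
  conj : Mat → Mat → Mat
  conj X A = X ⊙ A ⊙ adj X

  mat-cong : ∀ {a b c d a' b' c' d'} → a ≡ a' → b ≡ b' → c ≡ c' → d ≡ d' →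
             mat a b c d ≡ mat a' b' c' d'
  mat-cong refl refl refl refl = refl

  private
    row-col-assoc : ∀ a b e f g h x y →
                    (a * e + b * g) * x + (a * f + b * h) * y ≡ a * (e * x + f * y) + b * (g * x + h * y)
    row-col-assoc = solve 8 (λ a b e f g h x y →
      (a :* e :+ b :* g) :* x :+ (a :* f :+ b :* h) :* y := a :* (e :* x :+ f :* y) :+ b :* (g :* x :+ h :* y)) refl

    scale-row : ∀ s a b x y → (s * a) * x + (s * b) * y ≡ s * (a * x + b * y)
    scale-row = solve 5 (λ s a b x y → (s :* a) :* x :+ (s :* b) :* y := s :* (a :* x :+ b :* y)) refl

    scale-col : ∀ s a b x y → a * (s * x) + b * (s * y) ≡ s * (a * x + b * y)
    scale-col = solve 5 (λ s a b x y → a :* (s :* x) :+ b :* (s :* y) := s :* (a :* x :+ b :* y)) refl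

    unit-row : ∀ a b → 1# * a + 0# * b ≡ a
    unit-row = solve 2 (λ a b → 𝟙 :* a :+ 𝟘 :* b := a) refl

    unit-row' : ∀ a b → 0# * a + 1# * b ≡ b
    unit-row' = solve 2 (λ a b → 𝟘 :* a :+ 𝟙 :* b := b) refl

    unit-col : ∀ a b → a * 1# + b * 0# ≡ a
    unit-col = solve 2 (λ a b → a :* 𝟙 :+ b :* 𝟘 := a) refl

    unit-col' : ∀ a b → a * 0# + b * 1# ≡ b
    unit-col' = solve 2 (λ a b → a :* 𝟘 :+ b :* 𝟙 := b) refl

    *-assoc-comm : ∀ s t a → s * (t * a) ≡ (s * t) * a
    *-assoc-comm s t a = sym (*-assoc s t a)

  ⊙-assoc : ∀ A B C → (A ⊙ B) ⊙ C ≡ A ⊙ (B ⊙ C)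
  ⊙-assoc (mat a b c d) (mat e f g h) (mat i j k l) = mat-cong
    (row-col-assoc a b e f g h i k) (row-col-assoc a b e f g h j l)
    (row-col-assoc c d e f g h i k) (row-col-assoc c d e f g h j l)

  ⊙-identityˡ : ∀ A → I ⊙ A ≡ A
  ⊙-identityˡ (mat a b c d) = mat-cong (unit-row a c) (unit-row b d) (unit-row' a c) (unit-row' b d)

  ⊙-identityʳ : ∀ A → A ⊙ I ≡ A
  ⊙-identityʳ (mat a b c d) = mat-cong (unit-col a b) (unit-col' a b) (unit-col c d) (unit-col' c d)

  scale-⊙ : ∀ s A B → scale s A ⊙ B ≡ scale s (A ⊙ B)
  scale-⊙ s (mat a b c d) (mat e f g h) = mat-cong
    (scale-row s a b e g) (scale-row s a b f h) (scale-row s c d e g) (scale-row s c d f h)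

  ⊙-scale : ∀ s A B → A ⊙ scale s B ≡ scale s (A ⊙ B)
  ⊙-scale s (mat a b c d) (mat e f g h) = mat-cong
    (scale-col s a b e g) (scale-col s a b f h) (scale-col s c d e g) (scale-col s c d f h)

  scale-scale : ∀ s t A → scale s (scale t A) ≡ scale (s * t) A
  scale-scale s t (mat a b c d) = mat-cong
    (*-assoc-comm s t a) (*-assoc-comm s t b) (*-assoc-comm s t c) (*-assoc-comm s t d)

  scale-1 : ∀ A → scale 1# A ≡ A
  scale-1 (mat a b c d) = mat-cong (*-identityˡ a) (*-identityˡ b) (*-identityˡ c) (*-identityˡ d)

  adj-⊙ : ∀ A B → adj (A ⊙ B) ≡ adj B ⊙ adj A
  adj-⊙ (mat a b c d) (mat e f g h) = mat-cong
    (solve 4 (λ c d f h → c :* f :+ d :* h := h :* d :+ (:- f) :* (:- c)) refl c d f h)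
    (solve 4 (λ a b f h → :- (a :* f :+ b :* h) := h :* (:- b) :+ (:- f) :* a) refl a b f h)
    (solve 4 (λ c d e g → :- (c :* e :+ d :* g) := (:- g) :* d :+ e :* (:- c)) refl c d e g)
    (solve 4 (λ a b e g → a :* e :+ b :* g := (:- g) :* (:- b) :+ e :* a) refl a b e g)

  adj-involutive : ∀ A → adj (adj A) ≡ A
  adj-involutive (mat a b c d) = mat-cong refl (-‿involutive b) (-‿involutive c) refl

  adj-scale : ∀ s A → adj (scale s A) ≡ scale s (adj A)
  adj-scale s (mat a b c d) = mat-cong refl (-‿distribʳ-* s b) (-‿distribʳ-* s c) refl

  ⊙-adjʳ : ∀ A → A ⊙ adj A ≡ scale (det A) I
  ⊙-adjʳ (mat a b c d) = mat-cong
    (solve 4 (λ a b c d → a :* d :+ b :* (:- c) := (a :* d :- b :* c) :* 𝟙) refl a b c d)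
    (solve 4 (λ a b c d → a :* (:- b) :+ b :* a := (a :* d :- b :* c) :* 𝟘) refl a b c d)
    (solve 4 (λ a b c d → c :* d :+ d :* (:- c) := (a :* d :- b :* c) :* 𝟘) refl a b c d)
    (solve 4 (λ a b c d → c :* (:- b) :+ d :* a := (a :* d :- b :* c) :* 𝟙) refl a b c d)

  ⊙-adjˡ : ∀ A → adj A ⊙ A ≡ scale (det A) I
  ⊙-adjˡ (mat a b c d) = mat-cong
    (solve 4 (λ a b c d → d :* a :+ (:- b) :* c := (a :* d :- b :* c) :* 𝟙) refl a b c d)
    (solve 4 (λ a b c d → d :* b :+ (:- b) :* d := (a :* d :- b :* c) :* 𝟘) refl a b c d)
    (solve 4 (λ a b c d → (:- c) :* a :+ a :* c := (a :* d :- b :* c) :* 𝟘) refl a b c d)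
    (solve 4 (λ a b c d → (:- c) :* b :+ a :* d := (a :* d :- b :* c) :* 𝟙) refl a b c d)

  det-⊙ : ∀ A B → det (A ⊙ B) ≡ det A * det B
  det-⊙ (mat a b c d) (mat e f g h) = solve 8 (λ a b c d e f g h →
    (a :* e :+ b :* g) :* (c :* f :+ d :* h) :- (a :* f :+ b :* h) :* (c :* e :+ d :* g)
      := (a :* d :- b :* c) :* (e :* h :- f :* g)) refl a b c d e f g h

  det-adj : ∀ A → det (adj A) ≡ det A
  det-adj (mat a b c d) = solve 4 (λ a b c d → d :* a :- (:- b) :* (:- c) := a :* d :- b :* c) refl a b c d

  det-scale : ∀ s A → det (scale s A) ≡ (s * s) * det A
  det-scale s (mat a b c d) = solve 5 (λ s a b c d →
    (s :* a) :* (s :* d) :- (s :* b) :* (s :* c) := (s :* s) :* (a :* d :- b :* c)) refl s a b c d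

  det-I : det I ≡ 1#
  det-I = solve 0 (𝟙 :* 𝟙 :- 𝟘 :* 𝟘 := 𝟙) refl

  tr-conj : ∀ X A → tr (conj X A) ≡ det X * tr A
  tr-conj (mat a b c d) (mat e f g h) = solve 8 (λ a b c d e f g h →
    (a :* e :+ b :* g) :* d :+ (a :* f :+ b :* h) :* (:- c) :+ ((c :* e :+ d :* g) :* (:- b) :+ (c :* f :+ d :* h) :* a)
      := (a :* d :- b :* c) :* (e :+ h)) refl a b c d e f g h

  tr-scale : ∀ s A → tr (scale s A) ≡ s * tr A
  tr-scale s (mat a b c d) = solve 3 (λ s a d → s :* a :+ s :* d := s :* (a :+ d)) refl s a d

  apply-⊙ : ∀ A B v → apply (A ⊙ B) v ≡ apply A (apply B v)
  apply-⊙ (mat a b c d) (mat e f g h) (x , y) =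
    cong₂ _,_ (row-col-assoc a b e f g h x y) (row-col-assoc c d e f g h x y)

  apply-scale : ∀ s A v → apply (scale s A) v ≡ scaleV s (apply A v)
  apply-scale s (mat a b c d) (x , y) = cong₂ _,_ (scale-row s a b x y) (scale-row s c d x y)

  apply-scaleV : ∀ s A v → apply A (scaleV s v) ≡ scaleV s (apply A v)
  apply-scaleV s (mat a b c d) (x , y) = cong₂ _,_ (scale-col s a b x y) (scale-col s c d x y)

  apply-I : ∀ v → apply I v ≡ v
  apply-I (x , y) = cong₂ _,_ (unit-row x y) (unit-row' x y)

  apply-0V : ∀ A → apply A 0V ≡ 0V
  apply-0V (mat a b c d) = cong₂ _,_
    (solve 2 (λ a b → a :* 𝟘 :+ b :* 𝟘 := 𝟘) refl a b) (solve 2 (λ c d → c :* 𝟘 :+ d :* 𝟘 := 𝟘) refl c d)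

  scaleV-scaleV : ∀ s t v → scaleV s (scaleV t v) ≡ scaleV (s * t) v
  scaleV-scaleV s t (x , y) = cong₂ _,_ (*-assoc-comm s t x) (*-assoc-comm s t y)

  scaleV-1 : ∀ v → scaleV 1# v ≡ v
  scaleV-1 (x , y) = cong₂ _,_ (*-identityˡ x) (*-identityˡ y)

  apply-scale-I : ∀ s v → apply (scale s I) v ≡ scaleV s v
  apply-scale-I s v = trans (apply-scale s I v) (cong (scaleV s) (apply-I v))

  apply-adjˡ : ∀ A v → apply (adj A) (apply A v) ≡ scaleV (det A) v
  apply-adjˡ A v = begin
    apply (adj A) (apply A v)  ≡⟨ apply-⊙ (adj A) A v ⟨
    apply (adj A ⊙ A) v        ≡⟨ cong (λ M → apply M v) (⊙-adjˡ A) ⟩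
    apply (scale (det A) I) v  ≡⟨ apply-scale-I (det A) v ⟩
    scaleV (det A) v           ∎

  apply-adjʳ : ∀ A v → apply A (apply (adj A) v) ≡ scaleV (det A) v
  apply-adjʳ A v = begin
    apply A (apply (adj A) v)  ≡⟨ apply-⊙ A (adj A) v ⟨
    apply (A ⊙ adj A) v        ≡⟨ cong (λ M → apply M v) (⊙-adjʳ A) ⟩
    apply (scale (det A) I) v  ≡⟨ apply-scale-I (det A) v ⟩
    scaleV (det A) v           ∎

  apply-conj : ∀ X A v → apply (conj X A) v ≡ apply X (apply A (apply (adj X) v))
  apply-conj X A v = trans (apply-⊙ (X ⊙ A) (adj X) v) (apply-⊙ X A (apply (adj X) v))

  cayley-hamilton : ∀ M v → apply M (apply M v) ≡
    (tr M * proj₁ (apply M v) - det M * proj₁ v , tr M * proj₂ (apply M v) - det M * proj₂ v)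
  cayley-hamilton (mat a b c d) (x , y) = cong₂ _,_
    (solve 6 (λ a b c d x y → a :* (a :* x :+ b :* y) :+ b :* (c :* x :+ d :* y)
                := (a :+ d) :* (a :* x :+ b :* y) :- (a :* d :- b :* c) :* x) refl a b c d x y)
    (solve 6 (λ a b c d x y → c :* (a :* x :+ b :* y) :+ d :* (c :* x :+ d :* y)
                := (a :+ d) :* (c :* x :+ d :* y) :- (a :* d :- b :* c) :* y) refl a b c d x y)

  adj-I : adj I ≡ I
  adj-I = mat-cong refl -0#≈0# -0#≈0# refl

  conj-⊙ : ∀ A B M → conj (A ⊙ B) M ≡ conj A (conj B M)
  conj-⊙ A B M = begin
    A ⊙ B ⊙ M ⊙ adj (A ⊙ B)          ≡⟨ cong (A ⊙ B ⊙ M ⊙_) (adj-⊙ A B) ⟩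
    A ⊙ B ⊙ M ⊙ (adj B ⊙ adj A)      ≡⟨ cong (_⊙ (adj B ⊙ adj A)) (⊙-assoc A B M) ⟩
    A ⊙ (B ⊙ M) ⊙ (adj B ⊙ adj A)    ≡⟨ ⊙-assoc (A ⊙ (B ⊙ M)) (adj B) (adj A) ⟨
    A ⊙ (B ⊙ M) ⊙ adj B ⊙ adj A      ≡⟨ cong (_⊙ adj A) (⊙-assoc A (B ⊙ M) (adj B)) ⟩
    A ⊙ (B ⊙ M ⊙ adj B) ⊙ adj A      ∎

  conj-I : ∀ M → conj I M ≡ M
  conj-I M = trans (cong (I ⊙ M ⊙_) adj-I) (trans (⊙-identityʳ (I ⊙ M)) (⊙-identityˡ M))

  adj-conj : ∀ X M → adj (conj X M) ≡ conj X (adj M)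
  adj-conj X M = begin
    adj (X ⊙ M ⊙ adj X)              ≡⟨ adj-⊙ (X ⊙ M) (adj X) ⟩
    adj (adj X) ⊙ adj (X ⊙ M)        ≡⟨ cong (_⊙ adj (X ⊙ M)) (adj-involutive X) ⟩
    X ⊙ adj (X ⊙ M)                  ≡⟨ cong (X ⊙_) (adj-⊙ X M) ⟩
    X ⊙ (adj M ⊙ adj X)              ≡⟨ ⊙-assoc X (adj M) (adj X) ⟨
    X ⊙ adj M ⊙ adj X                ∎

  tr-scale-conj : ∀ κ Y A → tr (scale κ (conj Y A)) ≡ (κ * det Y) * tr A
  tr-scale-conj κ Y A = begin
    tr (scale κ (conj Y A))    ≡⟨ tr-scale κ (conj Y A) ⟩
    κ * tr (conj Y A)          ≡⟨ cong (κ *_) (tr-conj Y A) ⟩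
    κ * (det Y * tr A)         ≡⟨ *-assoc κ (det Y) (tr A) ⟨
    κ * det Y * tr A           ∎

  det-scale-conj : ∀ κ Y A → det (scale κ (conj Y A)) ≡ ((κ * det Y) * (κ * det Y)) * det A
  det-scale-conj κ Y A = begin
    det (scale κ (conj Y A))                    ≡⟨ det-scale κ (conj Y A) ⟩
    κ * κ * det (Y ⊙ A ⊙ adj Y)                 ≡⟨ cong (κ * κ *_) (det-⊙ (Y ⊙ A) (adj Y)) ⟩
    κ * κ * (det (Y ⊙ A) * det (adj Y))         ≡⟨ cong₂ (λ u w → κ * κ * (u * w)) (det-⊙ Y A) (det-adj Y) ⟩
    κ * κ * (det Y * det A * det Y)             ≡⟨ solve 3 (λ κ y a → κ :* κ :* (y :* a :* y) := κ :* y :* (κ :* y) :* a)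
                                                      refl κ (det Y) (det A) ⟩
    κ * det Y * (κ * det Y) * det A             ∎

  companion : F → F → Mat
  companion t n = mat 0# (- n) 1# t

  cyclicBasis : V → Mat → Mat
  cyclicBasis v M = mat (proj₁ v) (proj₁ (apply M v)) (proj₂ v) (proj₂ (apply M v))

  ⊙-cyclicBasis : ∀ M v → M ⊙ cyclicBasis v M ≡ cyclicBasis v M ⊙ companion (tr M) (det M)
  ⊙-cyclicBasis (mat a b c d) (x , y) = mat-cong
    (solve 4 (λ a b x y → a :* x :+ b :* y := x :* 𝟘 :+ (a :* x :+ b :* y) :* 𝟙) refl a b x y)
    (solve 6 (λ a b c d x y → a :* (a :* x :+ b :* y) :+ b :* (c :* x :+ d :* y)
                := x :* (:- (a :* d :- b :* c)) :+ (a :* x :+ b :* y) :* (a :+ d)) refl a b c d x y)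
    (solve 4 (λ c d x y → c :* x :+ d :* y := y :* 𝟘 :+ (c :* x :+ d :* y) :* 𝟙) refl c d x y)
    (solve 6 (λ a b c d x y → c :* (a :* x :+ b :* y) :+ d :* (c :* x :+ d :* y)
                := y :* (:- (a :* d :- b :* c)) :+ (c :* x :+ d :* y) :* (a :+ d)) refl a b c d x y)


module Projective (p : ℕ) .{{nz : NonZero p}} (p-prime : Prime p) where

  open import Data.Nat using (suc)
  open import Data.Fin using (Fin; zero; suc)
  import Data.Fin.Properties as Fin
  open import Data.Product using (Σ; _×_; _,_; proj₁; proj₂)
  open import Data.Sum using ([_,_]; [_,_]′)
  open import Relation.Nullary using (Dec; yes; no; contradiction)
  open import Relation.Binary.Bundles using (Setoid)
  import Relation.Binary.Reasoning.Setoid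
  open import Relation.Binary.PropositionalEquality using (_≡_; _≢_; refl; sym; trans; cong; cong₂; module ≡-Reasoning)
  import Defs as D
  open ZMod p
  open Field p p-prime
  open Matrices p

  -- Both _≈P_ and _~L_ of Defs are instances of this relation.
  module ScalingEquivalence {X : Set} (act : F → X → X)
           (act-act : ∀ s t x → act s (act t x) ≡ act (s * t) x) (act-1 : ∀ x → act 1# x ≡ x) where

    infix 4 _∼_
    _∼_ : X → X → Set
    x ∼ y = Σ F λ s → (s ≢ 0#) × (x ≡ act s y)

    ∼-refl : ∀ {x} → x ∼ x
    ∼-refl {x} = 1# , 1≢0 , sym (act-1 x)

    ≡⇒∼ : ∀ {x y} → x ≡ y → x ∼ y
    ≡⇒∼ refl = ∼-refl

    act∼ : ∀ {s} x → s ≢ 0# → act s x ∼ x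
    act∼ {s} x s≢0 = s , s≢0 , refl

    ∼-sym : ∀ {x y} → x ∼ y → y ∼ x
    ∼-sym {x} {y} (s , s≢0 , x≡sy) = s⁻¹ , ⁻¹-≢0 s s≢0 , (begin
      y                   ≡⟨ act-1 y ⟨
      act 1# y            ≡⟨ cong (λ t → act t y) (trans (*-comm s⁻¹ s) (*-inverseʳ s s≢0)) ⟨
      act (s⁻¹ * s) y     ≡⟨ act-act s⁻¹ s y ⟨
      act s⁻¹ (act s y)   ≡⟨ cong (act s⁻¹) x≡sy ⟨
      act s⁻¹ x           ∎)
      where
      s⁻¹ = s ⁻¹[ s≢0 ]
      open ≡-Reasoning

    ∼-trans : ∀ {x y z} → x ∼ y → y ∼ z → x ∼ z
    ∼-trans {z = z} (s , s≢0 , x≡sy) (t , t≢0 , y≡tz) =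
      s * t , x≢0∧y≢0⇒x*y≢0 s≢0 t≢0 , trans x≡sy (trans (cong (act s) y≡tz) (act-act s t z))

    setoid : Setoid _ _
    setoid = record
      { Carrier = X ; _≈_ = _∼_
      ; isEquivalence = record { refl = ∼-refl ; sym = ∼-sym ; trans = ∼-trans } }

  open ScalingEquivalence scale scale-scale scale-1 public
    renaming (_∼_ to _≈_; ∼-refl to ≈-refl; ≡⇒∼ to ≡⇒≈; act∼ to scale≈; ∼-sym to ≈-sym;
              ∼-trans to ≈-trans; setoid to ≈-setoid)
  open ScalingEquivalence scaleV scaleV-scaleV scaleV-1 public
    renaming (act∼ to scaleV∼) hiding (setoid)

  Invertible : Mat → Set
  Invertible = D.Invertible p

  ⊙-congˡ : ∀ {A A'} B → A ≈ A' → A ⊙ B ≈ A' ⊙ B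
  ⊙-congˡ {A' = A'} B (s , s≢0 , eq) = s , s≢0 , trans (cong (_⊙ B) eq) (scale-⊙ s A' B)

  ⊙-congʳ : ∀ A {B B'} → B ≈ B' → A ⊙ B ≈ A ⊙ B'
  ⊙-congʳ A {B' = B'} (s , s≢0 , eq) = s , s≢0 , trans (cong (A ⊙_) eq) (⊙-scale s A B')

  ⊙-cong : ∀ {A A' B B'} → A ≈ A' → B ≈ B' → A ⊙ B ≈ A' ⊙ B'
  ⊙-cong {A' = A'} {B} A≈A' B≈B' = ≈-trans (⊙-congˡ B A≈A') (⊙-congʳ A' B≈B')

  adj-cong : ∀ {A B} → A ≈ B → adj A ≈ adj B
  adj-cong {B = B} (s , s≢0 , eq) = s , s≢0 , trans (cong adj eq) (adj-scale s B)

  scale-I≈I : ∀ {s} → s ≢ 0# → scale s I ≈ I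
  scale-I≈I s≢0 = scale≈ I s≢0

  Invertible-⊙ : ∀ A B → Invertible A → Invertible B → Invertible (A ⊙ B)
  Invertible-⊙ A B A-inv B-inv detAB≡0 =
    x≢0∧y≢0⇒x*y≢0 A-inv B-inv (trans (sym (det-⊙ A B)) detAB≡0)

  Invertible-adj : ∀ A → Invertible A → Invertible (adj A)
  Invertible-adj A A-inv detAdj≡0 = A-inv (trans (sym (det-adj A)) detAdj≡0)

  Invertible-conj : ∀ X A → Invertible X → Invertible A → Invertible (conj X A)
  Invertible-conj X A X-inv A-inv = Invertible-⊙ (X ⊙ A) (adj X) (Invertible-⊙ X A X-inv A-inv) (Invertible-adj X X-inv)

  Invertible-I : Invertible I
  Invertible-I detI≡0 = 1≢0 (trans (sym det-I) detI≡0)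

  apply-cong : ∀ A {v w} → v ∼ w → apply A v ∼ apply A w
  apply-cong A {w = w} (s , s≢0 , eq) = s , s≢0 , trans (cong (apply A) eq) (apply-scaleV s A w)

  ≈⇒apply∼ : ∀ {A B} v → A ≈ B → apply A v ∼ apply B v
  ≈⇒apply∼ {B = B} v (s , s≢0 , eq) = s , s≢0 , trans (cong (λ M → apply M v) eq) (apply-scale s B v)

  adj-apply∼ : ∀ A v → Invertible A → apply (adj A) (apply A v) ∼ v
  adj-apply∼ A v A-inv = ∼-trans (≡⇒∼ (apply-adjˡ A v)) (scaleV∼ v A-inv)

  apply-adj∼ : ∀ A v → Invertible A → apply A (apply (adj A) v) ∼ v
  apply-adj∼ A v A-inv = ∼-trans (≡⇒∼ (apply-adjʳ A v)) (scaleV∼ v A-inv)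

  apply-injective : ∀ A {v w} → Invertible A → apply A v ∼ apply A w → v ∼ w
  apply-injective A {v} {w} A-inv Av∼Aw =
    ∼-trans (∼-sym (adj-apply∼ A v A-inv)) (∼-trans (apply-cong (adj A) Av∼Aw) (adj-apply∼ A w A-inv))

  scaleV≡0V : ∀ s v → s ≢ 0# → scaleV s v ≡ 0V → v ≡ 0V
  scaleV≡0V s (x , y) s≢0 sv≡0 = cong₂ _,_ (cancel x (cong proj₁ sv≡0)) (cancel y (cong proj₂ sv≡0))
    where
    cancel : ∀ a → s * a ≡ 0# → a ≡ 0#
    cancel a sa≡0 = [ (λ s≡0 → contradiction s≡0 s≢0) , (λ a≡0 → a≡0) ] (x*y≡0⇒x≡0⊎y≡0 s a sa≡0)

  apply-≢0V : ∀ A {v} → Invertible A → v ≢ 0V → apply A v ≢ 0V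
  apply-≢0V A {v} A-inv v≢0 Av≡0 =
    v≢0 (scaleV≡0V (det A) v A-inv (trans (sym (apply-adjˡ A v)) (trans (cong (apply (adj A)) Av≡0) (apply-0V (adj A)))))

  lineRep : Fin (suc p) → V
  lineRep zero    = 1# , 0#
  lineRep (suc a) = a , 1#

  lineIndex : V → Fin (suc p)
  lineIndex (x , y) with y Fin.≟ 0#
  ... | yes _   = zero
  ... | no y≢0  = suc (x * y ⁻¹[ y≢0 ])

  lineRep-≢0V : ∀ j → lineRep j ≢ 0V
  lineRep-≢0V zero    eq = 1≢0 (cong proj₁ eq)
  lineRep-≢0V (suc a) eq = 1≢0 (cong proj₂ eq)

  lineIndex-lineRep : ∀ j → lineIndex (lineRep j) ≡ j
  lineIndex-lineRep zero with 0# Fin.≟ 0#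
  ... | yes _   = refl
  ... | no 0≢0  = contradiction refl 0≢0
  lineIndex-lineRep (suc a) with 1# Fin.≟ 0#
  ... | yes 1≡0 = contradiction 1≡0 1≢0
  ... | no 1≢0' = cong suc (trans (sym (*-identityˡ _)) (*-⁻¹-cancel a 1# 1≢0'))

  ∼lineRep : ∀ v → v ≢ 0V → v ∼ lineRep (lineIndex v)
  ∼lineRep (x , y) v≢0 with y Fin.≟ 0#
  ... | yes refl = x , x≢0 , cong₂ _,_ (sym (*-identityʳ x)) (sym (zeroʳ x))
    where
    x≢0 : x ≢ 0#
    x≢0 x≡0 = v≢0 (cong (_, 0#) x≡0)
  ... | no y≢0 = y , y≢0 , cong₂ _,_ (sym (*-⁻¹-cancel x y y≢0)) (sym (*-identityʳ y))

  lineIndex-scaleV : ∀ s v → s ≢ 0# → lineIndex (scaleV s v) ≡ lineIndex v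
  lineIndex-scaleV s (x , y) s≢0 with s * y Fin.≟ 0# | y Fin.≟ 0#
  ... | yes _     | yes _   = refl
  ... | yes sy≡0  | no y≢0  = contradiction sy≡0 (x≢0∧y≢0⇒x*y≢0 s≢0 y≢0)
  ... | no sy≢0   | yes y≡0 = contradiction (trans (cong (s *_) y≡0) (zeroʳ s)) sy≢0
  ... | no sy≢0   | no y≢0  = cong suc (*-cancelˡ _ _ sy≢0 (begin
    (s * y) * ((s * x) * (s * y) ⁻¹[ sy≢0 ])   ≡⟨ *-⁻¹-cancel (s * x) (s * y) sy≢0 ⟩
    s * x                                       ≡⟨ cong (s *_) (*-⁻¹-cancel x y y≢0) ⟨
    s * (y * (x * y ⁻¹[ y≢0 ]))                 ≡⟨ *-assoc s y _ ⟨
    (s * y) * (x * y ⁻¹[ y≢0 ])                 ∎))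
    where open ≡-Reasoning

  lineIndex-cong : ∀ {v w} → v ∼ w → lineIndex v ≡ lineIndex w
  lineIndex-cong {w = w} (s , s≢0 , refl) = lineIndex-scaleV s w s≢0

  lineIndex-injective : ∀ {v w} → v ≢ 0V → w ≢ 0V → lineIndex v ≡ lineIndex w → v ∼ w
  lineIndex-injective {v} {w} v≢0 w≢0 eq =
    ∼-trans (∼lineRep v v≢0) (∼-trans (≡⇒∼ (cong lineRep eq)) (∼-sym (∼lineRep w w≢0)))

  fixes-lines⇒≈I : ∀ T → (∀ v → v ≢ 0V → apply T v ∼ v) → T ≈ I
  fixes-lines⇒≈I (mat a b c d) fixes with fixes (1# , 0#) (lineRep-≢0V Fin.zero)
                                       | fixes (0# , 1#) (lineRep-≢0V (Fin.suc 0#))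
                                       | fixes (1# , 1#) (lineRep-≢0V (Fin.suc 1#))
  ... | s , s≢0 , Te₁≡se₁ | t , _ , Te₂≡te₂ | u , _ , Te₁₂≡ue₁₂ =
    a , a≢0 , mat-cong (sym (*-identityʳ a)) (trans b≡0 (sym (zeroʳ a))) (trans c≡0 (sym (zeroʳ a)))
                       (trans (sym a≡d) (sym (*-identityʳ a)))
    where
    a≡s : a ≡ s
    a≡s = trans (sym (solve 2 (λ a b → a :* 𝟙 :+ b :* 𝟘 := a) refl a b))
                (trans (cong proj₁ Te₁≡se₁) (*-identityʳ s))
    a≢0 : a ≢ 0#
    a≢0 a≡0 = s≢0 (trans (sym a≡s) a≡0)
    c≡0 : c ≡ 0#
    c≡0 = trans (sym (solve 2 (λ c d → c :* 𝟙 :+ d :* 𝟘 := c) refl c d))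
                (trans (cong proj₂ Te₁≡se₁) (zeroʳ s))
    b≡0 : b ≡ 0#
    b≡0 = trans (sym (solve 2 (λ a b → a :* 𝟘 :+ b :* 𝟙 := b) refl a b))
                (trans (cong proj₁ Te₂≡te₂) (zeroʳ t))
    a≡d : a ≡ d
    a≡d = begin
      a                      ≡⟨ solve 1 (λ a → a := a :* 𝟙 :+ 𝟘 :* 𝟙) refl a ⟩
      a * 1# + 0# * 1#       ≡⟨ cong (λ x → a * 1# + x * 1#) b≡0 ⟨
      a * 1# + b * 1#        ≡⟨ cong proj₁ Te₁₂≡ue₁₂ ⟩
      u * 1#                 ≡⟨ cong proj₂ Te₁₂≡ue₁₂ ⟨
      c * 1# + d * 1#        ≡⟨ cong (λ x → x * 1# + d * 1#) c≡0 ⟩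
      0# * 1# + d * 1#       ≡⟨ solve 1 (λ d → 𝟘 :* 𝟙 :+ d :* 𝟙 := d) refl d ⟩
      d                      ∎
      where open ≡-Reasoning

  module ≈-Reasoning = Relation.Binary.Reasoning.Setoid ≈-setoid

  agree-on-lines⇒≈ : ∀ A B → Invertible B → (∀ v → v ≢ 0V → apply A v ∼ apply B v) → A ≈ B
  agree-on-lines⇒≈ A B B-inv agree = begin
    A                     ≈⟨ scale≈ A B-inv ⟨
    scale (det B) A       ≡⟨ cong (scale (det B)) (⊙-identityˡ A) ⟨
    scale (det B) (I ⊙ A) ≡⟨ scale-⊙ (det B) I A ⟨
    scale (det B) I ⊙ A   ≡⟨ cong (_⊙ A) (⊙-adjʳ B) ⟨
    B ⊙ adj B ⊙ A         ≡⟨ ⊙-assoc B (adj B) A ⟩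
    B ⊙ (adj B ⊙ A)       ≈⟨ ⊙-congʳ B (fixes-lines⇒≈I (adj B ⊙ A) fixes) ⟩
    B ⊙ I                 ≡⟨ ⊙-identityʳ B ⟩
    B                     ∎
    where
    open ≈-Reasoning
    fixes : ∀ v → v ≢ 0V → apply (adj B ⊙ A) v ∼ v
    fixes v v≢0 = ∼-trans (≡⇒∼ (apply-⊙ (adj B) A v))
                          (∼-trans (apply-cong (adj B) (agree v v≢0)) (adj-apply∼ B v B-inv))

  det≡0⇒multiple : ∀ v w → v ≢ 0V → det (mat (proj₁ v) (proj₁ w) (proj₂ v) (proj₂ w)) ≡ 0# →
                   Σ F λ l → w ≡ scaleV l v
  det≡0⇒multiple (v₁ , v₂) (w₁ , w₂) v≢0 det≡0 = by-cases (v₁ Fin.≟ 0#)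
    where
    open ≡-Reasoning
    v₁w₂≡w₁v₂ : v₁ * w₂ ≡ w₁ * v₂
    v₁w₂≡w₁v₂ = x-y≡0⇒x≡y _ _ det≡0
    by-cases : Dec (v₁ ≡ 0#) → Σ F λ l → (w₁ , w₂) ≡ scaleV l (v₁ , v₂)
    by-cases (no v₁≢0) = l , cong₂ _,_ (sym (trans (*-comm l v₁) (*-⁻¹-cancel w₁ v₁ v₁≢0)))
      (*-cancelˡ w₂ (l * v₂) v₁≢0 (begin
        v₁ * w₂                ≡⟨ v₁w₂≡w₁v₂ ⟩
        w₁ * v₂                ≡⟨ cong (_* v₂) (*-⁻¹-cancel w₁ v₁ v₁≢0) ⟨
        v₁ * l * v₂            ≡⟨ *-assoc v₁ l v₂ ⟩
        v₁ * (l * v₂)          ∎))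
      where l = w₁ * v₁ ⁻¹[ v₁≢0 ]
    by-cases (yes v₁≡0) = l , cong₂ _,_ w₁≡lv₁ (sym (trans (*-comm l v₂) (*-⁻¹-cancel w₂ v₂ v₂≢0)))
      where
      v₂≢0 : v₂ ≢ 0#
      v₂≢0 v₂≡0 = v≢0 (cong₂ _,_ v₁≡0 v₂≡0)
      l = w₂ * v₂ ⁻¹[ v₂≢0 ]
      w₁v₂≡0 : w₁ * v₂ ≡ 0#
      w₁v₂≡0 = trans (sym v₁w₂≡w₁v₂) (trans (cong (_* w₂) v₁≡0) (zeroˡ w₂))
      w₁≡lv₁ : w₁ ≡ l * v₁
      w₁≡lv₁ = [ (λ w₁≡0 → trans w₁≡0 (sym (trans (cong (l *_) v₁≡0) (zeroʳ l))))
               , (λ v₂≡0 → contradiction v₂≡0 v₂≢0) ]′ (x*y≡0⇒x≡0⊎y≡0 w₁ v₂ w₁v₂≡0)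

  conj-congʳ : ∀ X {M M'} → M ≈ M' → conj X M ≈ conj X M'
  conj-congʳ X M≈M' = ⊙-congˡ (adj X) (⊙-congʳ X M≈M')

  conj-congˡ : ∀ {X X'} M → X ≈ X' → conj X M ≈ conj X' M
  conj-congˡ M X≈X' = ⊙-cong (⊙-congˡ M X≈X') (adj-cong X≈X')

  conj-adj-cancel : ∀ X M → Invertible X → conj (adj X) (conj X M) ≈ M
  conj-adj-cancel X M X-inv = begin
    conj (adj X) (conj X M)   ≡⟨ conj-⊙ (adj X) X M ⟨
    conj (adj X ⊙ X) M        ≡⟨ cong (λ Y → conj Y M) (⊙-adjˡ X) ⟩
    conj (scale (det X) I) M  ≈⟨ conj-congˡ M (scale-I≈I X-inv) ⟩
    conj I M                  ≡⟨ conj-I M ⟩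
    M                         ∎
    where open ≈-Reasoning

  conj-cancel-adj : ∀ X M → Invertible X → conj X (conj (adj X) M) ≈ M
  conj-cancel-adj X M X-inv = begin
    conj X (conj (adj X) M)   ≡⟨ conj-⊙ X (adj X) M ⟨
    conj (X ⊙ adj X) M        ≡⟨ cong (λ Y → conj Y M) (⊙-adjʳ X) ⟩
    conj (scale (det X) I) M  ≈⟨ conj-congˡ M (scale-I≈I X-inv) ⟩
    conj I M                  ≡⟨ conj-I M ⟩
    M                         ∎
    where open ≈-Reasoning

  cancelʳ-adj-⊙ : ∀ X A → Invertible X → A ⊙ adj X ⊙ X ≈ A
  cancelʳ-adj-⊙ X A X-inv = begin
    A ⊙ adj X ⊙ X           ≡⟨ ⊙-assoc A (adj X) X ⟩
    A ⊙ (adj X ⊙ X)         ≡⟨ cong (A ⊙_) (⊙-adjˡ X) ⟩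
    A ⊙ scale (det X) I     ≈⟨ ⊙-congʳ A (scale-I≈I X-inv) ⟩
    A ⊙ I                   ≡⟨ ⊙-identityʳ A ⟩
    A                       ∎
    where open ≈-Reasoning

  cancelˡ-⊙-adj : ∀ X A → Invertible X → X ⊙ (adj X ⊙ A) ≈ A
  cancelˡ-⊙-adj X A X-inv = begin
    X ⊙ (adj X ⊙ A)         ≡⟨ ⊙-assoc X (adj X) A ⟨
    X ⊙ adj X ⊙ A           ≡⟨ cong (_⊙ A) (⊙-adjʳ X) ⟩
    scale (det X) I ⊙ A     ≈⟨ ⊙-congˡ A (scale-I≈I X-inv) ⟩
    I ⊙ A                   ≡⟨ ⊙-identityˡ A ⟩
    A                       ∎
    where open ≈-Reasoning

  cancelʳ-⊙-adj : ∀ X A → Invertible X → A ⊙ X ⊙ adj X ≈ A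
  cancelʳ-⊙-adj X A X-inv = begin
    A ⊙ X ⊙ adj X           ≡⟨ ⊙-assoc A X (adj X) ⟩
    A ⊙ (X ⊙ adj X)         ≡⟨ cong (A ⊙_) (⊙-adjʳ X) ⟩
    A ⊙ scale (det X) I     ≈⟨ ⊙-congʳ A (scale-I≈I X-inv) ⟩
    A ⊙ I                   ≡⟨ ⊙-identityʳ A ⟩
    A                       ∎
    where open ≈-Reasoning

  conj-⊙-distrib : ∀ X A B → Invertible X → conj X A ⊙ conj X B ≈ conj X (A ⊙ B)
  conj-⊙-distrib X A B X-inv = begin
    X ⊙ A ⊙ adj X ⊙ (X ⊙ B ⊙ adj X)     ≡⟨ ⊙-assoc (X ⊙ A ⊙ adj X) (X ⊙ B) (adj X) ⟨
    X ⊙ A ⊙ adj X ⊙ (X ⊙ B) ⊙ adj X     ≡⟨ cong (_⊙ adj X) (⊙-assoc (X ⊙ A ⊙ adj X) X B) ⟨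
    X ⊙ A ⊙ adj X ⊙ X ⊙ B ⊙ adj X       ≈⟨ ⊙-congˡ (adj X) (⊙-congˡ B (cancelʳ-adj-⊙ X (X ⊙ A) X-inv)) ⟩
    X ⊙ A ⊙ B ⊙ adj X                   ≡⟨ cong (_⊙ adj X) (⊙-assoc X A B) ⟩
    X ⊙ (A ⊙ B) ⊙ adj X                 ∎
    where open ≈-Reasoning

  ≈conj⇒commute : ∀ A M M' → Invertible A → M ≈ conj A M' → M ⊙ A ≈ A ⊙ M'
  ≈conj⇒commute A M M' A-inv M≈ = ≈-trans (⊙-congˡ A M≈) (cancelʳ-adj-⊙ A (A ⊙ M') A-inv)

  commute⇒≈conj : ∀ B M C → Invertible B → M ⊙ B ≈ B ⊙ C → M ≈ conj B C
  commute⇒≈conj B M C B-inv MB≈BC = ≈-trans (≈-sym (cancelʳ-⊙-adj B M B-inv)) (⊙-congˡ (adj B) MB≈BC)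


module Necklaces (p : ℕ) .{{nz : NonZero p}} (p-prime : Prime p) where

  open import Data.Nat as ℕ using (zero; suc; _%_)
  import Data.Nat.Properties as ℕ
  open import Data.Nat.DivMod using (_mod_; m<n⇒m%n≡m; %-distribˡ-+; m%n%n≡m%n; n%n≡0)
  open import Data.Fin as Fin using (Fin; toℕ; inject₁; fromℕ; opposite)
  import Data.Fin.Properties as Fin
  open import Data.Fin.Relation.Unary.Top using (view; ‵fromℕ; ‵inject₁)
  open import Data.Product using (∃; _,_; proj₁; proj₂)
  open import Relation.Nullary using (contradiction)
  open import Relation.Binary.PropositionalEquality using (_≡_; _≢_; refl; sym; trans; cong; module ≡-Reasoning)
  import Defs as D
  open Matrices p
  open Projective p p-prime
  open ≡-Reasoning

  Lst : Set
  Lst = D.Lst p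

  record EnumeratesLines (C : Lst) : Set where
    field
      nonzero  : ∀ i → C i ≢ 0V
      distinct : ∀ i j → C i ∼ C j → i ≡ j
      complete : ∀ v → v ≢ 0V → ∃ λ i → v ∼ C i
  open EnumeratesLines public

  -- The stepping condition of Defs.IsOrientedNecklace, wrapped in a record so that A and C are inferable.
  record Steps (A : Mat) (C : Lst) : Set where
    constructor steps
    field step : ∀ (i : Fin p) → apply A (C (inject₁ i)) ∼ C (Fin.suc i)
  open Steps public

  ∼-at : ∀ (C : Lst) {i j} → i ≡ j → C i ∼ C j
  ∼-at C refl = ∼-refl

  -- Defs.rot k C i is C (cyc (toℕ i + toℕ k)).
  cyc : ℕ → Fin (suc p)
  cyc n = n mod suc p

  cyc-toℕ : ∀ i → cyc (toℕ i) ≡ i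
  cyc-toℕ i = Fin.toℕ-injective (trans (Fin.toℕ-fromℕ< _) (m<n⇒m%n≡m (Fin.toℕ<n i)))

  cyc-suc : ∀ n → cyc (suc n) ≡ cyc (suc (toℕ (cyc n)))
  cyc-suc n = Fin.toℕ-injective (begin
    toℕ (cyc (suc n))                        ≡⟨ Fin.toℕ-fromℕ< _ ⟩
    (1 ℕ.+ n) % suc p                        ≡⟨ %-distribˡ-+ 1 n (suc p) ⟩
    (1 % suc p ℕ.+ n % suc p) % suc p        ≡⟨ cong (λ m → (1 % suc p ℕ.+ m) % suc p) (m%n%n≡m%n n (suc p)) ⟨
    (1 % suc p ℕ.+ n % suc p % suc p) % suc p ≡⟨ %-distribˡ-+ 1 (n % suc p) (suc p) ⟨
    (1 ℕ.+ n % suc p) % suc p                ≡⟨ cong (λ m → suc m % suc p) (Fin.toℕ-fromℕ< _) ⟨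
    suc (toℕ (cyc n)) % suc p                ≡⟨ Fin.toℕ-fromℕ< _ ⟨
    toℕ (cyc (suc (toℕ (cyc n))))            ∎)

  cyc-wraps : cyc (suc (toℕ (fromℕ p))) ≡ Fin.zero
  cyc-wraps = Fin.toℕ-injective (begin
    toℕ (cyc (suc (toℕ (fromℕ p))))   ≡⟨ Fin.toℕ-fromℕ< _ ⟩
    suc (toℕ (fromℕ p)) % suc p       ≡⟨ cong (λ m → suc m % suc p) (Fin.toℕ-fromℕ p) ⟩
    suc p % suc p                     ≡⟨ n%n≡0 (suc p) ⟩
    0                                 ∎)

  module _ {A C} (C-enum : EnumeratesLines C) (A-inv : Invertible A) (A-steps : Steps A C) where

    -- A must send the last line back to the first: every other line already has a preimage.
    steps-last : apply A (C (fromℕ p)) ∼ C Fin.zero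
    steps-last = first-line (complete C-enum (apply A (C (fromℕ p))) (apply-≢0V A A-inv (nonzero C-enum (fromℕ p))))
      where
      first-line : (∃ λ i → apply A (C (fromℕ p)) ∼ C i) → apply A (C (fromℕ p)) ∼ C Fin.zero
      first-line (Fin.zero  , ACp∼C₀)   = ACp∼C₀
      first-line (Fin.suc j , ACp∼Cj+1) = contradiction
        (distinct C-enum (fromℕ p) (inject₁ j) (apply-injective A A-inv (∼-trans ACp∼Cj+1 (∼-sym (step A-steps j)))))
        Fin.fromℕ≢inject₁

    steps-cyclic : ∀ i → apply A (C i) ∼ C (cyc (suc (toℕ i)))
    steps-cyclic i with view i
    ... | ‵fromℕ    = ∼-trans steps-last (∼-at C (sym cyc-wraps))
    ... | ‵inject₁ j = ∼-trans (step A-steps j)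
                         (∼-at C (sym (trans (cong (λ m → cyc (suc m)) (Fin.toℕ-inject₁ j)) (cyc-toℕ (Fin.suc j)))))

    steps-mod : ∀ n → apply A (C (cyc n)) ∼ C (cyc (suc n))
    steps-mod n = ∼-trans (steps-cyclic (cyc n)) (∼-at C (sym (cyc-suc n)))

  _≈O_ : Lst → Lst → Set
  _≈O_ = D._≈O_ p

  -- The rotation is the one aligning the first lines.
  common-step⇒rotation : ∀ {A C E} → EnumeratesLines C → EnumeratesLines E → Invertible A →
                         Steps A C → Steps A E → C ≈O E
  common-step⇒rotation {A} {C} {E} C-enum E-enum A-inv A-steps-C A-steps-E =
    k , λ i → ∼-trans (∼-at C (sym (cyc-toℕ i))) (aligned (toℕ i))
    where
    k : Fin (suc p)
    k = proj₁ (complete E-enum (C Fin.zero) (nonzero C-enum Fin.zero))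
    aligned : ∀ n → C (cyc n) ∼ E (cyc (n ℕ.+ toℕ k))
    aligned zero    = ∼-trans (∼-at C (cyc-toℕ Fin.zero))
      (∼-trans (proj₂ (complete E-enum (C Fin.zero) (nonzero C-enum Fin.zero))) (∼-at E (sym (cyc-toℕ k))))
    aligned (suc n) = ∼-trans (∼-sym (steps-mod C-enum A-inv A-steps-C n))
      (∼-trans (apply-cong A (aligned n)) (steps-mod E-enum A-inv A-steps-E (n ℕ.+ toℕ k)))

  Steps-rotation : ∀ {A C E} → C ≈O E → EnumeratesLines E → Invertible A → Steps A E → Steps A C
  Steps-rotation {A} {C} {E} (k , C∼E) E-enum A-inv A-steps-E = steps λ i →
    ∼-trans (apply-cong A (∼-trans (C∼E (inject₁ i)) (∼-at E (cong (λ m → cyc (m ℕ.+ toℕ k)) (Fin.toℕ-inject₁ i)))))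
      (∼-trans (steps-mod E-enum A-inv A-steps-E (toℕ i ℕ.+ toℕ k)) (∼-sym (C∼E (Fin.suc i))))

  Steps-≈ : ∀ {A B C} → A ≈ B → Steps A C → Steps B C
  Steps-≈ {C = C} A≈B A-steps = steps λ i → ∼-trans (≈⇒apply∼ (C (inject₁ i)) (≈-sym A≈B)) (step A-steps i)

  common-enumeration⇒≈ : ∀ {A B C} → EnumeratesLines C → Invertible A → Invertible B →
                         Steps A C → Steps B C → A ≈ B
  common-enumeration⇒≈ {A} {B} {C} C-enum A-inv B-inv A-steps B-steps = agree-on-lines⇒≈ A B B-inv agree
    where
    agree : ∀ v → v ≢ 0V → apply A v ∼ apply B v
    agree v v≢0 = ∼-trans (apply-cong A v∼Ci)
      (∼-trans (steps-mod C-enum A-inv A-steps (toℕ i))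
        (∼-trans (∼-sym (steps-mod C-enum B-inv B-steps (toℕ i))) (apply-cong B (∼-sym v∼Ci))))
      where
      i = proj₁ (complete C-enum v v≢0)
      v∼Ci : v ∼ C (cyc (toℕ i))
      v∼Ci = ∼-trans (proj₂ (complete C-enum v v≢0)) (∼-at C (sym (cyc-toℕ i)))

  module _ {A B C E} (C-enum : EnumeratesLines C) (E-enum : EnumeratesLines E)
           (A-inv : Invertible A) (B-inv : Invertible B) (A-steps : Steps A C) (B-steps : Steps B E) where

    rotation⇒≈ : C ≈O E → A ≈ B
    rotation⇒≈ C≈E = common-enumeration⇒≈ C-enum A-inv B-inv A-steps (Steps-rotation C≈E E-enum B-inv B-steps)

    ≈⇒rotation : A ≈ B → C ≈O E
    ≈⇒rotation A≈B = common-step⇒rotation C-enum E-enum A-inv A-steps (Steps-≈ (≈-sym A≈B) B-steps)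

  reverse : Lst → Lst
  reverse = D.wrev p

  opposite-inject₁ : ∀ {n} (i : Fin n) → opposite (inject₁ i) ≡ Fin.suc (opposite i)
  opposite-inject₁ {suc n} Fin.zero    = refl
  opposite-inject₁ {suc n} (Fin.suc i) = cong inject₁ (opposite-inject₁ i)

  EnumeratesLines-reverse : ∀ {C} → EnumeratesLines C → EnumeratesLines (reverse C)
  EnumeratesLines-reverse {C} C-enum = record
    { nonzero  = λ i → nonzero C-enum (opposite i)
    ; distinct = λ i j Ci∼Cj → trans (sym (Fin.opposite-involutive i))
                   (trans (cong opposite (distinct C-enum _ _ Ci∼Cj)) (Fin.opposite-involutive j))
    ; complete = λ v v≢0 → let (i , v∼Ci) = complete C-enum v v≢0 in
                   opposite i , ∼-trans v∼Ci (∼-at C (sym (Fin.opposite-involutive i))) }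

  Steps-reverse : ∀ {A C} → Invertible A → Steps A C → Steps (adj A) (reverse C)
  Steps-reverse {A} {C} A-inv A-steps = steps λ i →
    ∼-trans (apply-cong (adj A) (∼-trans (∼-at C (opposite-inject₁ i)) (∼-sym (step A-steps (opposite i)))))
            (adj-apply∼ A (C (inject₁ (opposite i))) A-inv)

  act : Mat → Lst → Lst
  act = D.actL p

  EnumeratesLines-act : ∀ g {C} → Invertible g → EnumeratesLines C → EnumeratesLines (act g C)
  EnumeratesLines-act g {C} g-inv C-enum = record
    { nonzero  = λ i → apply-≢0V g g-inv (nonzero C-enum i)
    ; distinct = λ i j gCi∼gCj → distinct C-enum i j (apply-injective g g-inv gCi∼gCj)
    ; complete = λ v v≢0 →
        let (i , g⁻¹v∼Ci) = complete C-enum (apply (adj g) v) (apply-≢0V (adj g) (Invertible-adj g g-inv) v≢0) in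
        i , ∼-trans (∼-sym (apply-adj∼ g v g-inv)) (apply-cong g g⁻¹v∼Ci) }

  Steps-act : ∀ g {A C} → Invertible g → Steps A C → Steps (conj g A) (act g C)
  Steps-act g {A} {C} g-inv A-steps = steps λ i → ∼-trans (≡⇒∼ (apply-conj g A _))
    (apply-cong g (∼-trans (apply-cong A (adj-apply∼ g (C (inject₁ i)) g-inv)) (step A-steps i)))


module QuadraticExtension (p : ℕ) .{{nz : NonZero p}} (p-prime : Prime p) (c d : D.Fp p) where

  open import Data.Product using (_,_; proj₁; proj₂)
  open import Data.Sum using ([_,_]′)
  open import Data.Fin.Properties using (_≟_)
  open import Data.Product.Properties using (≡-dec)
  open import Relation.Nullary using (Dec; yes; no; contradiction)
  open import Data.Empty using (⊥)
  open import Relation.Binary.PropositionalEquality using (_≡_; _≢_; refl; sym; trans; cong; cong₂; module ≡-Reasoning)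
  open ZMod p
  open Field p p-prime
  open Matrices p
  open ≡-Reasoning

  K : Set
  K = D.K p

  infixl 7 _·_
  _·_ : K → K → K
  _·_ = D.mulK p c d

  0K 1K : K
  0K = D.0K p
  1K = D.1K p

  embK : F → K
  embK = D.embK p

  mulMat : K → Mat
  mulMat = D.mulMat p c d

  -- The conjugate of x + yα is x + yα' = (x + cy) − yα, where α' = c − α is the other root.
  frob : K → K
  frob (x , y) = x + c * y , - y

  norm : K → F
  norm (x , y) = x * x + c * (x * y) - d * (y * y)

  -- The matrix of z ↦ frob z in the basis (1, α).
  σ : Mat
  σ = mat 1# c 0# (- 1#)

  _≟K_ : (z w : K) → Dec (z ≡ w)
  _≟K_ = ≡-dec _≟_ _≟_

  ·-comm : ∀ z w → z · w ≡ w · z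
  ·-comm (x , y) (u , v) = cong₂ _,_
    (solve 5 (λ x y u v d → x :* u :+ d :* (y :* v) := u :* x :+ d :* (v :* y)) refl x y u v d)
    (solve 5 (λ x y u v c → x :* v :+ u :* y :+ c :* (y :* v) := u :* y :+ x :* v :+ c :* (v :* y)) refl x y u v c)

  ·-assoc : ∀ z w s → (z · w) · s ≡ z · (w · s)
  ·-assoc (x , y) (u , v) (s , t) = cong₂ _,_
    (solve 8 (λ x y u v s t c d →
      (x :* u :+ d :* (y :* v)) :* s :+ d :* ((x :* v :+ u :* y :+ c :* (y :* v)) :* t)
        := x :* (u :* s :+ d :* (v :* t)) :+ d :* (y :* (u :* t :+ s :* v :+ c :* (v :* t)))) refl x y u v s t c d)
    (solve 8 (λ x y u v s t c d →
      (x :* u :+ d :* (y :* v)) :* t :+ s :* (x :* v :+ u :* y :+ c :* (y :* v))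
        :+ c :* ((x :* v :+ u :* y :+ c :* (y :* v)) :* t)
        := x :* (u :* t :+ s :* v :+ c :* (v :* t)) :+ (u :* s :+ d :* (v :* t)) :* y
           :+ c :* (y :* (u :* t :+ s :* v :+ c :* (v :* t))))
      refl x y u v s t c d)

  embK-· : ∀ a z → embK a · z ≡ scaleV a z
  embK-· a (x , y) = cong₂ _,_
    (solve 4 (λ a x y d → a :* x :+ d :* (𝟘 :* y) := a :* x) refl a x y d)
    (solve 4 (λ a x y c → a :* y :+ x :* 𝟘 :+ c :* (𝟘 :* y) := a :* y) refl a x y c)

  ·-identityˡ : ∀ z → 1K · z ≡ z
  ·-identityˡ z = trans (embK-· 1# z) (scaleV-1 z)

  ·-identityʳ : ∀ z → z · 1K ≡ z
  ·-identityʳ z = trans (·-comm z 1K) (·-identityˡ z)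

  ·-zeroʳ : ∀ z → z · 0K ≡ 0K
  ·-zeroʳ z = trans (·-comm z 0K) (trans (embK-· 0# z) (cong₂ _,_ (zeroˡ _) (zeroˡ _)))

  apply-mulMat : ∀ z w → apply (mulMat z) w ≡ z · w
  apply-mulMat (x , y) (u , v) = cong₂ _,_
    (solve 5 (λ x y u v d → x :* u :+ (d :* y) :* v := x :* u :+ d :* (y :* v)) refl x y u v d)
    (solve 5 (λ x y u v c → y :* u :+ (x :+ c :* y) :* v := x :* v :+ u :* y :+ c :* (y :* v)) refl x y u v c)

  mulMat-⊙ : ∀ z w → mulMat z ⊙ mulMat w ≡ mulMat (z · w)
  mulMat-⊙ (x , y) (u , v) = mat-cong
    (solve 5 (λ x y u v d → x :* u :+ (d :* y) :* v := x :* u :+ d :* (y :* v)) refl x y u v d)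
    (solve 6 (λ x y u v c d → x :* (d :* v) :+ (d :* y) :* (u :+ c :* v)
                := d :* (x :* v :+ u :* y :+ c :* (y :* v))) refl x y u v c d)
    (solve 5 (λ x y u v c → y :* u :+ (x :+ c :* y) :* v := x :* v :+ u :* y :+ c :* (y :* v)) refl x y u v c)
    (solve 6 (λ x y u v c d → y :* (d :* v) :+ (x :+ c :* y) :* (u :+ c :* v)
                := x :* u :+ d :* (y :* v) :+ c :* (x :* v :+ u :* y :+ c :* (y :* v))) refl x y u v c d)

  mulMat-scaleV : ∀ a z → mulMat (scaleV a z) ≡ scale a (mulMat z)
  mulMat-scaleV a (x , y) = mat-cong refl
    (solve 3 (λ a y d → d :* (a :* y) := a :* (d :* y)) refl a y d) refl
    (solve 4 (λ a x y c → a :* x :+ c :* (a :* y) := a :* (x :+ c :* y)) refl a x y c)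

  adj-mulMat : ∀ z → adj (mulMat z) ≡ mulMat (frob z)
  adj-mulMat (x , y) = mat-cong refl
    (solve 2 (λ y d → :- (d :* y) := d :* (:- y)) refl y d) refl
    (solve 3 (λ x y c → x := x :+ c :* y :+ c :* (:- y)) refl x y c)

  det-mulMat : ∀ z → det (mulMat z) ≡ norm z
  det-mulMat (x , y) = solve 4 (λ x y c d →
    x :* (x :+ c :* y) :- (d :* y) :* y := x :* x :+ c :* (x :* y) :- d :* (y :* y)) refl x y c d

  σ-mulMat-σ : ∀ z → σ ⊙ mulMat z ⊙ σ ≡ mulMat (frob z)
  σ-mulMat-σ (x , y) = mat-cong
    (solve 4 (λ x y c d → (𝟙 :* x :+ c :* y) :* 𝟙 :+ (𝟙 :* (d :* y) :+ c :* (x :+ c :* y)) :* 𝟘 := x :+ c :* y) refl x y c d)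
    (solve 4 (λ x y c d → (𝟙 :* x :+ c :* y) :* c :+ (𝟙 :* (d :* y) :+ c :* (x :+ c :* y)) :* (:- 𝟙) := d :* (:- y)) refl x y c d)
    (solve 4 (λ x y c d → (𝟘 :* x :+ (:- 𝟙) :* y) :* 𝟙 :+ (𝟘 :* (d :* y) :+ (:- 𝟙) :* (x :+ c :* y)) :* 𝟘 := :- y) refl x y c d)
    (solve 4 (λ x y c d → (𝟘 :* x :+ (:- 𝟙) :* y) :* c :+ (𝟘 :* (d :* y) :+ (:- 𝟙) :* (x :+ c :* y)) :* (:- 𝟙)
                := x :+ c :* y :+ c :* (:- y)) refl x y c d)

  σ⊙σ : σ ⊙ σ ≡ I
  σ⊙σ = mat-cong
    (solve 1 (λ c → 𝟙 :* 𝟙 :+ c :* 𝟘 := 𝟙) refl c) (solve 1 (λ c → 𝟙 :* c :+ c :* (:- 𝟙) := 𝟘) refl c)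
    (solve 0 (𝟘 :* 𝟙 :+ (:- 𝟙) :* 𝟘 := 𝟘) refl) (solve 1 (λ c → 𝟘 :* c :+ (:- 𝟙) :* (:- 𝟙) := 𝟙) refl c)

  adj-σ : adj σ ≡ scale (- 1#) σ
  adj-σ = mat-cong
    (solve 0 (:- 𝟙 := (:- 𝟙) :* 𝟙) refl) (solve 1 (λ c → :- c := (:- 𝟙) :* c) refl c)
    (solve 0 (:- 𝟘 := (:- 𝟙) :* 𝟘) refl) (solve 0 (𝟙 := (:- 𝟙) :* (:- 𝟙)) refl)

  ·-frob : ∀ z → z · frob z ≡ embK (norm z)
  ·-frob (x , y) = cong₂ _,_
    (solve 4 (λ x y c d → x :* (x :+ c :* y) :+ d :* (y :* (:- y)) := x :* x :+ c :* (x :* y) :- d :* (y :* y)) refl x y c d)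
    (solve 3 (λ x y c → x :* (:- y) :+ (x :+ c :* y) :* y :+ c :* (y :* (:- y)) := 𝟘) refl x y c)

  frob-·-· : ∀ z u → frob z · (z · u) ≡ scaleV (norm z) u
  frob-·-· z u = begin
    frob z · (z · u)   ≡⟨ ·-assoc (frob z) z u ⟨
    frob z · z · u     ≡⟨ cong (_· u) (·-comm (frob z) z) ⟩
    z · frob z · u     ≡⟨ cong (_· u) (·-frob z) ⟩
    embK (norm z) · u  ≡⟨ embK-· (norm z) u ⟩
    scaleV (norm z) u  ∎

  frob-≢0K : ∀ {z} → z ≢ 0K → frob z ≢ 0K
  frob-≢0K {x , y} z≢0 frob-z≡0 = z≢0 (cong₂ _,_ x≡0 y≡0)
    where
    y≡0 : y ≡ 0#
    y≡0 = trans (sym (-‿involutive y)) (trans (cong (-_) (cong proj₂ frob-z≡0)) -0#≈0#)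
    x≡0 : x ≡ 0#
    x≡0 = begin
      x                    ≡⟨ solve 3 (λ x y c → x := x :+ c :* y :- c :* y) refl x y c ⟩
      (x + c * y) - c * y  ≡⟨ cong₂ (λ u v → u - c * v) (cong proj₁ frob-z≡0) y≡0 ⟩
      0# - c * 0#          ≡⟨ solve 1 (λ c → 𝟘 :- c :* 𝟘 := 𝟘) refl c ⟩
      0#                   ∎

  module _ (irreducible : D.Irreducible p c d) where

    -- For y ≠ 0, norm (x , y) = y² (t² − c t − d) with t = −x/y, a root of X² − cX − d.
    norm-≢0 : ∀ z → z ≢ 0K → norm z ≢ 0#
    norm-≢0 (x , y) z≢0 norm≡0 = by-cases (y ≟ 0#)
      where
      by-cases : Dec (y ≡ 0#) → ⊥
      by-cases (yes y≡0) = x≢0∧y≢0⇒x*y≢0 x≢0 x≢0 (begin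
        x * x                                  ≡⟨ solve 3 (λ x c d → x :* x := x :* x :+ c :* (x :* 𝟘) :- d :* (𝟘 :* 𝟘))
                                                     refl x c d ⟩
        x * x + c * (x * 0#) - d * (0# * 0#)   ≡⟨ cong (λ v → x * x + c * (x * v) - d * (v * v)) y≡0 ⟨
        norm (x , y)                           ≡⟨ norm≡0 ⟩
        0#                                     ∎)
        where
        x≢0 : x ≢ 0#
        x≢0 x≡0 = z≢0 (cong₂ _,_ x≡0 y≡0)
      by-cases (no y≢0) = irreducible t (x-y≡0⇒x≡y (t * t) (c * t + d) root)
        where
        t = - (x * y ⁻¹[ y≢0 ])
        x≡-ty : x ≡ - (t * y)
        x≡-ty = begin
          x                          ≡⟨ *-⁻¹-cancel x y y≢0 ⟨
          y * (x * y ⁻¹[ y≢0 ])      ≡⟨ solve 2 (λ y u → y :* u := :- ((:- u) :* y)) refl y (x * y ⁻¹[ y≢0 ]) ⟩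
          - (t * y)                  ∎
        scaled-root : (t * t - (c * t + d)) * (y * y) ≡ 0#
        scaled-root = begin
          (t * t - (c * t + d)) * (y * y)  ≡⟨ solve 4 (λ t y c d → (t :* t :- (c :* t :+ d)) :* (y :* y)
                                                := (:- (t :* y)) :* (:- (t :* y)) :+ c :* ((:- (t :* y)) :* y) :- d :* (y :* y)) refl t y c d ⟩
          norm (- (t * y) , y)             ≡⟨ cong (λ u → norm (u , y)) x≡-ty ⟨
          norm (x , y)                     ≡⟨ norm≡0 ⟩
          0#                               ∎
        root : t * t - (c * t + d) ≡ 0#
        root = [ (λ r → r) , (λ yy≡0 → contradiction yy≡0 (x≢0∧y≢0⇒x*y≢0 y≢0 y≢0)) ]′
                 (x*y≡0⇒x≡0⊎y≡0 (t * t - (c * t + d)) (y * y) scaled-root)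

    ·-cancelˡ : ∀ {z} u w → z ≢ 0K → z · u ≡ z · w → u ≡ w
    ·-cancelˡ {z} (u₁ , u₂) (w₁ , w₂) z≢0 zu≡zw = cong₂ _,_
      (*-cancelˡ u₁ w₁ (norm-≢0 z z≢0) (cong proj₁ Nu≡Nw)) (*-cancelˡ u₂ w₂ (norm-≢0 z z≢0) (cong proj₂ Nu≡Nw))
      where
      Nu≡Nw : scaleV (norm z) (u₁ , u₂) ≡ scaleV (norm z) (w₁ , w₂)
      Nu≡Nw = trans (sym (frob-·-· z (u₁ , u₂))) (trans (cong (frob z ·_) zu≡zw) (frob-·-· z (w₁ , w₂)))

    ·-≢0K : ∀ {z w} → z ≢ 0K → w ≢ 0K → z · w ≢ 0K
    ·-≢0K {z} {w} z≢0 w≢0 zw≡0 = w≢0 (·-cancelˡ w 0K z≢0 (trans zw≡0 (sym (·-zeroʳ z))))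


module Generator (p : ℕ) .{{nz : NonZero p}} (p-prime : Prime p) (c d : D.Fp p)
                     (irreducible : D.Irreducible p c d) (γ : D.K p) (generator : D.IsGenerator p c d γ) where

  open import Data.Nat as ℕ using (zero; suc; _%_; _/_)
  import Data.Nat.Properties as ℕ
  open import Data.Nat.DivMod using (_mod_; m%n<n; m≡m%n+[m/n]*n)
  open import Data.Nat.Primality using (prime⇒nonTrivial)
  open import Data.Fin as Fin using (Fin; toℕ)
  import Data.Fin.Properties as Fin
  open import Data.Product using (Σ; ∃; _×_; _,_; proj₁; proj₂)
  open import Data.Sum using (_⊎_; inj₁; inj₂; [_,_]′)
  open import Relation.Nullary using (Dec; yes; no; ¬_; contradiction)
  open import Relation.Binary.Definitions using (tri<; tri≈; tri>)
  open import Relation.Binary.PropositionalEquality using (_≡_; _≢_; refl; sym; trans; cong; cong₂; subst₂; module ≡-Reasoning)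
  open ZMod p
  open Field p p-prime
  open Matrices p
  open Projective p p-prime
  open Necklaces p p-prime
  open QuadraticExtension p p-prime c d
  open ≡-Reasoning

  pow : ℕ → K
  pow = D.powK p c d γ

  x₀ y₀ : F
  x₀ = proj₁ γ
  y₀ = proj₂ γ

  mγ : Mat
  mγ = mulMat γ

  tγ nγ : F
  tγ = tr mγ
  nγ = det mγ

  γ≢0K : γ ≢ 0K
  γ≢0K = proj₁ generator

  pow-≢0K : ∀ n → pow n ≢ 0K
  pow-≢0K zero    1K≡0K = 1≢0 (cong proj₁ 1K≡0K)
  pow-≢0K (suc n) = ·-≢0K irreducible γ≢0K (pow-≢0K n)

  pow-+ : ∀ m n → pow (m ℕ.+ n) ≡ pow m · pow n
  pow-+ zero    n = sym (·-identityˡ (pow n))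
  pow-+ (suc m) n = trans (cong (γ ·_) (pow-+ m n)) (sym (·-assoc γ (pow m) (pow n)))

  ·-scaleV : ∀ a z w → z · scaleV a w ≡ scaleV a (z · w)
  ·-scaleV a z w = begin
    z · scaleV a w   ≡⟨ cong (z ·_) (embK-· a w) ⟨
    z · (embK a · w) ≡⟨ ·-assoc z (embK a) w ⟨
    z · embK a · w   ≡⟨ cong (_· w) (·-comm z (embK a)) ⟩
    embK a · z · w   ≡⟨ ·-assoc (embK a) z w ⟩
    embK a · (z · w) ≡⟨ embK-· a (z · w) ⟩
    scaleV a (z · w) ∎

  -- If γ^m were a scalar, the lines through γ⁰, …, γ^(m−1) would already exhaust the p + 1 lines of V.
  pow-∉F : ∀ m → 1 ℕ.≤ m → m ℕ.≤ p → proj₂ (pow m) ≢ 0#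
  pow-∉F m@(suc _) _ m≤p γᵐ₂≡0 = ℕ.<-irrefl refl (ℕ.≤-trans (surjective⇒≤ line line-surjective) m≤p)
    where
    a = proj₁ (pow m)
    a≢0 : a ≢ 0#
    a≢0 a≡0 = pow-≢0K m (cong₂ _,_ a≡0 γᵐ₂≡0)
    shift : ∀ n → pow (m ℕ.+ n) ∼ pow n
    shift n = a , a≢0 , (begin
      pow (m ℕ.+ n)           ≡⟨ pow-+ m n ⟩
      pow m · pow n           ≡⟨ cong (λ y → (a , y) · pow n) γᵐ₂≡0 ⟩
      embK a · pow n          ≡⟨ embK-· a (pow n) ⟩
      scaleV a (pow n)        ∎)
    periodic : ∀ r k → pow (r ℕ.+ k ℕ.* m) ∼ pow r
    periodic r zero    = ≡⇒∼ (cong pow (ℕ.+-identityʳ r))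
    periodic r (suc k) = ∼-trans (≡⇒∼ (cong pow regroup)) (∼-trans (shift (r ℕ.+ k ℕ.* m)) (periodic r k))
      where
      regroup : r ℕ.+ (m ℕ.+ k ℕ.* m) ≡ m ℕ.+ (r ℕ.+ k ℕ.* m)
      regroup = trans (sym (ℕ.+-assoc r m _)) (trans (cong (ℕ._+ k ℕ.* m) (ℕ.+-comm r m)) (ℕ.+-assoc m r _))
    line : Fin m → Fin (suc p)
    line r = lineIndex (pow (toℕ r))
    line-surjective : ∀ j → ∃ λ r → line r ≡ j
    line-surjective j = n mod m , (begin
      lineIndex (pow (toℕ (n mod m))) ≡⟨ cong (λ k → lineIndex (pow k)) (Fin.toℕ-fromℕ< (m%n<n n m)) ⟩
      lineIndex (pow (n % m))         ≡⟨ lineIndex-cong (periodic (n % m) (n / m)) ⟨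
      lineIndex (pow (n % m ℕ.+ n / m ℕ.* m)) ≡⟨ cong (λ k → lineIndex (pow k)) (m≡m%n+[m/n]*n n m) ⟨
      lineIndex (pow n)               ≡⟨ cong lineIndex γⁿ≡rep ⟩
      lineIndex (lineRep j)           ≡⟨ lineIndex-lineRep j ⟩
      j                               ∎)
      where
      n = proj₁ (proj₂ generator (lineRep j) (lineRep-≢0V j))
      γⁿ≡rep = proj₂ (proj₂ generator (lineRep j) (lineRep-≢0V j))

  y₀≢0 : y₀ ≢ 0#
  y₀≢0 y₀≡0 = pow-∉F 1 ℕ.≤-refl (ℕ.>-nonZero⁻¹ p) (trans (cong proj₂ (·-identityʳ γ)) y₀≡0)

  tγ≢0 : tγ ≢ 0#
  tγ≢0 tγ≡0 = pow-∉F 2 (ℕ.s≤s ℕ.z≤n) (ℕ.nonTrivial⇒n>1 p {{prime⇒nonTrivial p-prime}}) (begin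
    proj₂ (γ · (γ · 1K))   ≡⟨ cong (λ z → proj₂ (γ · z)) (·-identityʳ γ) ⟩
    proj₂ (γ · γ)          ≡⟨ solve 3 (λ x y c → x :* y :+ x :* y :+ c :* (y :* y) := y :* (x :+ (x :+ c :* y))) refl x₀ y₀ c ⟩
    y₀ * tγ                ≡⟨ cong (y₀ *_) tγ≡0 ⟩
    y₀ * 0#                ≡⟨ zeroʳ y₀ ⟩
    0#                     ∎)

  private
    pow-lines-<⇒⊥ : ∀ i j → i ℕ.< j → j ℕ.≤ p → ¬ (pow i ∼ pow j)
    pow-lines-<⇒⊥ i j i<j j≤p (l , l≢0 , γⁱ≡lγʲ) =
      pow-∉F k (ℕ.m<n⇒0<n∸m i<j) (ℕ.≤-trans (ℕ.m∸n≤m j i) j≤p) γᵏ₂≡0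
      where
      k = j ℕ.∸ i
      1K≡lγᵏ : 1K ≡ scaleV l (pow k)
      1K≡lγᵏ = ·-cancelˡ irreducible 1K (scaleV l (pow k)) (pow-≢0K i) (begin
        pow i · 1K             ≡⟨ ·-identityʳ (pow i) ⟩
        pow i                  ≡⟨ γⁱ≡lγʲ ⟩
        scaleV l (pow j)       ≡⟨ cong (λ n → scaleV l (pow n)) (ℕ.m+[n∸m]≡n (ℕ.<⇒≤ i<j)) ⟨
        scaleV l (pow (i ℕ.+ k)) ≡⟨ cong (scaleV l) (pow-+ i k) ⟩
        scaleV l (pow i · pow k) ≡⟨ ·-scaleV l (pow i) (pow k) ⟨
        pow i · scaleV l (pow k) ∎)
      γᵏ₂≡0 : proj₂ (pow k) ≡ 0#
      γᵏ₂≡0 = [ (λ l≡0 → contradiction l≡0 l≢0) , (λ γᵏ₂≡0 → γᵏ₂≡0) ]′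
                (x*y≡0⇒x≡0⊎y≡0 l (proj₂ (pow k)) (sym (cong proj₂ 1K≡lγᵏ)))

  pow-lines-distinct : ∀ (i j : Fin (suc p)) → pow (toℕ i) ∼ pow (toℕ j) → i ≡ j
  pow-lines-distinct i j γⁱ∼γʲ with ℕ.<-cmp (toℕ i) (toℕ j)
  ... | tri< i<j _ _ = contradiction γⁱ∼γʲ (pow-lines-<⇒⊥ _ _ i<j (ℕ.s≤s⁻¹ (Fin.toℕ<n j)))
  ... | tri≈ _ i≡j _ = Fin.toℕ-injective i≡j
  ... | tri> _ _ j<i = contradiction (∼-sym γⁱ∼γʲ) (pow-lines-<⇒⊥ _ _ j<i (ℕ.s≤s⁻¹ (Fin.toℕ<n i)))

  infixl 6 _+K_
  _+K_ : K → K → K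
  _+K_ = D._+K_ p

  minPolyAt : F → F → K
  minPolyAt a₁ a₀ = γ · γ +K embK a₁ · γ +K embK a₀

  private
    T S : F
    T = x₀ * x₀ + d * (y₀ * y₀)
    S = x₀ * y₀ + x₀ * y₀ + c * (y₀ * y₀)

    minPolyAt₁ : ∀ a₁ a₀ → proj₁ (minPolyAt a₁ a₀) ≡ T + a₁ * x₀ + a₀
    minPolyAt₁ a₁ a₀ = solve 5 (λ x y d a₁ a₀ → x :* x :+ d :* (y :* y) :+ (a₁ :* x :+ d :* (𝟘 :* y)) :+ a₀
                                  := x :* x :+ d :* (y :* y) :+ a₁ :* x :+ a₀) refl x₀ y₀ d a₁ a₀

    minPolyAt₂ : ∀ a₁ a₀ → proj₂ (minPolyAt a₁ a₀) ≡ S + a₁ * y₀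
    minPolyAt₂ a₁ a₀ = solve 4 (λ x y c a₁ → x :* y :+ x :* y :+ c :* (y :* y) :+ (a₁ :* y :+ x :* 𝟘 :+ c :* (𝟘 :* y)) :+ 𝟘
                                  := x :* y :+ x :* y :+ c :* (y :* y) :+ a₁ :* y) refl x₀ y₀ c a₁

  minPolyAt-γ : minPolyAt (- tγ) nγ ≡ 0K
  minPolyAt-γ = cong₂ _,_
    (trans (minPolyAt₁ (- tγ) nγ) (solve 4 (λ x y c d →
      x :* x :+ d :* (y :* y) :+ (:- (x :+ (x :+ c :* y))) :* x :+ (x :* (x :+ c :* y) :- (d :* y) :* y) := 𝟘) refl x₀ y₀ c d))
    (trans (minPolyAt₂ (- tγ) nγ) (solve 3 (λ x y c →
      x :* y :+ x :* y :+ c :* (y :* y) :+ (:- (x :+ (x :+ c :* y))) :* y := 𝟘) refl x₀ y₀ c))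

  minPoly-γ : D.IsMinPolyQuad p c d γ (- tγ) nγ
  minPoly-γ = minPolyAt-γ , λ b γ+b≡0 → y₀≢0 (trans (sym (+-identityʳ y₀)) (cong proj₂ γ+b≡0))

  minPoly-unique : ∀ a₁ a₀ → D.IsMinPolyQuad p c d γ a₁ a₀ → (a₁ ≡ - tγ) × (a₀ ≡ nγ)
  minPoly-unique a₁ a₀ (γ-root , _) = a₁≡-tγ , a₀≡nγ
    where
    a₁≡-tγ : a₁ ≡ - tγ
    a₁≡-tγ = *-cancelˡ a₁ (- tγ) y₀≢0 (trans (*-comm y₀ a₁) (trans (+-cancelˡ S _ _ (begin
      S + a₁ * y₀                  ≡⟨ minPolyAt₂ a₁ a₀ ⟨
      proj₂ (minPolyAt a₁ a₀)      ≡⟨ cong proj₂ (trans γ-root (sym minPolyAt-γ)) ⟩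
      proj₂ (minPolyAt (- tγ) nγ)  ≡⟨ minPolyAt₂ (- tγ) nγ ⟩
      S + (- tγ) * y₀              ∎)) (*-comm (- tγ) y₀)))
    a₀≡nγ : a₀ ≡ nγ
    a₀≡nγ = +-cancelˡ (T + a₁ * x₀) a₀ nγ (begin
      T + a₁ * x₀ + a₀             ≡⟨ minPolyAt₁ a₁ a₀ ⟨
      proj₁ (minPolyAt a₁ a₀)      ≡⟨ cong proj₁ (trans γ-root (sym minPolyAt-γ)) ⟩
      proj₁ (minPolyAt (- tγ) nγ)  ≡⟨ minPolyAt₁ (- tγ) nγ ⟩
      T + (- tγ) * x₀ + nγ         ≡⟨ cong (λ a → T + a * x₀ + nγ) a₁≡-tγ ⟨
      T + a₁ * x₀ + nγ             ∎)

  charpoly≡minpoly⇒tr-det : ∀ M → D.CharpolyIsMinpoly p c d γ M → (tr M ≡ tγ) × (det M ≡ nγ)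
  charpoly≡minpoly⇒tr-det M charpoly =
    trans (sym (-‿involutive (tr M))) (trans (cong (-_) (proj₁ unique)) (-‿involutive tγ)) , proj₂ unique
    where unique = minPoly-unique (- tr M) (det M) charpoly

  -- An eigenvalue l of such an M is a root of X² − tγ X + nγ, i.e. norm (x₀ − l , y₀) = 0.
  no-eigenvector : ∀ M l v → tr M ≡ tγ → det M ≡ nγ → v ≢ 0V → apply M v ≢ scaleV l v
  no-eigenvector M l v trM≡tγ detM≡nγ v≢0 Mv≡lv = norm-≢0 irreducible (x₀ - l , y₀) (λ eq → y₀≢0 (cong proj₂ eq)) (begin
    norm (x₀ - l , y₀)     ≡⟨ solve 5 (λ x y l c d → (x :- l) :* (x :- l) :+ c :* ((x :- l) :* y) :- d :* (y :* y)
                                := l :* l :- (x :+ (x :+ c :* y)) :* l :+ (x :* (x :+ c :* y) :- (d :* y) :* y)) refl x₀ y₀ l c d ⟩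
    l * l - tγ * l + nγ    ≡⟨ cong₂ (λ t n → l * l - t * l + n) trM≡tγ detM≡nγ ⟨
    Q                      ≡⟨ Q≡0 (Q Fin.≟ 0#) ⟩
    0#                     ∎)
    where
    t = tr M
    n = det M
    Q = l * l - t * l + n
    Mv = apply M v
    MMv≡l²v : apply M Mv ≡ scaleV (l * l) v
    MMv≡l²v = begin
      apply M Mv               ≡⟨ cong (apply M) Mv≡lv ⟩
      apply M (scaleV l v)     ≡⟨ apply-scaleV l M v ⟩
      scaleV l Mv              ≡⟨ cong (scaleV l) Mv≡lv ⟩
      scaleV l (scaleV l v)    ≡⟨ scaleV-scaleV l l v ⟩
      scaleV (l * l) v         ∎
    component : ∀ w Mw → Mw ≡ l * w → (l * l) * w ≡ t * Mw - n * w → Q * w ≡ 0#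
    component w Mw Mw≡lw l²w≡ = begin
      Q * w                                 ≡⟨ solve 4 (λ l t n w → (l :* l :- t :* l :+ n) :* w
                                                   := l :* l :* w :- (t :* (l :* w) :- n :* w)) refl l t n w ⟩
      l * l * w - (t * (l * w) - n * w)     ≡⟨ cong (λ u → l * l * w - (t * u - n * w)) Mw≡lw ⟨
      l * l * w - (t * Mw - n * w)          ≡⟨ cong (_- (t * Mw - n * w)) l²w≡ ⟩
      (t * Mw - n * w) - (t * Mw - n * w)   ≡⟨ -‿inverseʳ _ ⟩
      0#                                    ∎
    Qv≡0 : scaleV Q v ≡ 0V
    Qv≡0 = cong₂ _,_
      (component (proj₁ v) (proj₁ Mv) (cong proj₁ Mv≡lv) (trans (sym (cong proj₁ MMv≡l²v)) (cong proj₁ (cayley-hamilton M v))))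
      (component (proj₂ v) (proj₂ Mv) (cong proj₂ Mv≡lv) (trans (sym (cong proj₂ MMv≡l²v)) (cong proj₂ (cayley-hamilton M v))))
    Q≡0 : Dec (Q ≡ 0#) → Q ≡ 0#
    Q≡0 (yes Q≡0) = Q≡0
    Q≡0 (no Q≢0)  = contradiction (scaleV≡0V Q v Q≢0 Qv≡0) v≢0

  necklaceOf : Mat → Lst
  necklaceOf X i = apply X (pow (toℕ i))

  necklaceOf-enumerates : ∀ X → Invertible X → EnumeratesLines (necklaceOf X)
  necklaceOf-enumerates X X-inv = record
    { nonzero  = λ i → apply-≢0V X X-inv (pow-≢0K (toℕ i))
    ; distinct = λ i j Xγⁱ∼Xγʲ → pow-lines-distinct i j (apply-injective X X-inv Xγⁱ∼Xγʲ)
    ; complete = complete' }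
    where
    line : Fin (suc p) → Fin (suc p)
    line i = lineIndex (pow (toℕ i))
    line-injective : ∀ {i j} → line i ≡ line j → i ≡ j
    line-injective {i} {j} eq = pow-lines-distinct i j (lineIndex-injective (pow-≢0K (toℕ i)) (pow-≢0K (toℕ j)) eq)
    complete' : ∀ v → v ≢ 0V → ∃ λ i → v ∼ necklaceOf X i
    complete' v v≢0 = i , ∼-trans (∼-sym (apply-adj∼ X v X-inv)) (apply-cong X X⁻¹v∼γⁱ)
      where
      X⁻¹v≢0 = apply-≢0V (adj X) (Invertible-adj X X-inv) v≢0
      hit = injective⇒surjective line line-injective (lineIndex (apply (adj X) v))
      i = proj₁ hit
      X⁻¹v∼γⁱ : apply (adj X) v ∼ pow (toℕ i)
      X⁻¹v∼γⁱ = lineIndex-injective X⁻¹v≢0 (pow-≢0K (toℕ i)) (sym (proj₂ hit))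

  necklaceOf-steps : ∀ X → Invertible X → Steps (conj X mγ) (necklaceOf X)
  necklaceOf-steps X X-inv = steps λ i → ∼-trans (≡⇒∼ (apply-conj X mγ _))
    (apply-cong X (∼-trans (apply-cong mγ (adj-apply∼ X _ X-inv))
      (≡⇒∼ (trans (apply-mulMat γ _) (cong (λ n → pow (suc n)) (Fin.toℕ-inject₁ i))))))

  conj-mγ∈Cγ : ∀ X → Invertible X → D.InCγ p c d γ (conj X mγ)
  conj-mγ∈Cγ X X-inv = M , scale≈ (conj X mγ) (⁻¹-≢0 (det X) X-inv) ,
    subst₂ (D.IsMinPolyQuad p c d γ) (cong (-_) (sym trM≡tγ)) (sym detM≡nγ) minPoly-γ
    where
    κ = det X ⁻¹[ X-inv ]
    M = scale κ (conj X mγ)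
    κδ≡1 : κ * det X ≡ 1#
    κδ≡1 = trans (*-comm κ (det X)) (*-inverseʳ (det X) X-inv)
    trM≡tγ : tr M ≡ tγ
    trM≡tγ = trans (tr-scale-conj κ X mγ) (trans (cong (_* tγ) κδ≡1) (*-identityˡ tγ))
    detM≡nγ : det M ≡ nγ
    detM≡nγ = trans (det-scale-conj κ X mγ)
      (trans (cong (λ u → u * u * nγ) κδ≡1) (trans (cong (_* nγ) (*-identityˡ 1#)) (*-identityˡ nγ)))

  commutes-with-mγ⇒mulMat : ∀ A → mγ ⊙ A ≡ A ⊙ mγ → A ≡ mulMat (D.m₁₁ A , D.m₂₁ A)
  commutes-with-mγ⇒mulMat (mat a b c' d') commutes = mat-cong refl b≡dc' refl d'≡a+cc'
    where
    b≡dc' : b ≡ d * c'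
    b≡dc' = *-cancelˡ b (d * c') y₀≢0 (begin
      y₀ * b                               ≡⟨ solve 4 (λ y b a x → y :* b := a :* x :+ b :* y :- a :* x) refl y₀ b a x₀ ⟩
      a * x₀ + b * y₀ - a * x₀             ≡⟨ cong (λ u → u - a * x₀) (cong D.m₁₁ commutes) ⟨
      x₀ * a + (d * y₀) * c' - a * x₀      ≡⟨ solve 5 (λ x a d y c' → x :* a :+ d :* y :* c' :- a :* x := y :* (d :* c'))
                                                 refl x₀ a d y₀ c' ⟩
      y₀ * (d * c')                        ∎)
    d'≡a+cc' : d' ≡ a + c * c'
    d'≡a+cc' = *-cancelˡ d' (a + c * c') y₀≢0 (begin
      y₀ * d'                              ≡⟨ solve 4 (λ y d' c' x → y :* d' := c' :* x :+ d' :* y :- c' :* x) refl y₀ d' c' x₀ ⟩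
      c' * x₀ + d' * y₀ - c' * x₀          ≡⟨ cong (λ u → u - c' * x₀) (cong D.m₂₁ commutes) ⟨
      y₀ * a + (x₀ + c * y₀) * c' - c' * x₀ ≡⟨ solve 5 (λ y a x c c' → y :* a :+ (x :+ c :* y) :* c' :- c' :* x
                                                  := y :* (a :+ c :* c')) refl y₀ a x₀ c c' ⟩
      y₀ * (a + c * c')                    ∎)

  -- Comparing traces of mγ A adj A = λ · A mγ adj A forces λ = 1, since tγ ≠ 0.
  projectively-commutes-with-mγ : ∀ A → Invertible A → mγ ⊙ A ≈ A ⊙ mγ → Σ K λ z → (z ≢ 0K) × (A ≡ mulMat z)
  projectively-commutes-with-mγ A A-inv (l , _ , mγA≡lAmγ) = z , z≢0 , A≡mz
    where
    δ = det A
    tr-lhs : tr (mγ ⊙ A ⊙ adj A) ≡ δ * tγ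
    tr-lhs = begin
      tr (mγ ⊙ A ⊙ adj A)      ≡⟨ cong tr (⊙-assoc mγ A (adj A)) ⟩
      tr (mγ ⊙ (A ⊙ adj A))    ≡⟨ cong (λ Y → tr (mγ ⊙ Y)) (⊙-adjʳ A) ⟩
      tr (mγ ⊙ scale δ I)      ≡⟨ cong tr (⊙-scale δ mγ I) ⟩
      tr (scale δ (mγ ⊙ I))    ≡⟨ tr-scale δ (mγ ⊙ I) ⟩
      δ * tr (mγ ⊙ I)          ≡⟨ cong (λ Y → δ * tr Y) (⊙-identityʳ mγ) ⟩
      δ * tγ                   ∎
    tr-rhs : tr (mγ ⊙ A ⊙ adj A) ≡ l * (δ * tγ)
    tr-rhs = begin
      tr (mγ ⊙ A ⊙ adj A)            ≡⟨ cong (λ Y → tr (Y ⊙ adj A)) mγA≡lAmγ ⟩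
      tr (scale l (A ⊙ mγ) ⊙ adj A)  ≡⟨ cong tr (scale-⊙ l (A ⊙ mγ) (adj A)) ⟩
      tr (scale l (conj A mγ))       ≡⟨ tr-scale l (conj A mγ) ⟩
      l * tr (conj A mγ)             ≡⟨ cong (l *_) (tr-conj A mγ) ⟩
      l * (δ * tγ)                   ∎
    l≡1 : l ≡ 1#
    l≡1 = *-cancelˡ l 1# (x≢0∧y≢0⇒x*y≢0 A-inv tγ≢0)
            (trans (*-comm (δ * tγ) l) (trans (sym tr-rhs) (trans tr-lhs (sym (*-identityʳ (δ * tγ))))))
    z = D.m₁₁ A , D.m₂₁ A
    A≡mz : A ≡ mulMat z
    A≡mz = commutes-with-mγ⇒mulMat A (trans mγA≡lAmγ (trans (cong (λ u → scale u (A ⊙ mγ)) l≡1) (scale-1 (A ⊙ mγ))))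
    z≢0 : z ≢ 0K
    z≢0 z≡0 = A-inv (trans (cong det A≡mz) (trans (det-mulMat z) (trans (cong norm z≡0)
                (solve 2 (λ c d → 𝟘 :* 𝟘 :+ c :* (𝟘 :* 𝟘) :- d :* (𝟘 :* 𝟘) := 𝟘) refl c d))))

  -- (z − μγ)(z − μγ') vanishes because its coefficients are the trace and determinant defects.
  same-tr-det-as-μγ : ∀ z μ → tr (mulMat z) ≡ μ * tγ → det (mulMat z) ≡ (μ * μ) * nγ →
                      (z ≡ scaleV μ γ) ⊎ (z ≡ scaleV μ (frob γ))
  same-tr-det-as-μγ (a , b) μ tr≡ det≡ = by-cases (u ≟K 0K)
    where
    _-K_ : K → K → K
    (a , b) -K (a' , b') = a - a' , b - b'
    -K≡0K⇒≡ : ∀ z w → z -K w ≡ 0K → z ≡ w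
    -K≡0K⇒≡ (a , b) (a' , b') eq = cong₂ _,_ (x-y≡0⇒x≡y a a' (cong proj₁ eq)) (x-y≡0⇒x≡y b b' (cong proj₂ eq))
    u = (a , b) -K scaleV μ γ
    w = (a , b) -K scaleV μ (frob γ)
    trace-defect = a + (a + c * b) - μ * tγ
    det-defect = μ * μ * nγ - (a * (a + c * b) - d * b * b)
    u·w : u · w ≡ (trace-defect * a + det-defect , trace-defect * b)
    u·w = cong₂ _,_
      (solve 7 (λ a b x y c d μ →
         (a :- μ :* x) :* (a :- μ :* (x :+ c :* y)) :+ d :* ((b :- μ :* y) :* (b :- μ :* (:- y)))
           := (a :+ (a :+ c :* b) :- μ :* (x :+ (x :+ c :* y))) :* a
              :+ (μ :* μ :* (x :* (x :+ c :* y) :- d :* y :* y) :- (a :* (a :+ c :* b) :- d :* b :* b))) refl a b x₀ y₀ c d μ)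
      (solve 7 (λ a b x y c d μ →
         (a :- μ :* x) :* (b :- μ :* (:- y)) :+ (a :- μ :* (x :+ c :* y)) :* (b :- μ :* y) :+ c :* ((b :- μ :* y) :* (b :- μ :* (:- y)))
           := (a :+ (a :+ c :* b) :- μ :* (x :+ (x :+ c :* y))) :* b) refl a b x₀ y₀ c d μ)
    u·w≡0K : u · w ≡ 0K
    u·w≡0K = begin
      u · w                                               ≡⟨ u·w ⟩
      (trace-defect * a + det-defect , trace-defect * b)  ≡⟨ cong₂ (λ s t → s * a + t , s * b)
                                                               (trans (cong (_- μ * tγ) tr≡) (-‿inverseʳ (μ * tγ)))
                                                               (trans (cong (λ t → μ * μ * nγ - t) det≡) (-‿inverseʳ (μ * μ * nγ))) ⟩
      (0# * a + 0# , 0# * b)                              ≡⟨ cong₂ _,_ (trans (+-identityʳ _) (zeroˡ a)) (zeroˡ b) ⟩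
      0K                                                  ∎
    by-cases : Dec (u ≡ 0K) → ((a , b) ≡ scaleV μ γ) ⊎ ((a , b) ≡ scaleV μ (frob γ))
    by-cases (yes u≡0) = inj₁ (-K≡0K⇒≡ _ _ u≡0)
    by-cases (no u≢0)  = inj₂ (-K≡0K⇒≡ _ _ (·-cancelˡ irreducible w 0K u≢0 (trans u·w≡0K (sym (·-zeroʳ u)))))

  cyclicBasis-invertible : ∀ M v → tr M ≡ tγ → det M ≡ nγ → v ≢ 0V → Invertible (cyclicBasis v M)
  cyclicBasis-invertible M v trM≡tγ detM≡nγ v≢0 det≡0 =
    no-eigenvector M (proj₁ Mv∈Fv) v trM≡tγ detM≡nγ v≢0 (proj₂ Mv∈Fv)
    where Mv∈Fv = det≡0⇒multiple v (apply M v) v≢0 det≡0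

  -- Both M and mγ are conjugate to the companion matrix of X² − tγ X + nγ.
  conjugate-of-mγ : ∀ M → tr M ≡ tγ → det M ≡ nγ → Σ Mat λ X → Invertible X × (conj X mγ ≈ M)
  conjugate-of-mγ M trM≡tγ detM≡nγ = B ⊙ adj B₀ , Invertible-⊙ B (adj B₀) B-inv (Invertible-adj B₀ B₀-inv) ,
    ≈-trans (≡⇒≈ (conj-⊙ B (adj B₀) mγ))
      (≈-trans (conj-congʳ B mγ-companion) (≈-sym (companion-form M trM≡tγ detM≡nγ B-inv)))
    where
    e₁ = lineRep Fin.zero
    B = cyclicBasis e₁ M
    B₀ = cyclicBasis e₁ mγ
    C = companion tγ nγ
    B-inv = cyclicBasis-invertible M e₁ trM≡tγ detM≡nγ (lineRep-≢0V Fin.zero)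
    B₀-inv = cyclicBasis-invertible mγ e₁ refl refl (lineRep-≢0V Fin.zero)
    companion-form : ∀ N → tr N ≡ tγ → det N ≡ nγ → Invertible (cyclicBasis e₁ N) → N ≈ conj (cyclicBasis e₁ N) C
    companion-form N trN≡tγ detN≡nγ BN-inv = commute⇒≈conj (cyclicBasis e₁ N) N C BN-inv
      (≡⇒≈ (trans (⊙-cyclicBasis N e₁) (cong₂ (λ t n → cyclicBasis e₁ N ⊙ companion t n) trN≡tγ detN≡nγ)))
    mγ-companion : conj (adj B₀) mγ ≈ C
    mγ-companion = ≈-trans (conj-congʳ (adj B₀) (companion-form mγ refl refl B₀-inv)) (conj-adj-cancel B₀ C B₀-inv)


module Cartan (p : ℕ) .{{nz : NonZero p}} (p-prime : Prime p) (c d : D.Fp p)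
                  (irreducible : D.Irreducible p c d) (γ : D.K p) (generator : D.IsGenerator p c d γ)
                  (P : D.Mat p) (P-inv : D.Invertible p P) where

  open import Data.Product using (Σ; _×_; _,_; proj₁; proj₂)
  open import Data.Sum using (_⊎_; inj₁; inj₂)
  open import Relation.Binary.PropositionalEquality using (_≡_; _≢_; refl; sym; trans; cong; subst; module ≡-Reasoning)
  open ZMod p
  open Field p p-prime
  open Matrices p
  open Projective p p-prime
  open QuadraticExtension p p-prime c d
  open Necklaces p p-prime
  open Generator p p-prime c d irreducible γ generator

  H : Mat → Set
  H = D.NonsplitCartan p c d P

  N : Mat → Set
  N = D.Normaliser p H

  -- P⁻¹ represented by Q; H consists of the classes of Q m_z P.
  Q : Mat
  Q = adj P

  Q-inv : Invertible Q
  Q-inv = Invertible-adj P P-inv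

  cartan : K → Mat
  cartan z = conj Q (mulMat z)

  conj-Q : ∀ M → conj Q M ≡ Q ⊙ M ⊙ P
  conj-Q M = cong (Q ⊙ M ⊙_) (adj-involutive P)

  ∈H⇒≈cartan : ∀ {h} → H h → Σ K λ z → (z ≢ 0K) × (h ≈ cartan z)
  ∈H⇒≈cartan {h} (z , z≢0 , Ph≈mzP) = z , z≢0 , (begin
    h                         ≈⟨ cancelˡ-⊙-adj Q h Q-inv ⟨
    Q ⊙ (adj Q ⊙ h)           ≡⟨ cong (λ Y → Q ⊙ (Y ⊙ h)) (adj-involutive P) ⟩
    Q ⊙ (P ⊙ h)               ≈⟨ ⊙-congʳ Q Ph≈mzP ⟩
    Q ⊙ (mulMat z ⊙ P)        ≡⟨ ⊙-assoc Q (mulMat z) P ⟨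
    Q ⊙ mulMat z ⊙ P          ≡⟨ conj-Q (mulMat z) ⟨
    cartan z                  ∎)
    where open ≈-Reasoning

  ≈cartan⇒∈H : ∀ {h} z → z ≢ 0K → h ≈ cartan z → H h
  ≈cartan⇒∈H {h} z z≢0 h≈ = z , z≢0 , (begin
    P ⊙ h                         ≈⟨ ⊙-congʳ P h≈ ⟩
    P ⊙ (Q ⊙ mulMat z ⊙ adj Q)    ≡⟨ cong (λ Y → P ⊙ (Q ⊙ mulMat z ⊙ Y)) (adj-involutive P) ⟩
    P ⊙ (Q ⊙ mulMat z ⊙ P)        ≡⟨ ⊙-assoc P (Q ⊙ mulMat z) P ⟨
    P ⊙ (Q ⊙ mulMat z) ⊙ P        ≈⟨ ⊙-congˡ P (cancelˡ-⊙-adj P (mulMat z) P-inv) ⟩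
    mulMat z ⊙ P                  ∎)
    where open ≈-Reasoning

  H-resp-≈ : ∀ {A B} → A ≈ B → H A → H B
  H-resp-≈ A≈B A∈H = let (z , z≢0 , A≈) = ∈H⇒≈cartan A∈H in ≈cartan⇒∈H z z≢0 (≈-trans (≈-sym A≈B) A≈)

  cartan-⊙ : ∀ z w → cartan z ⊙ cartan w ≈ cartan (z · w)
  cartan-⊙ z w = ≈-trans (conj-⊙-distrib Q (mulMat z) (mulMat w) Q-inv) (≡⇒≈ (cong (conj Q) (mulMat-⊙ z w)))

  adj-cartan : ∀ z → adj (cartan z) ≡ cartan (frob z)
  adj-cartan z = trans (adj-conj Q (mulMat z)) (cong (conj Q) (adj-mulMat z))

  cartan-scaleV : ∀ {a} z → a ≢ 0# → cartan (scaleV a z) ≈ cartan z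
  cartan-scaleV {a} z a≢0 = conj-congʳ Q (≈-trans (≡⇒≈ (mulMat-scaleV a z)) (scale≈ (mulMat z) a≢0))

  -- H is abelian: w z w' = z · (w w') = norm w · z.
  conj-cartan : ∀ w z → w ≢ 0K → conj (cartan w) (cartan z) ≈ cartan z
  conj-cartan w z w≢0 = begin
    cartan w ⊙ cartan z ⊙ adj (cartan w)      ≡⟨ cong (cartan w ⊙ cartan z ⊙_) (adj-cartan w) ⟩
    cartan w ⊙ cartan z ⊙ cartan (frob w)     ≈⟨ ⊙-congˡ (cartan (frob w)) (cartan-⊙ w z) ⟩
    cartan (w · z) ⊙ cartan (frob w)          ≈⟨ cartan-⊙ (w · z) (frob w) ⟩
    cartan (w · z · frob w)                   ≡⟨ cong cartan wzw'≡ ⟩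
    cartan (scaleV (norm w) z)                ≈⟨ cartan-scaleV z (norm-≢0 irreducible w w≢0) ⟩
    cartan z                                  ∎
    where
    open ≈-Reasoning
    wzw'≡ : w · z · frob w ≡ scaleV (norm w) z
    wzw'≡ = trans (cong (_· frob w) (·-comm w z)) (trans (·-assoc z w (frob w))
              (trans (cong (z ·_) (·-frob w)) (trans (·-comm z (embK (norm w))) (embK-· (norm w) z))))

  σP : Mat
  σP = conj Q σ

  σP-inv : Invertible σP
  σP-inv = Invertible-conj Q σ Q-inv σ-inv
    where
    σ-inv : Invertible σ
    σ-inv detσ≡0 = 1≢0 (trans (solve 1 (λ c → 𝟙 := :- (𝟙 :* (:- 𝟙) :- c :* 𝟘)) refl c) (trans (cong (-_) detσ≡0) -0#≈0#))

  conj-σP-cartan : ∀ z → conj σP (cartan z) ≈ cartan (frob z)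
  conj-σP-cartan z = begin
    σP ⊙ cartan z ⊙ adj σP                    ≡⟨ cong (σP ⊙ cartan z ⊙_) (adj-conj Q σ) ⟩
    σP ⊙ cartan z ⊙ conj Q (adj σ)            ≈⟨ ⊙-congˡ (conj Q (adj σ)) (conj-⊙-distrib Q σ (mulMat z) Q-inv) ⟩
    conj Q (σ ⊙ mulMat z) ⊙ conj Q (adj σ)    ≈⟨ conj-⊙-distrib Q (σ ⊙ mulMat z) (adj σ) Q-inv ⟩
    conj Q (σ ⊙ mulMat z ⊙ adj σ)             ≡⟨ cong (λ Y → conj Q (σ ⊙ mulMat z ⊙ Y)) adj-σ ⟩
    conj Q (σ ⊙ mulMat z ⊙ scale (- 1#) σ)    ≈⟨ conj-congʳ Q (⊙-congʳ (σ ⊙ mulMat z) (scale≈ σ -1≢0)) ⟩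
    conj Q (σ ⊙ mulMat z ⊙ σ)                 ≡⟨ cong (conj Q) (σ-mulMat-σ z) ⟩
    cartan (frob z)                           ∎
    where
    open ≈-Reasoning
    -1≢0 : - 1# ≢ 0#
    -1≢0 -1≡0 = 1≢0 (trans (sym (-‿involutive 1#)) (trans (cong (-_) -1≡0) -0#≈0#))

  conj-σP-involutive : ∀ A → conj σP (conj σP A) ≈ A
  conj-σP-involutive A = begin
    conj σP (conj σP A)     ≡⟨ conj-⊙ σP σP A ⟨
    conj (σP ⊙ σP) A        ≈⟨ conj-congˡ A σP⊙σP≈I ⟩
    conj I A                ≡⟨ conj-I A ⟩
    A                       ∎
    where
    open ≈-Reasoning
    σP⊙σP≈I : σP ⊙ σP ≈ I
    σP⊙σP≈I = begin
      σP ⊙ σP               ≈⟨ conj-⊙-distrib Q σ σ Q-inv ⟩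
      conj Q (σ ⊙ σ)        ≡⟨ cong (conj Q) σ⊙σ ⟩
      Q ⊙ I ⊙ adj Q         ≡⟨ cong (_⊙ adj Q) (⊙-identityʳ Q) ⟩
      Q ⊙ adj Q             ≡⟨ ⊙-adjʳ Q ⟩
      scale (det Q) I       ≈⟨ scale-I≈I Q-inv ⟩
      I                     ∎

  H-conj : ∀ {w A} → H w → H A → H (conj w A)
  H-conj {w} {A} w∈H A∈H =
    let (u , u≢0 , w≈) = ∈H⇒≈cartan w∈H
        (z , z≢0 , A≈) = ∈H⇒≈cartan A∈H
    in ≈cartan⇒∈H z z≢0 (≈-trans (conj-congˡ A w≈) (≈-trans (conj-congʳ (cartan u) A≈) (conj-cartan u z u≢0)))

  H-adj : ∀ {w} → H w → H (adj w)
  H-adj w∈H = let (u , u≢0 , w≈) = ∈H⇒≈cartan w∈H in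
    ≈cartan⇒∈H (frob u) (frob-≢0K u≢0) (≈-trans (adj-cong w≈) (≡⇒≈ (adj-cartan u)))

  H-conj⁻¹ : ∀ {w A} → Invertible w → H w → H (conj w A) → H A
  H-conj⁻¹ {w} {A} w-inv w∈H wAw⁻¹∈H = H-resp-≈ (conj-adj-cancel w A w-inv) (H-conj (H-adj w∈H) wAw⁻¹∈H)

  H-conj-σP : ∀ {A} → H A → H (conj σP A)
  H-conj-σP A∈H = let (z , z≢0 , A≈) = ∈H⇒≈cartan A∈H in
    ≈cartan⇒∈H (frob z) (frob-≢0K z≢0) (≈-trans (conj-congʳ σP A≈) (conj-σP-cartan z))

  H-conj-σP⁻¹ : ∀ {A} → H (conj σP A) → H A
  H-conj-σP⁻¹ {A} σAσ∈H = H-resp-≈ (conj-σP-involutive A) (H-conj-σP σAσ∈H)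

  H⊆N : ∀ {w} → Invertible w → H w → N w
  H⊆N w-inv w∈H = w-inv , λ h _ → H-conj w∈H , H-conj⁻¹ w-inv w∈H

  σP⊙H⊆N : ∀ {w} → Invertible w → H w → N (σP ⊙ w)
  σP⊙H⊆N {w} w-inv w∈H = Invertible-⊙ σP w σP-inv w-inv , λ h _ →
    (λ h∈H → subst H (sym (conj-⊙ σP w h)) (H-conj-σP (H-conj w∈H h∈H))) ,
    (λ σwh∈H → H-conj⁻¹ w-inv w∈H (H-conj-σP⁻¹ (subst H (conj-⊙ σP w h) σwh∈H)))

  _≈[H]_ _≈[N]_ : Mat → Mat → Set
  A ≈[H] B = D._≈[_]_ p A H B
  A ≈[N] B = D._≈[_]_ p A N B

  ≈[H]⇒≈[N] : ∀ g₁ g₂ → g₁ ≈[H] g₂ → g₁ ≈[N] g₂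
  ≈[H]⇒≈[N] _ _ (h , h-inv , h∈H , g₂≈g₁h) = h , h-inv , H⊆N h-inv h∈H , g₂≈g₁h

  γP : Mat
  γP = cartan γ

  γP-inv : Invertible γP
  γP-inv = Invertible-conj Q mγ Q-inv (λ detmγ≡0 → norm-≢0 irreducible γ γ≢0K (trans (sym (det-mulMat γ)) detmγ≡0))

  -- g ↦ g γP g⁻¹ identifies G/H with the conjugacy class of γP, H being the centraliser of γP.
  γ⟨_⟩ : Mat → Mat
  γ⟨ g ⟩ = conj g γP

  γ⟨⟩-inv : ∀ g → Invertible g → Invertible γ⟨ g ⟩
  γ⟨⟩-inv g g-inv = Invertible-conj g γP g-inv γP-inv

  ≈[H]⇒γ⟨⟩≈ : ∀ g₁ g₂ → g₁ ≈[H] g₂ → γ⟨ g₁ ⟩ ≈ γ⟨ g₂ ⟩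
  ≈[H]⇒γ⟨⟩≈ g₁ g₂ (h , _ , h∈H , g₂≈g₁h) = let (z , z≢0 , h≈) = ∈H⇒≈cartan h∈H in ≈-sym (begin
    γ⟨ g₂ ⟩                 ≈⟨ conj-congˡ γP g₂≈g₁h ⟩
    conj (g₁ ⊙ h) γP        ≡⟨ conj-⊙ g₁ h γP ⟩
    conj g₁ (conj h γP)     ≈⟨ conj-congʳ g₁ (≈-trans (conj-congˡ γP h≈) (conj-cartan z γ z≢0)) ⟩
    γ⟨ g₁ ⟩                 ∎)
    where open ≈-Reasoning

  γ⟨⟩≈⇒≈[H] : ∀ g₁ g₂ → Invertible g₁ → Invertible g₂ → γ⟨ g₁ ⟩ ≈ γ⟨ g₂ ⟩ → g₁ ≈[H] g₂
  γ⟨⟩≈⇒≈[H] g₁ g₂ g₁-inv g₂-inv γ₁≈γ₂ = h , h-inv , ≈cartan⇒∈H z z≢0 h≈cartan , ≈-sym g₁h≈g₂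
    where
    X₁ = g₁ ⊙ Q
    X₂ = g₂ ⊙ Q
    A = adj X₁ ⊙ X₂
    A-inv = Invertible-⊙ (adj X₁) X₂ (Invertible-adj X₁ (Invertible-⊙ g₁ Q g₁-inv Q-inv)) (Invertible-⊙ g₂ Q g₂-inv Q-inv)
    mγ≈conjAmγ : mγ ≈ conj A mγ
    mγ≈conjAmγ = begin
      mγ                          ≈⟨ conj-adj-cancel X₁ mγ (Invertible-⊙ g₁ Q g₁-inv Q-inv) ⟨
      conj (adj X₁) (conj X₁ mγ)  ≡⟨ cong (conj (adj X₁)) (conj-⊙ g₁ Q mγ) ⟩
      conj (adj X₁) γ⟨ g₁ ⟩       ≈⟨ conj-congʳ (adj X₁) γ₁≈γ₂ ⟩
      conj (adj X₁) γ⟨ g₂ ⟩       ≡⟨ cong (conj (adj X₁)) (conj-⊙ g₂ Q mγ) ⟨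
      conj (adj X₁) (conj X₂ mγ)  ≡⟨ conj-⊙ (adj X₁) X₂ mγ ⟨
      conj A mγ                   ∎
      where open ≈-Reasoning
    centralises = projectively-commutes-with-mγ A A-inv (≈conj⇒commute A mγ mγ A-inv mγ≈conjAmγ)
    z = proj₁ centralises
    z≢0 = proj₁ (proj₂ centralises)
    h = adj g₁ ⊙ g₂
    h-inv = Invertible-⊙ (adj g₁) g₂ (Invertible-adj g₁ g₁-inv) g₂-inv
    A≡PhQ : A ≡ P ⊙ h ⊙ Q
    A≡PhQ = begin
      adj (g₁ ⊙ Q) ⊙ (g₂ ⊙ Q)     ≡⟨ cong (_⊙ (g₂ ⊙ Q)) (adj-⊙ g₁ Q) ⟩
      adj Q ⊙ adj g₁ ⊙ (g₂ ⊙ Q)   ≡⟨ cong (λ Y → Y ⊙ adj g₁ ⊙ (g₂ ⊙ Q)) (adj-involutive P) ⟩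
      P ⊙ adj g₁ ⊙ (g₂ ⊙ Q)       ≡⟨ ⊙-assoc (P ⊙ adj g₁) g₂ Q ⟨
      P ⊙ adj g₁ ⊙ g₂ ⊙ Q         ≡⟨ cong (_⊙ Q) (⊙-assoc P (adj g₁) g₂) ⟩
      P ⊙ h ⊙ Q                   ∎
      where open ≡-Reasoning
    h≈cartan : h ≈ cartan z
    h≈cartan = ≈-trans (≈-sym (conj-adj-cancel P h P-inv))
                 (≡⇒≈ (cong (conj Q) (trans (sym A≡PhQ) (proj₂ (proj₂ centralises)))))
    g₁h≈g₂ : g₁ ⊙ h ≈ g₂
    g₁h≈g₂ = cancelˡ-⊙-adj g₁ g₂ g₁-inv

  γ⟨⊙σP⟩ : ∀ g → γ⟨ g ⊙ σP ⟩ ≈ adj γ⟨ g ⟩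
  γ⟨⊙σP⟩ g = begin
    γ⟨ g ⊙ σP ⟩               ≡⟨ conj-⊙ g σP γP ⟩
    conj g (conj σP γP)       ≈⟨ conj-congʳ g (conj-σP-cartan γ) ⟩
    conj g (cartan (frob γ))  ≡⟨ cong (conj g) (adj-cartan γ) ⟨
    conj g (adj γP)           ≡⟨ adj-conj g γP ⟨
    adj γ⟨ g ⟩                ∎
    where open ≈-Reasoning

  -- n γP n⁻¹ lies in H and has the characteristic polynomial of γP up to scaling, so it is γP or its conjugate.
  N-conj-γP : ∀ n → N n → (conj n γP ≈ γP) ⊎ (conj n γP ≈ adj γP)
  N-conj-γP n (n-inv , normalises) = by-cases (same-tr-det-as-μγ z μ tr≡ det≡)
    where
    open ≈-Reasoning
    nγPn⁻¹∈H : H (conj n γP)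
    nγPn⁻¹∈H = proj₁ (normalises γP γP-inv) (≈cartan⇒∈H γ γ≢0K ≈-refl)
    z = proj₁ (∈H⇒≈cartan nγPn⁻¹∈H)
    nγPn⁻¹≈ = proj₂ (proj₂ (∈H⇒≈cartan nγPn⁻¹∈H))
    Y = P ⊙ (n ⊙ Q)
    mz≈ : mulMat z ≈ conj Y mγ
    mz≈ = begin
      mulMat z                    ≈⟨ conj-cancel-adj P (mulMat z) P-inv ⟨
      conj P (cartan z)           ≈⟨ conj-congʳ P nγPn⁻¹≈ ⟨
      conj P (conj n γP)          ≡⟨ cong (conj P) (conj-⊙ n Q mγ) ⟨
      conj P (conj (n ⊙ Q) mγ)    ≡⟨ conj-⊙ P (n ⊙ Q) mγ ⟨
      conj Y mγ                   ∎
    κ = proj₁ mz≈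
    μ = κ * det Y
    μ≢0 : μ ≢ 0#
    μ≢0 = x≢0∧y≢0⇒x*y≢0 (proj₁ (proj₂ mz≈)) (Invertible-⊙ P (n ⊙ Q) P-inv (Invertible-⊙ n Q n-inv Q-inv))
    tr≡ = trans (cong tr (proj₂ (proj₂ mz≈))) (tr-scale-conj κ Y mγ)
    det≡ = trans (cong det (proj₂ (proj₂ mz≈))) (det-scale-conj κ Y mγ)
    by-cases : (z ≡ scaleV μ γ) ⊎ (z ≡ scaleV μ (frob γ)) → (conj n γP ≈ γP) ⊎ (conj n γP ≈ adj γP)
    by-cases (inj₁ z≡μγ)  = inj₁ (begin
      conj n γP                 ≈⟨ nγPn⁻¹≈ ⟩
      cartan z                  ≡⟨ cong cartan z≡μγ ⟩
      cartan (scaleV μ γ)       ≈⟨ cartan-scaleV γ μ≢0 ⟩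
      γP                        ∎)
    by-cases (inj₂ z≡μγ') = inj₂ (begin
      conj n γP                 ≈⟨ nγPn⁻¹≈ ⟩
      cartan z                  ≡⟨ cong cartan z≡μγ' ⟩
      cartan (scaleV μ (frob γ)) ≈⟨ cartan-scaleV (frob γ) μ≢0 ⟩
      cartan (frob γ)           ≡⟨ adj-cartan γ ⟨
      adj γP                    ∎)

  ≈[N]⇒γ⟨⟩≈ : ∀ g₁ g₂ → g₁ ≈[N] g₂ → (γ⟨ g₂ ⟩ ≈ γ⟨ g₁ ⟩) ⊎ (γ⟨ g₂ ⟩ ≈ adj γ⟨ g₁ ⟩)
  ≈[N]⇒γ⟨⟩≈ g₁ g₂ (n , _ , n∈N , g₂≈g₁n) = by-cases (N-conj-γP n n∈N)
    where
    γ₂≈ : γ⟨ g₂ ⟩ ≈ conj g₁ (conj n γP)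
    γ₂≈ = ≈-trans (conj-congˡ γP g₂≈g₁n) (≡⇒≈ (conj-⊙ g₁ n γP))
    by-cases : (conj n γP ≈ γP) ⊎ (conj n γP ≈ adj γP) → (γ⟨ g₂ ⟩ ≈ γ⟨ g₁ ⟩) ⊎ (γ⟨ g₂ ⟩ ≈ adj γ⟨ g₁ ⟩)
    by-cases (inj₁ nγPn⁻¹≈γP)  = inj₁ (≈-trans γ₂≈ (conj-congʳ g₁ nγPn⁻¹≈γP))
    by-cases (inj₂ nγPn⁻¹≈γP') =
      inj₂ (≈-trans γ₂≈ (≈-trans (conj-congʳ g₁ nγPn⁻¹≈γP') (≡⇒≈ (sym (adj-conj g₁ γP)))))

  γ⟨⟩≈adj⇒≈[N] : ∀ g₁ g₂ → Invertible g₁ → Invertible g₂ → γ⟨ g₂ ⟩ ≈ adj γ⟨ g₁ ⟩ → g₁ ≈[N] g₂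
  γ⟨⟩≈adj⇒≈[N] g₁ g₂ g₁-inv g₂-inv γ₂≈γ₁' =
    let (h , h-inv , h∈H , g₂≈g₁σPh) = γ⟨⟩≈⇒≈[H] (g₁ ⊙ σP) g₂ (Invertible-⊙ g₁ σP g₁-inv σP-inv) g₂-inv
                                          (≈-trans (γ⟨⊙σP⟩ g₁) (≈-sym γ₂≈γ₁'))
    in σP ⊙ h , Invertible-⊙ σP h σP-inv h-inv , σP⊙H⊆N h-inv h∈H , ≈-trans g₂≈g₁σPh (≡⇒≈ (⊙-assoc g₁ σP h))

  conj-⊙Q-mγ : ∀ g → conj (g ⊙ Q) mγ ≡ γ⟨ g ⟩
  conj-⊙Q-mγ g = conj-⊙ g Q mγ

  necklaceOfCoset : Mat → Lst
  necklaceOfCoset g = necklaceOf (g ⊙ Q)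

  necklaceOfCoset-enumerates : ∀ g → Invertible g → EnumeratesLines (necklaceOfCoset g)
  necklaceOfCoset-enumerates g g-inv = necklaceOf-enumerates (g ⊙ Q) (Invertible-⊙ g Q g-inv Q-inv)

  necklaceOfCoset-steps : ∀ g → Invertible g → Steps γ⟨ g ⟩ (necklaceOfCoset g)
  necklaceOfCoset-steps g g-inv =
    subst (λ A → Steps A (necklaceOfCoset g)) (conj-⊙Q-mγ g) (necklaceOf-steps (g ⊙ Q) (Invertible-⊙ g Q g-inv Q-inv))

  γ⟨⟩∈Cγ : ∀ g → Invertible g → D.InCγ p c d γ γ⟨ g ⟩
  γ⟨⟩∈Cγ g g-inv = subst (D.InCγ p c d γ) (conj-⊙Q-mγ g) (conj-mγ∈Cγ (g ⊙ Q) (Invertible-⊙ g Q g-inv Q-inv))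

  γ⟨⟩-surjective : ∀ M → tr M ≡ tγ → det M ≡ nγ → Σ Mat λ g → Invertible g × (γ⟨ g ⟩ ≈ M)
  γ⟨⟩-surjective M trM≡tγ detM≡nγ =
    let (X , X-inv , conjXmγ≈M) = conjugate-of-mγ M trM≡tγ detM≡nγ in
    X ⊙ P , Invertible-⊙ X P X-inv P-inv , (begin
      γ⟨ X ⊙ P ⟩              ≡⟨ conj-⊙ X P γP ⟩
      conj X (conj P γP)      ≈⟨ conj-congʳ X (conj-cancel-adj P mγ P-inv) ⟩
      conj X mγ               ≈⟨ conjXmγ≈M ⟩
      M                       ∎)
    where open ≈-Reasoning


module Iso (p : ℕ) .{{nz : NonZero p}} (p-prime : Prime p) (c d : D.Fp p)
               (irreducible : D.Irreducible p c d) (γ : D.K p) (generator : D.IsGenerator p c d γ)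
               (P : D.Mat p) (P-inv : D.Invertible p P) where

  open import Data.Product using (_,_; proj₁; proj₂)
  open import Data.Sum using (_⊎_; inj₁; inj₂)
  open import Relation.Binary.PropositionalEquality using (sym)
  open Matrices p
  open Projective p p-prime
  open Necklaces p p-prime
  open Generator p p-prime c d irreducible γ generator
  open Cartan p p-prime c d irreducible γ generator P P-inv

  Necklace : Set
  Necklace = D.ONecklace p c d γ

  _≈U_ : Lst → Lst → Set
  _≈U_ = D._≈U_ p

  module _ (x : Necklace) where

    list : Lst
    list = proj₁ x

    enumerates : EnumeratesLines list
    enumerates = let (nonzero , distinct , complete , _) = proj₂ x in
      record { nonzero = nonzero ; distinct = distinct ; complete = complete }

    private
      stepping = proj₂ (proj₂ (proj₂ (proj₂ x)))

    stepper : Mat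
    stepper = proj₁ stepping

    stepper-inv : Invertible stepper
    stepper-inv = proj₁ (proj₂ stepping)

    stepper-steps : Steps stepper list
    stepper-steps = steps (proj₂ (proj₂ (proj₂ stepping)))

    private
      stepper∈Cγ : D.InCγ p c d γ stepper
      stepper∈Cγ = proj₁ (proj₂ (proj₂ stepping))
      M = proj₁ stepper∈Cγ
      tr-det = charpoly≡minpoly⇒tr-det M (proj₂ (proj₂ stepper∈Cγ))
      representative = γ⟨⟩-surjective M (proj₁ tr-det) (proj₂ tr-det)

    coset : Mat
    coset = proj₁ representative

    coset-inv : Invertible coset
    coset-inv = proj₁ (proj₂ representative)

    γ⟨coset⟩≈stepper : γ⟨ coset ⟩ ≈ stepper
    γ⟨coset⟩≈stepper = ≈-trans (proj₂ (proj₂ representative)) (proj₁ (proj₂ stepper∈Cγ))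

  necklaceAt : ∀ g → Invertible g → Necklace
  necklaceAt g g-inv = necklaceOfCoset g , nonzero E , distinct E , complete E ,
    γ⟨ g ⟩ , γ⟨⟩-inv g g-inv , γ⟨⟩∈Cγ g g-inv , step (necklaceOfCoset-steps g g-inv)
    where E = necklaceOfCoset-enumerates g g-inv

  module _ (x y : Necklace) where

    ≈O⇒stepper≈ : list x ≈O list y → stepper x ≈ stepper y
    ≈O⇒stepper≈ = rotation⇒≈ (enumerates x) (enumerates y) (stepper-inv x) (stepper-inv y) (stepper-steps x) (stepper-steps y)

    stepper≈⇒≈O : stepper x ≈ stepper y → list x ≈O list y
    stepper≈⇒≈O = ≈⇒rotation (enumerates x) (enumerates y) (stepper-inv x) (stepper-inv y) (stepper-steps x) (stepper-steps y)

    ≈O-reverse⇒stepper≈adj : list x ≈O reverse (list y) → stepper x ≈ adj (stepper y)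
    ≈O-reverse⇒stepper≈adj = rotation⇒≈ (enumerates x) (EnumeratesLines-reverse (enumerates y)) (stepper-inv x)
      (Invertible-adj (stepper y) (stepper-inv y)) (stepper-steps x) (Steps-reverse (stepper-inv y) (stepper-steps y))

    stepper≈adj⇒≈O-reverse : stepper x ≈ adj (stepper y) → list x ≈O reverse (list y)
    stepper≈adj⇒≈O-reverse = ≈⇒rotation (enumerates x) (EnumeratesLines-reverse (enumerates y)) (stepper-inv x)
      (Invertible-adj (stepper y) (stepper-inv y)) (stepper-steps x) (Steps-reverse (stepper-inv y) (stepper-steps y))

    ≈O⇒γ⟨coset⟩≈ : list x ≈O list y → γ⟨ coset x ⟩ ≈ γ⟨ coset y ⟩
    ≈O⇒γ⟨coset⟩≈ x≈y = ≈-trans (γ⟨coset⟩≈stepper x) (≈-trans (≈O⇒stepper≈ x≈y) (≈-sym (γ⟨coset⟩≈stepper y)))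

    γ⟨coset⟩≈⇒≈O : γ⟨ coset x ⟩ ≈ γ⟨ coset y ⟩ → list x ≈O list y
    γ⟨coset⟩≈⇒≈O γx≈γy =
      stepper≈⇒≈O (≈-trans (≈-sym (γ⟨coset⟩≈stepper x)) (≈-trans γx≈γy (γ⟨coset⟩≈stepper y)))

    ≈O-reverse⇒γ⟨coset⟩≈adj : list x ≈O reverse (list y) → γ⟨ coset x ⟩ ≈ adj γ⟨ coset y ⟩
    ≈O-reverse⇒γ⟨coset⟩≈adj x≈y' = ≈-trans (γ⟨coset⟩≈stepper x)
      (≈-trans (≈O-reverse⇒stepper≈adj x≈y') (adj-cong (≈-sym (γ⟨coset⟩≈stepper y))))

    γ⟨coset⟩≈adj⇒≈O-reverse : γ⟨ coset x ⟩ ≈ adj γ⟨ coset y ⟩ → list x ≈O reverse (list y)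
    γ⟨coset⟩≈adj⇒≈O-reverse γx≈γy' = stepper≈adj⇒≈O-reverse
      (≈-trans (≈-sym (γ⟨coset⟩≈stepper x)) (≈-trans γx≈γy' (adj-cong (γ⟨coset⟩≈stepper y))))

  ≈adj-sym : ∀ {A B} → A ≈ adj B → B ≈ adj A
  ≈adj-sym {A} {B} A≈B' = ≈-trans (≡⇒≈ (sym (adj-involutive B))) (adj-cong (≈-sym A≈B'))

  -- The stepper of g·x is g (stepper x) g⁻¹.
  ≈O-act⇒γ⟨coset⟩≈ : ∀ g x y → Invertible g → list y ≈O act g (list x) → γ⟨ coset y ⟩ ≈ γ⟨ g ⊙ coset x ⟩
  ≈O-act⇒γ⟨coset⟩≈ g x y g-inv y≈gx = ≈-trans (γ⟨coset⟩≈stepper y) (≈-trans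
    (rotation⇒≈ (enumerates y) (EnumeratesLines-act g g-inv (enumerates x)) (stepper-inv y)
      (Invertible-conj g (stepper x) g-inv (stepper-inv x)) (stepper-steps y) (Steps-act g g-inv (stepper-steps x)) y≈gx)
    (≈-trans (conj-congʳ g (≈-sym (γ⟨coset⟩≈stepper x))) (≡⇒≈ (sym (conj-⊙ g (coset x) γP)))))

  ≈O-act-reverse⇒γ⟨coset⟩≈adj : ∀ g x y → Invertible g → list y ≈O reverse (act g (list x)) →
                                γ⟨ coset y ⟩ ≈ adj γ⟨ g ⊙ coset x ⟩
  ≈O-act-reverse⇒γ⟨coset⟩≈adj g x y g-inv y≈gx' = ≈-trans (γ⟨coset⟩≈stepper y) (≈-trans
    (rotation⇒≈ (enumerates y) (EnumeratesLines-reverse (EnumeratesLines-act g g-inv (enumerates x))) (stepper-inv y)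
      (Invertible-adj (conj g (stepper x)) gxg⁻¹-inv) (stepper-steps y)
      (Steps-reverse gxg⁻¹-inv (Steps-act g g-inv (stepper-steps x))) y≈gx')
    (adj-cong (≈-trans (conj-congʳ g (≈-sym (γ⟨coset⟩≈stepper x))) (≡⇒≈ (sym (conj-⊙ g (coset x) γP))))))
    where gxg⁻¹-inv = Invertible-conj g (stepper x) g-inv (stepper-inv x)

  cosetMap : Necklace → D.GL p
  cosetMap x = coset x , coset-inv x

  coset-necklaceAt : ∀ g g-inv → coset (necklaceAt g g-inv) ≈[H] g
  coset-necklaceAt g g-inv =
    γ⟨⟩≈⇒≈[H] (coset x) g (coset-inv x) g-inv (γ⟨coset⟩≈stepper x)
    where x = necklaceAt g g-inv

  orientedNecklaces≅G/H : D.GSetIsoToCosets p Necklace proj₁ (D._≈O_ p) H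
  orientedNecklaces≅G/H = record
    { f       = cosetMap
    ; f-cong  = λ x y x≈y → γ⟨⟩≈⇒≈[H] (coset x) (coset y) (coset-inv x) (coset-inv y) (≈O⇒γ⟨coset⟩≈ x y x≈y)
    ; f-inj   = λ x y fx≈fy → γ⟨coset⟩≈⇒≈O x y (≈[H]⇒γ⟨⟩≈ (coset x) (coset y) fx≈fy)
    ; f-surj  = λ (g , g-inv) → necklaceAt g g-inv , coset-necklaceAt g g-inv
    ; f-equiv = λ (g , g-inv) x y y≈gx → γ⟨⟩≈⇒≈[H] (coset y) (g ⊙ coset x) (coset-inv y)
                  (Invertible-⊙ g (coset x) g-inv (coset-inv x)) (≈O-act⇒γ⟨coset⟩≈ g x y g-inv y≈gx)
    }

  necklaces≅G/N : D.GSetIsoToCosets p Necklace proj₁ _≈U_ N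
  necklaces≅G/N = record
    { f       = cosetMap
    ; f-cong  = f-cong
    ; f-inj   = f-inj
    ; f-surj  = λ (g , g-inv) → necklaceAt g g-inv , ≈[H]⇒≈[N] (coset (necklaceAt g g-inv)) g (coset-necklaceAt g g-inv)
    ; f-equiv = f-equiv
    }
    where
    f-cong : ∀ x y → list x ≈U list y → coset x ≈[N] coset y
    f-cong x y (inj₁ x≈y)  = ≈[H]⇒≈[N] (coset x) (coset y) (D.GSetIsoToCosets.f-cong orientedNecklaces≅G/H x y x≈y)
    f-cong x y (inj₂ x≈y') = γ⟨⟩≈adj⇒≈[N] (coset x) (coset y) (coset-inv x) (coset-inv y)
                               (≈adj-sym (≈O-reverse⇒γ⟨coset⟩≈adj x y x≈y'))
    f-inj : ∀ x y → coset x ≈[N] coset y → list x ≈U list y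
    f-inj x y fx≈fy = by-cases (≈[N]⇒γ⟨⟩≈ (coset x) (coset y) fx≈fy)
      where
      by-cases : (γ⟨ coset y ⟩ ≈ γ⟨ coset x ⟩) ⊎ (γ⟨ coset y ⟩ ≈ adj γ⟨ coset x ⟩) → list x ≈U list y
      by-cases (inj₁ γy≈γx)  = inj₁ (γ⟨coset⟩≈⇒≈O x y (≈-sym γy≈γx))
      by-cases (inj₂ γy≈γx') = inj₂ (γ⟨coset⟩≈adj⇒≈O-reverse x y (≈adj-sym γy≈γx'))
    f-equiv : ∀ (g : D.GL p) x y → list y ≈U act (proj₁ g) (list x) → coset y ≈[N] (proj₁ g ⊙ coset x)
    f-equiv g x y (inj₁ y≈gx) =
      ≈[H]⇒≈[N] (coset y) (proj₁ g ⊙ coset x) (D.GSetIsoToCosets.f-equiv orientedNecklaces≅G/H g x y y≈gx)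
    f-equiv (g , g-inv) x y (inj₂ y≈gx') = γ⟨⟩≈adj⇒≈[N] (coset y) (g ⊙ coset x) (coset-inv y)
      (Invertible-⊙ g (coset x) g-inv (coset-inv x)) (≈adj-sym (≈O-act-reverse⇒γ⟨coset⟩≈adj g x y g-inv y≈gx'))


module Count (p : ℕ) .{{nz : NonZero p}} (p-prime : Prime p) (c d : D.Fp p)
                 (irreducible : D.Irreducible p c d) (γ : D.K p) (generator : D.IsGenerator p c d γ) where

  open import Data.Nat as ℕ using (zero; suc; _∸_; _<_; _≤_; s≤s; _%_; _/_)
  import Data.Nat.Properties as ℕ
  open import Data.Nat.DivMod using (m<n⇒m%n≡m; m%n<n; m≡m%n+[m/n]*n; m*n/n≡m)
  open import Data.Nat.Divisibility using (_∣_; m%n≡0⇒n∣m)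
  open import Data.Fin as Fin using (Fin; toℕ; fromℕ<; remQuot; combine)
  import Data.Fin.Properties as Fin
  open import Data.Product using (Σ; _×_; _,_; proj₁; proj₂; uncurry)
  open import Data.Sum using (inj₁; inj₂)
  open import Relation.Nullary using (¬_; Dec; yes; no; contradiction)
  open import Relation.Binary.PropositionalEquality using (_≡_; _≢_; refl; sym; trans; cong; cong₂; subst; module ≡-Reasoning)
  open ZMod p
  open Field p p-prime
  open Matrices p
  open Projective p p-prime
  open Necklaces p p-prime
  open QuadraticExtension p p-prime c d
  open Cartan p p-prime c d irreducible γ generator I Invertible-I
  open Iso p p-prime c d irreducible γ generator I Invertible-I

  borel : F → F → Mat
  borel a b = mat a b 0# 1#

  borel-inv : ∀ {a} b → a ≢ 0# → Invertible (borel a b)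
  borel-inv {a} b a≢0 det≡0 = a≢0 (trans (solve 2 (λ a b → a := a :* 𝟙 :- b :* 𝟘) refl a b) det≡0)

  cartan≡mulMat : ∀ z → cartan z ≡ mulMat z
  cartan≡mulMat z = trans (cong (λ Y → conj Y (mulMat z)) adj-I) (conj-I (mulMat z))

  σP≡σ : σP ≡ σ
  σP≡σ = trans (cong (λ Y → conj Y σ) adj-I) (conj-I σ)

  ≈[H]⇒≈⊙mulMat : ∀ g₁ g₂ → g₁ ≈[H] g₂ → Σ K λ z → g₂ ≈ g₁ ⊙ mulMat z
  ≈[H]⇒≈⊙mulMat g₁ _ (h , _ , h∈H , g₂≈g₁h) = let (z , _ , h≈) = ∈H⇒≈cartan h∈H in
    z , ≈-trans g₂≈g₁h (⊙-congʳ g₁ (≈-trans h≈ (≡⇒≈ (cartan≡mulMat z))))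

  -- Row 2 of borel a₁ b₁ · m_(x , y) is (y , x + c y), so l y = 0 and l x = 1.
  borel≡scaled-borel⊙mulMat : ∀ a₁ b₁ a₂ b₂ l x y → borel a₂ b₂ ≡ scale l (borel a₁ b₁ ⊙ mulMat (x , y)) →
                              (a₁ ≡ a₂) × (b₁ ≡ b₂)
  borel≡scaled-borel⊙mulMat a₁ b₁ a₂ b₂ l x y B₂≡ = sym a₂≡a₁ , sym b₂≡b₁
    where
    open ≡-Reasoning
    ly≡0 : l * y ≡ 0#
    ly≡0 = trans (solve 3 (λ l x y → l :* y := l :* (𝟘 :* x :+ 𝟙 :* y)) refl l x y) (sym (cong D.m₂₁ B₂≡))
    lx≡1 : l * x ≡ 1#
    lx≡1 = begin
      l * x                                    ≡⟨ solve 3 (λ l x c → l :* x := l :* x :+ c :* 𝟘) refl l x c ⟩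
      l * x + c * 0#                           ≡⟨ cong (λ t → l * x + c * t) ly≡0 ⟨
      l * x + c * (l * y)                      ≡⟨ solve 5 (λ l x y c d → l :* x :+ c :* (l :* y)
                                                     := l :* (𝟘 :* (d :* y) :+ 𝟙 :* (x :+ c :* y))) refl l x y c d ⟩
      l * (0# * (d * y) + 1# * (x + c * y))    ≡⟨ cong D.m₂₂ B₂≡ ⟨
      1#                                       ∎
    a₂≡a₁ : a₂ ≡ a₁
    a₂≡a₁ = begin
      a₂                                       ≡⟨ cong D.m₁₁ B₂≡ ⟩
      l * (a₁ * x + b₁ * y)                    ≡⟨ solve 5 (λ l a x b y → l :* (a :* x :+ b :* y) := l :* x :* a :+ l :* y :* b)
                                                     refl l a₁ x b₁ y ⟩
      l * x * a₁ + l * y * b₁                  ≡⟨ cong₂ (λ u v → u * a₁ + v * b₁) lx≡1 ly≡0 ⟩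
      1# * a₁ + 0# * b₁                        ≡⟨ solve 2 (λ a b → 𝟙 :* a :+ 𝟘 :* b := a) refl a₁ b₁ ⟩
      a₁                                       ∎
    b₂≡b₁ : b₂ ≡ b₁
    b₂≡b₁ = begin
      b₂                                       ≡⟨ cong D.m₁₂ B₂≡ ⟩
      l * (a₁ * (d * y) + b₁ * (x + c * y))    ≡⟨ solve 7 (λ l a d y b x c → l :* (a :* (d :* y) :+ b :* (x :+ c :* y))
                                                     := l :* x :* b :+ l :* y :* (a :* d :+ b :* c)) refl l a₁ d y b₁ x c ⟩
      l * x * b₁ + l * y * (a₁ * d + b₁ * c)   ≡⟨ cong₂ (λ u v → u * b₁ + v * (a₁ * d + b₁ * c)) lx≡1 ly≡0 ⟩
      1# * b₁ + 0# * (a₁ * d + b₁ * c)         ≡⟨ solve 4 (λ a b c d → 𝟙 :* b :+ 𝟘 :* (a :* d :+ b :* c) := b)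
                                                     refl a₁ b₁ c d ⟩
      b₁                                       ∎

  borel-≈[H]-injective : ∀ a₁ b₁ a₂ b₂ → borel a₁ b₁ ≈[H] borel a₂ b₂ → (a₁ ≡ a₂) × (b₁ ≡ b₂)
  borel-≈[H]-injective a₁ b₁ a₂ b₂ B₁≈B₂ =
    let ((x , y) , l , _ , B₂≡) = ≈[H]⇒≈⊙mulMat (borel a₁ b₁) (borel a₂ b₂) B₁≈B₂
    in borel≡scaled-borel⊙mulMat a₁ b₁ a₂ b₂ l x y B₂≡

  borel≡scaled-borel⊙σ⊙mulMat : ∀ a₁ b₁ a₂ b₂ l x y → borel a₁ b₁ ≡ scale l (borel a₂ b₂ ⊙ σ ⊙ mulMat (x , y)) →
                                a₁ + a₂ ≡ 0#
  borel≡scaled-borel⊙σ⊙mulMat a₁ b₁ a₂ b₂ l x y B₁≡ = begin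
    a₁ + a₂                                            ≡⟨ cong (_+ a₂) (cong D.m₁₁ B₁≡) ⟩
    l * ((a₂ * 1# + b₂ * 0#) * x + (a₂ * c + b₂ * (- 1#)) * y) + a₂
                                                       ≡⟨ solve 6 (λ l a b x y c →
                                                            l :* ((a :* 𝟙 :+ b :* 𝟘) :* x :+ (a :* c :+ b :* (:- 𝟙)) :* y) :+ a
                                                              := (l :* x :+ 𝟙) :* a :+ l :* y :* (a :* c :- b)) refl l a₂ b₂ x y c ⟩
    (l * x + 1#) * a₂ + l * y * (a₂ * c - b₂)          ≡⟨ cong₂ (λ u v → u * a₂ + v * (a₂ * c - b₂)) lx+1≡0 ly≡0 ⟩
    0# * a₂ + 0# * (a₂ * c - b₂)                       ≡⟨ solve 3 (λ a b c → 𝟘 :* a :+ 𝟘 :* (a :* c :- b) := 𝟘)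
                                                           refl a₂ b₂ c ⟩
    0#                                                 ∎
    where
    open ≡-Reasoning
    ly≡0 : l * y ≡ 0#
    ly≡0 = begin
      l * y            ≡⟨ solve 4 (λ l x y c → l :* y
                              := :- (l :* ((𝟘 :* 𝟙 :+ 𝟙 :* 𝟘) :* x :+ (𝟘 :* c :+ 𝟙 :* (:- 𝟙)) :* y))) refl l x y c ⟩
      - (l * ((0# * 1# + 1# * 0#) * x + (0# * c + 1# * (- 1#)) * y)) ≡⟨ cong (-_) (cong D.m₂₁ B₁≡) ⟨
      - 0#             ≡⟨ -0#≈0# ⟩
      0#               ∎
    lx+1≡0 : l * x + 1# ≡ 0#
    lx+1≡0 = begin
      l * x + 1#       ≡⟨ cong (l * x +_) (cong D.m₂₂ B₁≡) ⟩
      l * x + l * ((0# * 1# + 1# * 0#) * (d * y) + (0# * c + 1# * (- 1#)) * (x + c * y))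
                       ≡⟨ solve 5 (λ l x y c d →
                              l :* x :+ l :* ((𝟘 :* 𝟙 :+ 𝟙 :* 𝟘) :* (d :* y) :+ (𝟘 :* c :+ 𝟙 :* (:- 𝟙)) :* (x :+ c :* y))
                              := :- (c :* (l :* y))) refl l x y c d ⟩
      - (c * (l * y))  ≡⟨ cong (λ t → - (c * t)) ly≡0 ⟩
      - (c * 0#)       ≡⟨ solve 1 (λ c → :- (c :* 𝟘) := 𝟘) refl c ⟩
      0#               ∎

  borel⊙σP-≈[H]⇒+≡0 : ∀ a₁ b₁ a₂ b₂ → (borel a₂ b₂ ⊙ σP) ≈[H] borel a₁ b₁ → a₁ + a₂ ≡ 0#
  borel⊙σP-≈[H]⇒+≡0 a₁ b₁ a₂ b₂ B₂σ≈B₁ =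
    let ((x , y) , B₁≈) = ≈[H]⇒≈⊙mulMat (borel a₂ b₂ ⊙ σP) (borel a₁ b₁) B₂σ≈B₁
        (l , _ , B₁≡) = ≈-trans B₁≈ (≡⇒≈ (cong (λ S → borel a₂ b₂ ⊙ S ⊙ mulMat (x , y)) σP≡σ))
    in borel≡scaled-borel⊙σ⊙mulMat a₁ b₁ a₂ b₂ l x y B₁≡

  borel⊙σ : ∀ a b → borel (- a) (b - a * c) ⊙ σ ≡ scale (- 1#) (borel a b)
  borel⊙σ a b = mat-cong
    (solve 3 (λ a b c → (:- a) :* 𝟙 :+ (b :- a :* c) :* 𝟘 := (:- 𝟙) :* a) refl a b c)
    (solve 3 (λ a b c → (:- a) :* c :+ (b :- a :* c) :* (:- 𝟙) := (:- 𝟙) :* b) refl a b c)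
    (solve 0 (𝟘 :* 𝟙 :+ 𝟙 :* 𝟘 := (:- 𝟙) :* 𝟘) refl)
    (solve 1 (λ c → 𝟘 :* c :+ 𝟙 :* (:- 𝟙) := (:- 𝟙) :* 𝟙) refl c)

  -- Right multiplication by m_z with z = (g₂₂ , −g₂₁) clears the lower-left entry of g.
  borel-representative : ∀ g → Invertible g → Σ F λ a → Σ F λ b → (a ≢ 0#) × (g ≈[H] borel a b)
  borel-representative g@(mat g₁₁ g₁₂ g₂₁ g₂₂) g-inv =
    u * s⁻¹ , v * s⁻¹ , x≢0∧y≢0⇒x*y≢0 u≢0 (⁻¹-≢0 s s≢0) ,
    (mulMat z , mz-inv , ≈cartan⇒∈H z z≢0 (≡⇒≈ (sym (cartan≡mulMat z))) , ≈-sym (s , s≢0 , gmz≡sB))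
    where
    open ≡-Reasoning
    z : K
    z = g₂₂ , - g₂₁
    z≢0 : z ≢ 0K
    z≢0 z≡0 = g-inv (begin
      g₁₁ * g₂₂ - g₁₂ * g₂₁        ≡⟨ cong₂ (λ s t → g₁₁ * s - g₁₂ * t) (cong proj₁ z≡0)
                                        (trans (sym (-‿involutive g₂₁)) (trans (cong (-_) (cong proj₂ z≡0)) -0#≈0#)) ⟩
      g₁₁ * 0# - g₁₂ * 0#          ≡⟨ solve 2 (λ a b → a :* 𝟘 :- b :* 𝟘 := 𝟘) refl g₁₁ g₁₂ ⟩
      0#                           ∎)
    mz-inv : Invertible (mulMat z)
    mz-inv det≡0 = norm-≢0 irreducible z z≢0 (trans (sym (det-mulMat z)) det≡0)
    u = g₁₁ * g₂₂ + g₁₂ * (- g₂₁)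
    v = g₁₁ * (d * (- g₂₁)) + g₁₂ * (g₂₂ + c * (- g₂₁))
    s = g₂₁ * (d * (- g₂₁)) + g₂₂ * (g₂₂ + c * (- g₂₁))
    lower-left≡0 : g₂₁ * g₂₂ + g₂₂ * (- g₂₁) ≡ 0#
    lower-left≡0 = solve 2 (λ a b → a :* b :+ b :* (:- a) := 𝟘) refl g₂₁ g₂₂
    us≢0 : u * s ≢ 0#
    us≢0 us≡0 = Invertible-⊙ g (mulMat z) g-inv mz-inv (begin
      u * s - v * (g₂₁ * g₂₂ + g₂₂ * (- g₂₁))   ≡⟨ cong (λ t → u * s - v * t) lower-left≡0 ⟩
      u * s - v * 0#                            ≡⟨ solve 3 (λ u s v → u :* s :- v :* 𝟘 := u :* s) refl u s v ⟩
      u * s                                     ≡⟨ us≡0 ⟩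
      0#                                        ∎)
    s≢0 : s ≢ 0#
    s≢0 s≡0 = us≢0 (trans (cong (u *_) s≡0) (zeroʳ u))
    u≢0 : u ≢ 0#
    u≢0 u≡0 = us≢0 (trans (cong (_* s) u≡0) (zeroˡ s))
    s⁻¹ = s ⁻¹[ s≢0 ]
    gmz≡sB : g ⊙ mulMat z ≡ scale s (borel (u * s⁻¹) (v * s⁻¹))
    gmz≡sB = mat-cong (sym (*-⁻¹-cancel u s s≢0)) (sym (*-⁻¹-cancel v s s≢0))
                      (trans lower-left≡0 (sym (zeroʳ s))) (sym (*-identityʳ s))

  borelForm : ∀ x → Σ F λ a → Σ F λ b → (a ≢ 0#) × (γ⟨ borel a b ⟩ ≈ stepper x)
  borelForm x = let (a , b , a≢0 , g≈[H]B) = borel-representative (coset x) (coset-inv x) in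
    a , b , a≢0 , ≈-trans (≈-sym (≈[H]⇒γ⟨⟩≈ (coset x) (borel a b) g≈[H]B)) (γ⟨coset⟩≈stepper x)

  toℕ>0 : ∀ a → a ≢ 0# → 0 < toℕ a
  toℕ>0 a a≢0 = ℕ.n≢0⇒n>0 (λ toℕa≡0 → a≢0 (toℕ≡0⇒≡0# a toℕa≡0))

  private
    predFin : ∀ {m} n → 0 < n → n ≤ m → Fin m
    predFin (suc k) _ k<m = fromℕ< k<m

    suc-toℕ-predFin : ∀ {m} n (n>0 : 0 < n) (n≤m : n ≤ m) → suc (toℕ (predFin n n>0 n≤m)) ≡ n
    suc-toℕ-predFin (suc k) _ k<m = cong suc (Fin.toℕ-fromℕ< k<m)

  -- The elements 1, …, m of F, for m < p, indexed by Fin m.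
  module SmallUnits (m : ℕ) (m<p : m < p) where

    unit : Fin m → F
    unit j = fromℕ< (ℕ.≤-<-trans (Fin.toℕ<n j) m<p)

    toℕ-unit : ∀ j → toℕ (unit j) ≡ suc (toℕ j)
    toℕ-unit j = Fin.toℕ-fromℕ< _

    unit-≢0 : ∀ j → unit j ≢ 0#
    unit-≢0 j unit≡0 = ℕ.1+n≢0 (trans (sym (toℕ-unit j)) (trans (cong toℕ unit≡0) toℕ-0#))

    unit-injective : ∀ {j j'} → unit j ≡ unit j' → j ≡ j'
    unit-injective {j} {j'} eq = Fin.toℕ-injective (ℕ.suc-injective (trans (sym (toℕ-unit j)) (trans (cong toℕ eq) (toℕ-unit j'))))

    unitIndex : ∀ a → a ≢ 0# → toℕ a ≤ m → Fin m
    unitIndex a a≢0 = predFin (toℕ a) (toℕ>0 a a≢0)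

    unit-unitIndex : ∀ a a≢0 a≤m → unit (unitIndex a a≢0 a≤m) ≡ a
    unit-unitIndex a a≢0 a≤m = Fin.toℕ-injective (trans (toℕ-unit _) (suc-toℕ-predFin (toℕ a) (toℕ>0 a a≢0) a≤m))

  -- Fin (p * m) enumerates the Borel matrices borel a b with b ∈ F and a ∈ {1, …, m}.
  module BorelEnumeration (m : ℕ) (m<p : m < p) where
    open SmallUnits m m<p public

    borelAt : Fin p × Fin m → Mat
    borelAt (b , j) = borel (unit j) b

    borelAt-inv : ∀ r → Invertible (borelAt r)
    borelAt-inv (b , j) = borel-inv b (unit-≢0 j)

    necklaceNo : Fin (p ℕ.* m) → Necklace
    necklaceNo i = necklaceAt (borelAt (remQuot m i)) (borelAt-inv (remQuot m i))

    ≈[H]⇒same-index : ∀ i i' → borelAt (remQuot m i) ≈[H] borelAt (remQuot m i') → i ≡ i'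
    ≈[H]⇒same-index i i' B≈B' =
      let (b , j) = remQuot {p} m i
          (b' , j') = remQuot {p} m i'
          (unitj≡unitj' , b≡b') = borel-≈[H]-injective (unit j) b (unit j') b' B≈B'
      in trans (sym (Fin.combine-remQuot {p} m i))
           (trans (cong (uncurry combine) (cong₂ _,_ b≡b' (unit-injective unitj≡unitj'))) (Fin.combine-remQuot {p} m i'))

    borelAt-index : ∀ a b a≢0 a≤m → borelAt (remQuot m (combine b (unitIndex a a≢0 a≤m))) ≡ borel a b
    borelAt-index a b a≢0 a≤m = trans (cong borelAt (Fin.remQuot-combine b (unitIndex a a≢0 a≤m)))
                                      (cong (λ u → borel u b) (unit-unitIndex a a≢0 a≤m))

    necklaceNo-≈O⇒≡ : ∀ i i' → list (necklaceNo i) ≈O list (necklaceNo i') → i ≡ i'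
    necklaceNo-≈O⇒≡ i i' i≈i' = ≈[H]⇒same-index i i'
      (γ⟨⟩≈⇒≈[H] (borelAt (remQuot m i)) (borelAt (remQuot m i')) (borelAt-inv (remQuot m i)) (borelAt-inv (remQuot m i'))
        (≈O⇒stepper≈ (necklaceNo i) (necklaceNo i') i≈i'))

    necklaceNo-hits : ∀ x a b a≢0 a≤m → γ⟨ borel a b ⟩ ≈ stepper x →
                      list (necklaceNo (combine b (unitIndex a a≢0 a≤m))) ≈O list x
    necklaceNo-hits x a b a≢0 a≤m γB≈ =
      stepper≈⇒≈O (necklaceNo i) x (≈-trans (≡⇒≈ (cong γ⟨_⟩ (borelAt-index a b a≢0 a≤m))) γB≈)
      where i = combine b (unitIndex a a≢0 a≤m)

  n∸1<n : ∀ n → .{{NonZero n}} → n ∸ 1 < n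
  n∸1<n (suc n) = ℕ.n<1+n n

  m<n⇒m≤n∸1 : ∀ {m n} → m < n → m ≤ n ∸ 1
  m<n⇒m≤n∸1 (s≤s m≤n) = m≤n

  orientedCount : D.HasExactly p (p ℕ.* (p ∸ 1)) Necklace proj₁ (D._≈O_ p)
  orientedCount = record
    { e      = necklaceNo
    ; e-inj  = necklaceNo-≈O⇒≡
    ; e-surj = λ x → let (a , b , a≢0 , γB≈) = borelForm x
                         a≤p∸1 = m<n⇒m≤n∸1 (Fin.toℕ<n a)
                     in combine b (unitIndex a a≢0 a≤p∸1) , necklaceNo-hits x a b a≢0 a≤p∸1 γB≈ }
    where
    open BorelEnumeration (p ∸ 1) (n∸1<n p)

  module _ (p-odd : ¬ (2 ∣ p)) where

    half : ℕ
    half = p / 2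

    p≡1+half+half : p ≡ suc (half ℕ.+ half)
    p≡1+half+half = begin
      p                         ≡⟨ m≡m%n+[m/n]*n p 2 ⟩
      p % 2 ℕ.+ half ℕ.* 2      ≡⟨ cong₂ ℕ._+_ p%2≡1 (ℕ.*-comm half 2) ⟩
      1 ℕ.+ 2 ℕ.* half          ≡⟨ cong (λ k → suc (half ℕ.+ k)) (ℕ.+-identityʳ half) ⟩
      suc (half ℕ.+ half)       ∎
      where
      open ≡-Reasoning
      p%2≡1 : p % 2 ≡ 1
      p%2≡1 with p % 2 in eq | m%n<n p 2
      ... | zero        | _ = contradiction (m%n≡0⇒n∣m p 2 eq) p-odd
      ... | suc zero    | _ = refl
      ... | suc (suc _) | s≤s (s≤s ())

    half<p : half < p
    half<p = subst (half <_) (sym p≡1+half+half) (s≤s (ℕ.m≤m+n half half))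

    count≡p*half : (p ℕ.* (p ∸ 1)) / 2 ≡ p ℕ.* half
    count≡p*half = begin
      p ℕ.* (p ∸ 1) / 2         ≡⟨ cong (λ k → p ℕ.* (k ∸ 1) / 2) p≡1+half+half ⟩
      p ℕ.* (half ℕ.+ half) / 2 ≡⟨ cong (λ k → p ℕ.* k / 2) (trans (ℕ.*-comm half 2) (cong (half ℕ.+_) (ℕ.+-identityʳ half))) ⟨
      p ℕ.* (half ℕ.* 2) / 2    ≡⟨ cong (_/ 2) (ℕ.*-assoc p half 2) ⟨
      p ℕ.* half ℕ.* 2 / 2      ≡⟨ m*n/n≡m (p ℕ.* half) 2 ⟩
      p ℕ.* half                ∎
      where open ≡-Reasoning

    open BorelEnumeration half half<p

    -- 2 ≤ a + a' ≤ 2·half < p for a, a' ∈ {1, …, half}.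
    unit+unit≢0 : ∀ j j' → unit j + unit j' ≢ 0#
    unit+unit≢0 j j' sum≡0 = ℕ.1+n≢0 (begin
      suc (toℕ j) ℕ.+ suc (toℕ j')                ≡⟨ m<n⇒m%n≡m sum<p ⟨
      (suc (toℕ j) ℕ.+ suc (toℕ j')) % p          ≡⟨ cong₂ (λ u v → (u ℕ.+ v) % p) (toℕ-unit j) (toℕ-unit j') ⟨
      (toℕ (unit j) ℕ.+ toℕ (unit j')) % p        ≡⟨ toℕ-⟦⟧ _ ⟨
      toℕ (unit j + unit j')                      ≡⟨ cong toℕ sum≡0 ⟩
      toℕ 0#                                      ≡⟨ toℕ-0# ⟩
      0                                           ∎)
      where
      open ≡-Reasoning
      sum<p : suc (toℕ j) ℕ.+ suc (toℕ j') < p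
      sum<p = subst (suc (toℕ j) ℕ.+ suc (toℕ j') <_) (sym p≡1+half+half)
                (s≤s (ℕ.+-mono-≤ (Fin.toℕ<n j) (Fin.toℕ<n j')))

    -- −a = p − a lies in {1, …, half} when a does not.
    toℕ-neg≤half : ∀ a → a ≢ 0# → ¬ (toℕ a ≤ half) → toℕ (- a) ≤ half
    toℕ-neg≤half a a≢0 a≰half = begin
      toℕ (- a)                     ≡⟨ toℕ-⟦⟧ (p ∸ toℕ a) ⟩
      (p ∸ toℕ a) % p               ≡⟨ m<n⇒m%n≡m (ℕ.∸-monoʳ-< (toℕ>0 a a≢0) (ℕ.<⇒≤ (Fin.toℕ<n a))) ⟩
      p ∸ toℕ a                     ≤⟨ ℕ.∸-monoʳ-≤ p (ℕ.≰⇒> a≰half) ⟩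
      p ∸ suc half                  ≡⟨ cong (_∸ suc half) p≡1+half+half ⟩
      half ℕ.+ half ∸ half          ≡⟨ ℕ.m+n∸m≡n half half ⟩
      half                          ∎
      where open ℕ.≤-Reasoning

    unorientedCount : D.HasExactly p (p ℕ.* (p ∸ 1) / 2) Necklace proj₁ _≈U_
    unorientedCount = subst (λ n → D.HasExactly p n Necklace proj₁ _≈U_) (sym count≡p*half)
      record { e = necklaceNo ; e-inj = e-inj ; e-surj = e-surj }
      where
      e-inj : ∀ i i' → list (necklaceNo i) ≈U list (necklaceNo i') → i ≡ i'
      e-inj i i' (inj₁ i≈i')  = necklaceNo-≈O⇒≡ i i' i≈i'
      e-inj i i' (inj₂ i≈i'ʳ) =
        let (b , j) = remQuot {p} half i
            (b' , j') = remQuot {p} half i'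
            γB≈γB'⊙σP = ≈-trans (≈O-reverse⇒stepper≈adj (necklaceNo i) (necklaceNo i') i≈i'ʳ)
                                (≈-sym (γ⟨⊙σP⟩ (borel (unit j') b')))
        in contradiction (borel⊙σP-≈[H]⇒+≡0 (unit j) b (unit j') b'
             (γ⟨⟩≈⇒≈[H] (borel (unit j') b' ⊙ σP) (borel (unit j) b)
               (Invertible-⊙ (borel (unit j') b') σP (borel-inv b' (unit-≢0 j')) σP-inv) (borel-inv b (unit-≢0 j))
               (≈-sym γB≈γB'⊙σP)))
           (unit+unit≢0 j j')
      e-surj : ∀ x → Σ (Fin (p ℕ.* half)) λ i → list (necklaceNo i) ≈U list x
      e-surj x = let (a , b , a≢0 , γB≈) = borelForm x in by-cases a b a≢0 γB≈ (toℕ a ℕ.≤? half)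
        where
        by-cases : ∀ a b → a ≢ 0# → γ⟨ borel a b ⟩ ≈ stepper x → Dec (toℕ a ≤ half) →
                   Σ (Fin (p ℕ.* half)) λ i → list (necklaceNo i) ≈U list x
        by-cases a b a≢0 γB≈ (yes a≤half) = combine b (unitIndex a a≢0 a≤half) , inj₁ (necklaceNo-hits x a b a≢0 a≤half γB≈)
        by-cases a b a≢0 γB≈ (no a≰half)  =
          i , inj₂ (stepper≈adj⇒≈O-reverse (necklaceNo i) x
                      (≈-trans (≡⇒≈ (cong γ⟨_⟩ (borelAt-index a' b' a'≢0 a'≤half))) (≈adj-sym x≈adjγB')))
          where
          a' = - a
          b' = b - a * c
          a'≢0 : a' ≢ 0#
          a'≢0 -a≡0 = a≢0 (trans (sym (-‿involutive a)) (trans (cong (-_) -a≡0) -0#≈0#))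
          a'≤half = toℕ-neg≤half a a≢0 a≰half
          i = combine b' (unitIndex a' a'≢0 a'≤half)
          -1≢0 : - 1# ≢ 0#
          -1≢0 -1≡0 = 1≢0 (trans (sym (-‿involutive 1#)) (trans (cong (-_) -1≡0) -0#≈0#))
          B'σP≈B : borel a' b' ⊙ σP ≈ borel a b
          B'σP≈B = ≈-trans (≡⇒≈ (trans (cong (borel a' b' ⊙_) σP≡σ) (borel⊙σ a b))) (scale≈ (borel a b) -1≢0)
          x≈adjγB' : stepper x ≈ adj γ⟨ borel a' b' ⟩
          x≈adjγB' = ≈-trans (≈-sym γB≈) (≈-trans (≈-sym (conj-congˡ γP B'σP≈B)) (γ⟨⊙σP⟩ (borel a' b')))


open import Defs
open import Data.Nat using (ℕ; _*_; _∸_; _/_; NonZero)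
open import Data.Nat.Primality using (Prime)
open import Data.Nat.Divisibility using (_∣_)
open import Data.Product using (_×_; proj₁; _,_)
open import Relation.Nullary using (¬_)

mainTheorem3 : (p : ℕ) .{{nz : NonZero p}} → Prime p → ¬ (2 ∣ p)
    → (c d : Fp p) → Irreducible p c d
    → (γ : K p) → IsGenerator p c d γ
    → ((P : Mat p) → Invertible p P
         → GSetIsoToCosets p (ONecklace p c d γ) proj₁ (_≈O_ p) (NonsplitCartan p c d P))
    × ((P : Mat p) → Invertible p P
         → GSetIsoToCosets p (ONecklace p c d γ) proj₁ (_≈U_ p)
             (Normaliser p (NonsplitCartan p c d P)))
    × HasExactly p (p * (p ∸ 1)) (ONecklace p c d γ) proj₁ (_≈O_ p)
    × HasExactly p ((p * (p ∸ 1)) / 2) (ONecklace p c d γ) proj₁ (_≈U_ p)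
mainTheorem3 p p-prime p-odd c d irreducible γ generator =
  orientedNecklaces≅G/H , necklaces≅G/N , orientedCount , unorientedCount p-odd
  where
  open Iso p p-prime c d irreducible γ generator using (orientedNecklaces≅G/H; necklaces≅G/N)
  open Count p p-prime c d irreducible γ generator using (orientedCount; unorientedCount)
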